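{- The double coset space $P(\mathbb{Q})\backslash\mathrm{GSp}_6(\mathbb{Q})/H(\mathbb{Q})$, identified with the set of $H(\mathbb{Q})$-orbits on partial isotropic flags $F_2\subset F_3$ in $V$ (with $\dim F_i=i$), consists of exactly five elements, represented by the flags (1) $\langle f_2,f_3\rangle\subset\langle f_1,f_2,f_3\rangle$; (2) $\langle f_1,f_2\rangle\subset\langle f_1,f_2,f_3\rangle$; (3) $\langle f_1+f_2,f_3\rangle\subset\langle f_1,f_2,f_3\rangle$; (4) $\langle f_1+f_2,f_3\rangle\subset\langle f_1+f_2,e_1-e_2,f_3\rangle$; (5) $\langle f_1+f_2,e_1-e_2\rangle\subset\langle f_1+f_2,e_1-e_2,f_3\rangle$.
   Context: $V=\mathbb{Q}^6$ with basis $e_1,e_2,e_3,f_3,f_2,f_1$ and symplectic form $\langle e_i,f_j\rangle=\delta_{ij}$, $\langle e_i,e_j\rangle=\langle f_i,f_j\rangle=0$; $\mathrm{GSp}_6$ acts on the right. $H=\mathrm{GL}_2\boxtimes\mathrm{GSp}_4=\{(g_1,g_2)\in\mathrm{GL}_2\times\mathrm{GSp}_4:\det g_1=\mu(g_2)\}$ embedded in $\mathrm{GSp}_6$ via $\mathrm{GL}_2=\mathrm{GSp}_2$ acting on $\langle e_1,f_1\rangle$ and $\mathrm{GSp}_4$ acting on $\langle e_2,e_3,f_3,f_2\rangle$. $P$ is the stabilizer of the flag $\langle f_1,f_2\rangle\subset\langle f_1,f_2,f_3\rangle$, so $P(\mathbb{Q})\backslash\mathrm{GSp}_6(\mathbb{Q})$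 is the set of isotropic flags $F_2\subset F_3$. -}

module Defs where

open import Data.Nat using (ℕ; zero; suc)
open import Data.Fin using (Fin; zero; suc)
open import Data.Rational using (ℚ; 0ℚ; 1ℚ; _+_; _*_; _-_; -_)
open import Data.Product using (Σ; ∃; ∃-syntax; _×_; _,_)
open import Data.Sum using (_⊎_; inj₁; inj₂)
open import Relation.Binary.PropositionalEquality using (_≡_; _≢_)

-- Linear algebra over ℚ (row vectors, matrices acting on the right)

Vect : ℕ → Set
Vect n = Fin n → ℚ

Mat : ℕ → Set
Mat n = Fin n → Fin n → ℚ

sumFin : (k : ℕ) → (Fin k → ℚ) → ℚ
sumFin zero    f = 0ℚ
sumFin (suc k) f = f zero + sumFin k (λ i → f (suc i))

δ : {n : ℕ} → Fin n → Fin n → ℚ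
δ zero    zero    = 1ℚ
δ zero    (suc j) = 0ℚ
δ (suc i) zero    = 0ℚ
δ (suc i) (suc j) = δ i j

_·_ : {n : ℕ} → Vect n → Mat n → Vect n
_·_ {n} v g j = sumFin n (λ i → v i * g i j)

_⊗_ : {n : ℕ} → Mat n → Mat n → Mat n
_⊗_ {n} a b i j = sumFin n (λ k → a i k * b k j)

Invertible : {n : ℕ} → Mat n → Set
Invertible {n} g = ∃[ g' ] ((∀ i j → (g ⊗ g') i j ≡ δ i j) × (∀ i j → (g' ⊗ g) i j ≡ δ i j))

lincomb : {n k : ℕ} → (Fin k → ℚ) → (Fin k → Vect n) → Vect n
lincomb {n} {k} c vs j = sumFin k (λ i → c i * vs i j)

InSpan : {n k : ℕ} → (Fin k → Vect n) → Vect n → Set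
InSpan vs x = ∃[ c ] (∀ j → x j ≡ lincomb c vs j)

LinIndep : {n k : ℕ} → (Fin k → Vect n) → Set
LinIndep vs = ∀ c → (∀ j → lincomb c vs j ≡ 0ℚ) → ∀ i → c i ≡ 0ℚ

SameSpan : {n k l : ℕ} → (Fin k → Vect n) → (Fin l → Vect n) → Set
SameSpan {n} as bs = (x : Vect n) → (InSpan as x → InSpan bs x) × (InSpan bs x → InSpan as x)

-- V = ℚ^6 with ordered basis e1,e2,e3,f3,f2,f1  (indices 0..5)

V : Set
V = Vect 6

mk6 : ℚ → ℚ → ℚ → ℚ → ℚ → ℚ → V
mk6 a b c d e f zero = a
mk6 a b c d e f (suc zero) = b
mk6 a b c d e f (suc (suc zero)) = c
mk6 a b c d e f (suc (suc (suc zero))) = d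
mk6 a b c d e f (suc (suc (suc (suc zero)))) = e
mk6 a b c d e f (suc (suc (suc (suc (suc zero))))) = f

e₁ e₂ e₃ f₃ f₂ f₁ : V
e₁ = mk6 1ℚ 0ℚ 0ℚ 0ℚ 0ℚ 0ℚ
e₂ = mk6 0ℚ 1ℚ 0ℚ 0ℚ 0ℚ 0ℚ
e₃ = mk6 0ℚ 0ℚ 1ℚ 0ℚ 0ℚ 0ℚ
f₃ = mk6 0ℚ 0ℚ 0ℚ 1ℚ 0ℚ 0ℚ
f₂ = mk6 0ℚ 0ℚ 0ℚ 0ℚ 1ℚ 0ℚ
f₁ = mk6 0ℚ 0ℚ 0ℚ 0ℚ 0ℚ 1ℚ

_⊕_ _⊖_ : V → V → V
(v ⊕ w) j = v j + w j
(v ⊖ w) j = v j - w j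

-- symplectic form: ⟨e_i,f_j⟩ = δ_ij, ⟨e_i,e_j⟩ = ⟨f_i,f_j⟩ = 0, alternating
ω : V → V → ℚ
ω v w = ((v 0F * w 5F + v 1F * w 4F) + v 2F * w 3F)
      - ((v 5F * w 0F + v 4F * w 1F) + v 3F * w 2F)
  where
  0F 1F 2F 3F 4F 5F : Fin 6
  0F = zero
  1F = suc zero
  2F = suc (suc zero)
  3F = suc (suc (suc zero))
  4F = suc (suc (suc (suc zero)))
  5F = suc (suc (suc (suc (suc zero))))

-- GSp4 on ⟨e2,e3,f3,f2⟩ (local indices 0..3), with the restricted form
ω₄ : Vect 4 → Vect 4 → ℚ
ω₄ v w = (v zero * w (suc (suc (suc zero))) + v (suc zero) * w (suc (suc zero)))
       - (v (suc (suc (suc zero))) * w zero + v (suc (suc zero)) * w (suc zero))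

IsGSp4 : Mat 4 → ℚ → Set
IsGSp4 g μ = (μ ≢ 0ℚ) × Invertible g × (∀ v w → ω₄ (v · g) (w · g) ≡ μ * ω₄ v w)

det₂ : Mat 2 → ℚ
det₂ a = a zero zero * a (suc zero) (suc zero) - a zero (suc zero) * a (suc zero) zero

IsGL2 : Mat 2 → Set
IsGL2 a = det₂ a ≢ 0ℚ

-- position of each basis vector of V in ⟨e1,f1⟩ (local basis e1,f1)
-- or in ⟨e2,e3,f3,f2⟩ (local basis e2,e3,f3,f2)
block : Fin 6 → Fin 2 ⊎ Fin 4
block zero = inj₁ zero
block (suc zero) = inj₂ zero
block (suc (suc zero)) = inj₂ (suc zero)
block (suc (suc (suc zero))) = inj₂ (suc (suc zero))
block (suc (suc (suc (suc zero)))) = inj₂ (suc (suc (suc zero)))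
block (suc (suc (suc (suc (suc zero))))) = inj₁ (suc zero)

embedEntry : Mat 2 → Mat 4 → Fin 2 ⊎ Fin 4 → Fin 2 ⊎ Fin 4 → ℚ
embedEntry a b (inj₁ i) (inj₁ j) = a i j
embedEntry a b (inj₁ i) (inj₂ j) = 0ℚ
embedEntry a b (inj₂ i) (inj₁ j) = 0ℚ
embedEntry a b (inj₂ i) (inj₂ j) = b i j

embed : Mat 2 → Mat 4 → Mat 6
embed a b i j = embedEntry a b (block i) (block j)

InH : Mat 2 → Mat 4 → Set
InH g₁ g₂ = IsGL2 g₁ × Σ ℚ (λ μ → IsGSp4 g₂ μ × det₂ g₁ ≡ μ)

record Flag : Set where
  constructor flag
  field
    F2 : Fin 2 → V
    F3 : Fin 3 → V
open Flag public

Isotropic : {k : ℕ} → (Fin k → V) → Set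
Isotropic vs = ∀ x y → InSpan vs x → InSpan vs y → ω x y ≡ 0ℚ

IsIsotropicFlag : Flag → Set
IsIsotropicFlag F =
  LinIndep (F2 F) × LinIndep (F3 F) × (∀ i → InSpan (F3 F) (F2 F i)) × Isotropic (F3 F)

_▹_ : Flag → Mat 6 → Flag
F ▹ g = flag (λ i → F2 F i · g) (λ i → F3 F i · g)

_≅F_ : Flag → Flag → Set
F ≅F G = SameSpan (F2 F) (F2 G) × SameSpan (F3 F) (F3 G)

SameHOrbit : Flag → Flag → Set
SameHOrbit F G = ∃[ g₁ ] ∃[ g₂ ] (InH g₁ g₂ × (F ▹ embed g₁ g₂) ≅F G)

v2 : V → V → Fin 2 → V
v2 a b zero = a
v2 a b (suc zero) = b

v3 : V → V → V → Fin 3 → V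
v3 a b c zero = a
v3 a b c (suc zero) = b
v3 a b c (suc (suc zero)) = c

rep : Fin 5 → Flag
rep zero = flag (v2 f₂ f₃) (v3 f₁ f₂ f₃)
rep (suc zero) = flag (v2 f₁ f₂) (v3 f₁ f₂ f₃)
rep (suc (suc zero)) = flag (v2 (f₁ ⊕ f₂) f₃) (v3 f₁ f₂ f₃)
rep (suc (suc (suc zero))) = flag (v2 (f₁ ⊕ f₂) f₃) (v3 (f₁ ⊕ f₂) (e₁ ⊖ e₂) f₃)
rep (suc (suc (suc (suc zero)))) = flag (v2 (f₁ ⊕ f₂) (e₁ ⊖ e₂)) (v3 (f₁ ⊕ f₂) (e₁ ⊖ e₂) f₃)

-- V = W₁ ⊕ W₂ with W₁ = ⟨e₁, f₁⟩ and W₂ = ⟨e₂, e₃, f₃, f₂⟩, and H acts blockwise: an element of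
-- H amounts to a basis (E₁, F₁) of W₁ together with a basis (E₂, E₃, F₃, F₂) of W₂ on which ω
-- pairs like e₂, e₃, f₃, f₂ up to the factor ω₁(E₁, F₁).  Every isotropic flag F₂ ⊂ F₃ has a
-- basis adapted to the decomposition: if F₂ projects onto W₁ it is an image of representative 4;
-- otherwise F₂ contains a nonzero z ∈ W₂, and according as F₃ projects onto W₁, F₂ ⊆ W₂, or
-- F₃ ∩ W₂ is a Lagrangian plane of W₂ (with F₂ meeting W₁ or not), of representative 3, 0, 1
-- or 2.  The W₂-parts of the adapted basis complete to a symplectic basis of W₂, which gives
-- the element of H.  The orbits are distinct because F₂ ⊆ W₂, F₂ ∩ W₁ ≠ 0, F₃ ∩ W₁ ≠ 0 and
-- F₂ ∩ W₂ ≠ 0 are H-invariant conditions that separate the representatives.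

module Submission where

open import Defs
open import Level using (0ℓ)
open import Algebra.Bundles using (CommutativeRing)
open import Data.Nat using (ℕ; zero; suc)
open import Data.Fin using (Fin; zero; suc)
open import Data.Fin.Properties using (all?; ¬∀⟶∃¬)
open import Data.Rational using (ℚ; 0ℚ; 1ℚ; _+_; _*_; _-_; -_; 1/_; ≢-nonZero)
open import Data.Rational.Properties
  using (_≟_; 1≢0; +-*-commutativeRing; +-0-group; *-inverseʳ; neg-injective; neg-distribʳ-*;
         *-assoc; *-comm; *-identityˡ; *-identityʳ; *-zeroˡ; *-zeroʳ; +-identityˡ; +-identityʳ; +-inverseʳ)
open import Algebra.Properties.Group +-0-group using (⁻¹-involutive; x∙y⁻¹≈ε⇒x≈y; inverseʳ-unique)
open import Algebra.Properties.Semiring.Sum (CommutativeRing.semiring +-*-commutativeRing)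
  using (sum; ∑-distrib-+; ∑-comm; *-distribˡ-sum; *-distribʳ-sum; sum-replicate-zero)
open import Data.Product using (Σ; ∃-syntax; _×_; _,_; proj₁; proj₂)
open import Data.Sum using (_⊎_; inj₁; inj₂; [_,_]′)
open import Data.Empty using (⊥-elim)
open import Data.Unit using (tt)
open import Data.Vec.Functional using ([]; _∷_)
open import Function using (_∘_; id)
open import Relation.Nullary using (¬_; Dec; yes; no)
open import Relation.Nullary.Decidable using (True; toWitness; dec⇒maybe)
open import Relation.Binary.PropositionalEquality
  using (_≡_; _≢_; _≗_; refl; sym; trans; cong; cong₂; module ≡-Reasoning)
open import Tactic.RingSolver using (solve-∀)
open import Tactic.RingSolver.Core.AlmostCommutativeRing using (AlmostCommutativeRing; fromCommutativeRing)
open ≡-Reasoning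

ℚ-ring : AlmostCommutativeRing 0ℓ 0ℓ
ℚ-ring = fromCommutativeRing +-*-commutativeRing (λ x → dec⇒maybe (0ℚ ≟ x))

pattern 0F = zero
pattern 1F = suc zero
pattern 2F = suc (suc zero)
pattern 3F = suc (suc (suc zero))
pattern 4F = suc (suc (suc (suc zero)))
pattern 5F = suc (suc (suc (suc (suc zero))))

-- Linear algebra over ℚ

inv : (x : ℚ) → x ≢ 0ℚ → ℚ
inv x x≢0 = 1/_ x {{≢-nonZero x≢0}}

x*inv≡1 : (x : ℚ) (x≢0 : x ≢ 0ℚ) → x * inv x x≢0 ≡ 1ℚ
x*inv≡1 x x≢0 = *-inverseʳ x {{≢-nonZero x≢0}}

x*y≡0⇒y≡0 : ∀ {x y} → x ≢ 0ℚ → x * y ≡ 0ℚ → y ≡ 0ℚ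
x*y≡0⇒y≡0 {x} {y} x≢0 xy≡0 = begin
  y                    ≡⟨ sym (*-identityˡ y) ⟩
  1ℚ * y               ≡⟨ cong (_* y) (sym (x*inv≡1 x x≢0)) ⟩
  x * x⁻¹ * y          ≡⟨ cong (_* y) (*-comm x x⁻¹) ⟩
  x⁻¹ * x * y          ≡⟨ *-assoc x⁻¹ x y ⟩
  x⁻¹ * (x * y)        ≡⟨ cong (x⁻¹ *_) xy≡0 ⟩
  x⁻¹ * 0ℚ             ≡⟨ *-zeroʳ x⁻¹ ⟩
  0ℚ                   ∎
  where
  x⁻¹ : ℚ
  x⁻¹ = inv x x≢0

*-≢0 : ∀ {x y} → x ≢ 0ℚ → y ≢ 0ℚ → x * y ≢ 0ℚ
*-≢0 x≢0 y≢0 xy≡0 = y≢0 (x*y≡0⇒y≡0 x≢0 xy≡0)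

neg-≢0 : ∀ {x} → x ≢ 0ℚ → - x ≢ 0ℚ
neg-≢0 x≢0 -x≡0 = x≢0 (neg-injective -x≡0)

inv-≢0 : (x : ℚ) (x≢0 : x ≢ 0ℚ) → inv x x≢0 ≢ 0ℚ
inv-≢0 x x≢0 x⁻¹≡0 = 1≢0 (trans (sym (x*inv≡1 x x≢0)) (trans (cong (x *_) x⁻¹≡0) (*-zeroʳ x)))

inv*[x*y]≡y : ∀ x (x≢0 : x ≢ 0ℚ) y → inv x x≢0 * (x * y) ≡ y
inv*[x*y]≡y x x≢0 y = begin
  x⁻¹ * (x * y)  ≡⟨ sym (*-assoc x⁻¹ x y) ⟩
  x⁻¹ * x * y    ≡⟨ cong (_* y) (trans (*-comm x⁻¹ x) (x*inv≡1 x x≢0)) ⟩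
  1ℚ * y         ≡⟨ *-identityˡ y ⟩
  y              ∎
  where
  x⁻¹ : ℚ
  x⁻¹ = inv x x≢0

sumFin≡sum : ∀ k (f : Fin k → ℚ) → sumFin k f ≡ sum f
sumFin≡sum zero    f = refl
sumFin≡sum (suc k) f = cong (f zero +_) (sumFin≡sum k (λ i → f (suc i)))

sumFin-cong : ∀ k {f g : Fin k → ℚ} → f ≗ g → sumFin k f ≡ sumFin k g
sumFin-cong zero    f≗g = refl
sumFin-cong (suc k) f≗g = cong₂ _+_ (f≗g zero) (sumFin-cong k (λ i → f≗g (suc i)))

sumFin-zero : ∀ k → sumFin k (λ _ → 0ℚ) ≡ 0ℚ
sumFin-zero k = trans (sumFin≡sum k _) (sum-replicate-zero k)

sumFin-≡0 : ∀ k {f : Fin k → ℚ} → (∀ i → f i ≡ 0ℚ) → sumFin k f ≡ 0ℚ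
sumFin-≡0 k f≡0 = trans (sumFin-cong k f≡0) (sumFin-zero k)

sumFin-+ : ∀ k (f g : Fin k → ℚ) → sumFin k (λ i → f i + g i) ≡ sumFin k f + sumFin k g
sumFin-+ k f g = begin
  sumFin k (λ i → f i + g i)  ≡⟨ sumFin≡sum k _ ⟩
  sum (λ i → f i + g i)       ≡⟨ ∑-distrib-+ f g ⟩
  sum f + sum g               ≡⟨ sym (cong₂ _+_ (sumFin≡sum k f) (sumFin≡sum k g)) ⟩
  sumFin k f + sumFin k g     ∎

*-distribˡ-sumFin : ∀ k a (f : Fin k → ℚ) → sumFin k (λ i → a * f i) ≡ a * sumFin k f
*-distribˡ-sumFin k a f = begin
  sumFin k (λ i → a * f i)  ≡⟨ sumFin≡sum k _ ⟩
  sum (λ i → a * f i)       ≡⟨ sym (*-distribˡ-sum a f) ⟩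
  a * sum f                 ≡⟨ cong (a *_) (sym (sumFin≡sum k f)) ⟩
  a * sumFin k f            ∎

*-distribʳ-sumFin : ∀ k a (f : Fin k → ℚ) → sumFin k (λ i → f i * a) ≡ sumFin k f * a
*-distribʳ-sumFin k a f = begin
  sumFin k (λ i → f i * a)  ≡⟨ sumFin≡sum k _ ⟩
  sum (λ i → f i * a)       ≡⟨ sym (*-distribʳ-sum a f) ⟩
  sum f * a                 ≡⟨ cong (_* a) (sym (sumFin≡sum k f)) ⟩
  sumFin k f * a            ∎

sumFin-comm : ∀ k l (f : Fin k → Fin l → ℚ) →
  sumFin k (λ i → sumFin l (f i)) ≡ sumFin l (λ j → sumFin k (λ i → f i j))
sumFin-comm k l f = begin
  sumFin k (λ i → sumFin l (f i))        ≡⟨ trans (sumFin≡sum k _) (cong-sum (λ i → sumFin≡sum l (f i))) ⟩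
  sum (λ i → sum (f i))                  ≡⟨ ∑-comm f ⟩
  sum (λ j → sum (λ i → f i j))          ≡⟨ sym (trans (sumFin≡sum l _) (cong-sum (λ j → sumFin≡sum k (λ i → f i j)))) ⟩
  sumFin l (λ j → sumFin k (λ i → f i j)) ∎
  where
  cong-sum : ∀ {n} {g h : Fin n → ℚ} → g ≗ h → sum g ≡ sum h
  cong-sum {n} {g} {h} g≗h =
    trans (sym (sumFin≡sum n g)) (trans (sumFin-cong n g≗h) (sumFin≡sum n h))

sumFin-δʳ : ∀ k (f : Fin k → ℚ) j → sumFin k (λ i → f i * δ i j) ≡ f j
sumFin-δʳ (suc k) f zero = begin
  f zero * 1ℚ + sumFin k (λ i → f (suc i) * 0ℚ)
    ≡⟨ cong₂ _+_ (*-identityʳ (f zero)) (trans (sumFin-cong k (λ i → *-zeroʳ (f (suc i)))) (sumFin-zero k)) ⟩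
  f zero + 0ℚ ≡⟨ +-identityʳ (f zero) ⟩
  f zero ∎
sumFin-δʳ (suc k) f (suc j) = begin
  f zero * 0ℚ + sumFin k (λ i → f (suc i) * δ i j)
    ≡⟨ cong₂ _+_ (*-zeroʳ (f zero)) (sumFin-δʳ k (λ i → f (suc i)) j) ⟩
  0ℚ + f (suc j) ≡⟨ +-identityˡ (f (suc j)) ⟩
  f (suc j) ∎

δ-sym : ∀ {n} (i j : Fin n) → δ i j ≡ δ j i
δ-sym zero    zero    = refl
δ-sym zero    (suc j) = refl
δ-sym (suc i) zero    = refl
δ-sym (suc i) (suc j) = δ-sym i j

sumFin-δˡ : ∀ k (f : Fin k → ℚ) j → sumFin k (λ i → δ j i * f i) ≡ f j
sumFin-δˡ k f j = trans (sumFin-cong k (λ i → trans (*-comm (δ j i) (f i)) (cong (f i *_) (δ-sym j i))))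
                        (sumFin-δʳ k f j)

0ᵥ : {n : ℕ} → Vect n
0ᵥ _ = 0ℚ

IsIdentity : {n : ℕ} → Mat n → Set
IsIdentity m = ∀ i j → m i j ≡ δ i j

·-congˡ : ∀ {n} {u v : Vect n} (g : Mat n) → u ≗ v → u · g ≗ v · g
·-congˡ {n} g u≗v j = sumFin-cong n (λ i → cong (_* g i j) (u≗v i))

·-congʳ : ∀ {n} (v : Vect n) {g h : Mat n} → (∀ i j → g i j ≡ h i j) → v · g ≗ v · h
·-congʳ {n} v g≡h j = sumFin-cong n (λ i → cong (v i *_) (g≡h i j))

·-identity : ∀ {n} (v : Vect n) → v · δ ≗ v
·-identity {n} v = sumFin-δʳ n v

·-⊗ : ∀ {n} (v : Vect n) (g h : Mat n) → (v · g) · h ≗ v · (g ⊗ h)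
·-⊗ {n} v g h j = begin
  sumFin n (λ i → sumFin n (λ k → v k * g k i) * h i j)
    ≡⟨ sumFin-cong n (λ i → sym (*-distribʳ-sumFin n (h i j) (λ k → v k * g k i))) ⟩
  sumFin n (λ i → sumFin n (λ k → v k * g k i * h i j))
    ≡⟨ sumFin-comm n n _ ⟩
  sumFin n (λ k → sumFin n (λ i → v k * g k i * h i j))
    ≡⟨ sumFin-cong n (λ k → trans (sumFin-cong n (λ i → *-assoc (v k) (g k i) (h i j)))
                                   (*-distribˡ-sumFin n (v k) _)) ⟩
  sumFin n (λ k → v k * sumFin n (λ i → g k i * h i j)) ∎

·-inverse : ∀ {n} (v : Vect n) (g g' : Mat n) → IsIdentity (g ⊗ g') → (v · g) · g' ≗ v
·-inverse v g g' gg'≡1 j = trans (·-⊗ v g g' j) (trans (·-congʳ v gg'≡1 j) (·-identity v j))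

·-zero : ∀ {n} {u : Vect n} (g : Mat n) → u ≗ 0ᵥ → u · g ≗ 0ᵥ
·-zero {n} g u≗0 j = trans (sumFin-cong n (λ i → trans (cong (_* g i j) (u≗0 i)) (*-zeroˡ (g i j))))
                           (sumFin-zero n)

·-injective : ∀ {n} {u : Vect n} (g g' : Mat n) → IsIdentity (g ⊗ g') → u · g ≗ 0ᵥ → u ≗ 0ᵥ
·-injective {u = u} g g' gg'≡1 ug≗0 j = trans (sym (·-inverse u g g' gg'≡1 j)) (·-zero g' ug≗0 j)

lincomb-cong : ∀ {n k} (c : Fin k → ℚ) {vs ws : Fin k → Vect n} → (∀ i → vs i ≗ ws i) →
  lincomb c vs ≗ lincomb c ws
lincomb-cong {k = k} c vs≗ws j = sumFin-cong k (λ i → cong (c i *_) (vs≗ws i j))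

lincomb-congˡ : ∀ {n k} {c d : Fin k → ℚ} (vs : Fin k → Vect n) → c ≗ d → lincomb c vs ≗ lincomb d vs
lincomb-congˡ {k = k} vs c≗d j = sumFin-cong k (λ i → cong (_* vs i j) (c≗d i))

lincomb-zero : ∀ {n k} {c : Fin k → ℚ} (vs : Fin k → Vect n) → c ≗ 0ᵥ → lincomb c vs ≗ 0ᵥ
lincomb-zero {k = k} vs c≗0 j =
  trans (lincomb-congˡ vs c≗0 j) (trans (sumFin-cong k (λ i → *-zeroˡ (vs i j))) (sumFin-zero k))

lincomb-δ : ∀ {n k} (vs : Fin k → Vect n) i → lincomb (δ i) vs ≗ vs i
lincomb-δ {k = k} vs i j = sumFin-δˡ k (λ m → vs m j) i

lincomb-unitColumn : ∀ {n k} (c : Fin k → ℚ) (vs : Fin k → Vect n) j i → (∀ m → vs m j ≡ δ m i) →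
  lincomb c vs j ≡ c i
lincomb-unitColumn {k = k} c vs j i unit = trans (sumFin-cong k (λ m → cong (c m *_) (unit m))) (sumFin-δʳ k c i)

lincomb-zeroColumn : ∀ {n k} (c : Fin k → ℚ) (vs : Fin k → Vect n) j → (∀ m → vs m j ≡ 0ℚ) →
  lincomb c vs j ≡ 0ℚ
lincomb-zeroColumn {k = k} c vs j column≡0 = sumFin-≡0 k (λ m → trans (cong (c m *_) (column≡0 m)) (*-zeroʳ (c m)))

lincomb-· : ∀ {n k} (c : Fin k → ℚ) (vs : Fin k → Vect n) (g : Mat n) →
  lincomb c vs · g ≗ lincomb c (λ i → vs i · g)
lincomb-· {n} {k} c vs g j = begin
  sumFin n (λ m → sumFin k (λ i → c i * vs i m) * g m j)
    ≡⟨ sumFin-cong n (λ m → sym (*-distribʳ-sumFin k (g m j) _)) ⟩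
  sumFin n (λ m → sumFin k (λ i → c i * vs i m * g m j))
    ≡⟨ sumFin-comm n k _ ⟩
  sumFin k (λ i → sumFin n (λ m → c i * vs i m * g m j))
    ≡⟨ sumFin-cong k (λ i → trans (sumFin-cong n (λ m → *-assoc (c i) (vs i m) (g m j)))
                                   (*-distribˡ-sumFin n (c i) _)) ⟩
  sumFin k (λ i → c i * sumFin n (λ m → vs i m * g m j)) ∎

lincomb-lincomb : ∀ {n k l} (c : Fin k → ℚ) (C : Fin k → Fin l → ℚ) (ws : Fin l → Vect n) →
  lincomb c (λ i → lincomb (C i) ws) ≗ lincomb (λ m → sumFin k (λ i → c i * C i m)) ws
lincomb-lincomb {n} {k} {l} c C ws j = begin
  sumFin k (λ i → c i * sumFin l (λ m → C i m * ws m j))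
    ≡⟨ sumFin-cong k (λ i → trans (sym (*-distribˡ-sumFin l (c i) _))
                                   (sumFin-cong l (λ m → sym (*-assoc (c i) (C i m) (ws m j))))) ⟩
  sumFin k (λ i → sumFin l (λ m → c i * C i m * ws m j))
    ≡⟨ sumFin-comm k l _ ⟩
  sumFin l (λ m → sumFin k (λ i → c i * C i m * ws m j))
    ≡⟨ sumFin-cong l (λ m → *-distribʳ-sumFin k (ws m j) _) ⟩
  sumFin l (λ m → sumFin k (λ i → c i * C i m) * ws m j) ∎

module _ {n : ℕ} where

  InSpan-resp : ∀ {k} {vs : Fin k → Vect n} {x y} → x ≗ y → InSpan vs x → InSpan vs y
  InSpan-resp x≗y (c , x≗c) = c , (λ j → trans (sym (x≗y j)) (x≗c j))

  InSpan-member : ∀ {k} (vs : Fin k → Vect n) i → InSpan vs (vs i)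
  InSpan-member vs i = δ i , (λ j → sym (lincomb-δ vs i j))

  InSpan-trans : ∀ {k l} {vs : Fin k → Vect n} {ws : Fin l → Vect n} →
    (∀ i → InSpan ws (vs i)) → ∀ {x} → InSpan vs x → InSpan ws x
  InSpan-trans {k} {vs = vs} {ws} vs⊆ws (c , x≗c) =
    (λ m → sumFin k (λ i → c i * proj₁ (vs⊆ws i) m)) ,
    (λ j → trans (x≗c j) (trans (lincomb-cong c (λ i → proj₂ (vs⊆ws i)) j)
                                (lincomb-lincomb c (λ i → proj₁ (vs⊆ws i)) ws j)))

  SameSpan-intro : ∀ {k l} {vs : Fin k → Vect n} {ws : Fin l → Vect n} →
    (∀ i → InSpan ws (vs i)) → (∀ i → InSpan vs (ws i)) → SameSpan vs ws
  SameSpan-intro vs⊆ws ws⊆vs x = InSpan-trans vs⊆ws , InSpan-trans ws⊆vs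

  SameSpan-refl : ∀ {k} (vs : Fin k → Vect n) → SameSpan vs vs
  SameSpan-refl vs x = (λ h → h) , (λ h → h)

  SameSpan-sym : ∀ {k l} {vs : Fin k → Vect n} {ws : Fin l → Vect n} → SameSpan vs ws → SameSpan ws vs
  SameSpan-sym vs≈ws x = proj₂ (vs≈ws x) , proj₁ (vs≈ws x)

  SameSpan-trans : ∀ {k l m} {us : Fin m → Vect n} {vs : Fin k → Vect n} {ws : Fin l → Vect n} →
    SameSpan us vs → SameSpan vs ws → SameSpan us ws
  SameSpan-trans us≈vs vs≈ws x =
    (λ h → proj₁ (vs≈ws x) (proj₁ (us≈vs x) h)) , (λ h → proj₂ (us≈vs x) (proj₂ (vs≈ws x) h))

  SameSpan-≗ : ∀ {k} {vs ws : Fin k → Vect n} → (∀ i → vs i ≗ ws i) → SameSpan vs ws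
  SameSpan-≗ {vs = vs} {ws} vs≗ws = SameSpan-intro
    (λ i → InSpan-resp (λ j → sym (vs≗ws i j)) (InSpan-member ws i))
    (λ i → InSpan-resp (vs≗ws i) (InSpan-member vs i))

  InSpan-· : ∀ {k} {vs : Fin k → Vect n} {x} (g : Mat n) → InSpan vs x → InSpan (λ i → vs i · g) (x · g)
  InSpan-· {vs = vs} g (c , x≗c) = c , (λ j → trans (·-congˡ g x≗c j) (lincomb-· c vs g j))

  SameSpan-· : ∀ {k l} {vs : Fin k → Vect n} {ws : Fin l → Vect n} (g : Mat n) →
    SameSpan vs ws → SameSpan (λ i → vs i · g) (λ i → ws i · g)
  SameSpan-· {vs = vs} {ws} g vs≈ws = SameSpan-intro
    (λ i → InSpan-· g (proj₁ (vs≈ws (vs i)) (InSpan-member vs i)))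
    (λ i → InSpan-· g (proj₂ (vs≈ws (ws i)) (InSpan-member ws i)))

  LinIndep⇒≢0 : ∀ {k} (vs : Fin k → Vect n) → LinIndep vs → ∀ i → ¬ (vs i ≗ 0ᵥ)
  LinIndep⇒≢0 vs vs-indep i vs[i]≗0 =
    1≢0 (trans (sym (δ-diag i)) (vs-indep (δ i) (λ j → trans (lincomb-δ vs i j) (vs[i]≗0 j)) i))
    where
    δ-diag : ∀ {m} (i : Fin m) → δ i i ≡ 1ℚ
    δ-diag zero    = refl
    δ-diag (suc i) = δ-diag i

Isotropic-resp : ∀ {k l} (ws : Fin k → V) (vs : Fin l → V) → SameSpan ws vs → Isotropic vs → Isotropic ws
Isotropic-resp ws vs ws≈vs vs-iso x y x∈ws y∈ws = vs-iso x y (proj₁ (ws≈vs x) x∈ws) (proj₁ (ws≈vs y) y∈ws)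

Isotropic⇒ω≡0 : ∀ {k} (vs : Fin k → V) → Isotropic vs → ∀ i j → ω (vs i) (vs j) ≡ 0ℚ
Isotropic⇒ω≡0 vs iso i j = iso (vs i) (vs j) (InSpan-member vs i) (InSpan-member vs j)

BasisChange : ∀ {n k} → (Fin k → Vect n) → (Fin k → Vect n) → Set
BasisChange ws vs = SameSpan ws vs × (LinIndep vs → LinIndep ws)

basisChange : ∀ {n k} (vs ws : Fin k → Vect n) (C D : Mat k) → (∀ i → ws i ≗ lincomb (C i) vs) →
  IsIdentity (D ⊗ C) → IsIdentity (C ⊗ D) → BasisChange ws vs
basisChange vs ws C D ws≗Cvs DC≡1 CD≡1 = SameSpan-intro (λ i → C i , ws≗Cvs i) vs⊆ws , indep
  where
  vs⊆ws : ∀ i → InSpan ws (vs i)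
  vs⊆ws i = D i , λ j → sym (begin
    lincomb (D i) ws j                        ≡⟨ lincomb-cong (D i) ws≗Cvs j ⟩
    lincomb (D i) (λ m → lincomb (C m) vs) j  ≡⟨ lincomb-lincomb (D i) C vs j ⟩
    lincomb ((D ⊗ C) i) vs j                  ≡⟨ lincomb-congˡ vs (DC≡1 i) j ⟩
    lincomb (δ i) vs j                        ≡⟨ lincomb-δ vs i j ⟩
    vs i j                                    ∎)
  indep : LinIndep vs → LinIndep ws
  indep vs-indep e e·ws≗0 = ·-injective C D CD≡1 (vs-indep (e · C) λ j →
    trans (sym (trans (lincomb-cong e ws≗Cvs j) (lincomb-lincomb e C vs j))) (e·ws≗0 j))

_⋆_ : ∀ {n} → ℚ → Mat n → Mat n
(c ⋆ A) i j = c * A i j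

module _ {n} (A B : Mat n) (d : ℚ) (d≢0 : d ≢ 0ℚ) where

  private
    d⁻¹ : ℚ
    d⁻¹ = inv d d≢0

  ⊗-adjugateʳ : (∀ i j → (A ⊗ B) i j ≡ d * δ i j) → IsIdentity (A ⊗ (inv d d≢0 ⋆ B))
  ⊗-adjugateʳ AB≡d i j = begin
    sumFin n (λ k → A i k * (d⁻¹ * B k j)) ≡⟨ sumFin-cong n (λ k → sym (*-assoc (A i k) d⁻¹ (B k j))) ⟩
    sumFin n (λ k → A i k * d⁻¹ * B k j)   ≡⟨ sumFin-cong n (λ k → cong (_* B k j) (*-comm (A i k) d⁻¹)) ⟩
    sumFin n (λ k → d⁻¹ * A i k * B k j)   ≡⟨ sumFin-cong n (λ k → *-assoc d⁻¹ (A i k) (B k j)) ⟩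
    sumFin n (λ k → d⁻¹ * (A i k * B k j)) ≡⟨ *-distribˡ-sumFin n d⁻¹ _ ⟩
    d⁻¹ * (A ⊗ B) i j                      ≡⟨ cong (d⁻¹ *_) (AB≡d i j) ⟩
    d⁻¹ * (d * δ i j)                      ≡⟨ inv*[x*y]≡y d d≢0 (δ i j) ⟩
    δ i j                                  ∎

  ⊗-adjugateˡ : (∀ i j → (B ⊗ A) i j ≡ d * δ i j) → IsIdentity ((inv d d≢0 ⋆ B) ⊗ A)
  ⊗-adjugateˡ BA≡d i j = begin
    sumFin n (λ k → d⁻¹ * B i k * A k j)   ≡⟨ sumFin-cong n (λ k → *-assoc d⁻¹ (B i k) (A k j)) ⟩
    sumFin n (λ k → d⁻¹ * (B i k * A k j)) ≡⟨ *-distribˡ-sumFin n d⁻¹ _ ⟩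
    d⁻¹ * (B ⊗ A) i j                      ≡⟨ cong (d⁻¹ *_) (BA≡d i j) ⟩
    d⁻¹ * (d * δ i j)                      ≡⟨ inv*[x*y]≡y d d≢0 (δ i j) ⟩
    δ i j                                  ∎

infix 30 _ᵀ

_ᵀ : ∀ {n} → Mat n → Mat n
(A ᵀ) i j = A j i

⊗-ᵀ : ∀ {n} (A B : Mat n) i j → (A ⊗ B) j i ≡ (B ᵀ ⊗ A ᵀ) i j
⊗-ᵀ {n} A B i j = sumFin-cong n (λ k → *-comm (A j k) (B k i))

adjugate-⊗ : ∀ {n} (adj : Mat n → Mat n) (det : Mat n → ℚ) →
  (∀ M i j → (M ⊗ adj M) i j ≡ det M * δ i j) →
  (∀ M i j → adj (M ᵀ) i j ≡ adj M j i) → (∀ M → det (M ᵀ) ≡ det M) →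
  ∀ M i j → (adj M ⊗ M) i j ≡ det M * δ i j
adjugate-⊗ {n} adj det ⊗-adj adj-ᵀ det-ᵀ M i j = begin
  (adj M ⊗ M) i j               ≡⟨ ⊗-ᵀ (adj M) M j i ⟩
  (M ᵀ ⊗ adj M ᵀ) j i           ≡⟨ sumFin-cong n (λ k → cong (M k j *_) (sym (adj-ᵀ M k i))) ⟩
  (M ᵀ ⊗ adj (M ᵀ)) j i         ≡⟨ ⊗-adj (M ᵀ) j i ⟩
  det (M ᵀ) * δ j i             ≡⟨ cong₂ _*_ (det-ᵀ M) (δ-sym j i) ⟩
  det M * δ i j                 ∎

adj₂ : Mat 2 → Mat 2
adj₂ a 0F 0F = a 1F 1F
adj₂ a 0F 1F = - a 0F 1F
adj₂ a 1F 0F = - a 1F 0F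
adj₂ a 1F 1F = a 0F 0F

⊗-adj₂ : ∀ (a : Mat 2) i j → (a ⊗ adj₂ a) i j ≡ det₂ a * δ i j
⊗-adj₂ a 0F 0F = ring-identity (a 0F 0F) (a 0F 1F) (a 1F 0F) (a 1F 1F)
  where
  ring-identity : ∀ p q r s → p * s + (q * (- r) + 0ℚ) ≡ (p * s - q * r) * 1ℚ
  ring-identity = solve-∀ ℚ-ring
⊗-adj₂ a 0F 1F = ring-identity (a 0F 0F) (a 0F 1F) (a 1F 0F) (a 1F 1F)
  where
  ring-identity : ∀ p q r s → p * (- q) + (q * p + 0ℚ) ≡ (p * s - q * r) * 0ℚ
  ring-identity = solve-∀ ℚ-ring
⊗-adj₂ a 1F 0F = ring-identity (a 0F 0F) (a 0F 1F) (a 1F 0F) (a 1F 1F)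
  where
  ring-identity : ∀ p q r s → r * s + (s * (- r) + 0ℚ) ≡ (p * s - q * r) * 0ℚ
  ring-identity = solve-∀ ℚ-ring
⊗-adj₂ a 1F 1F = ring-identity (a 0F 0F) (a 0F 1F) (a 1F 0F) (a 1F 1F)
  where
  ring-identity : ∀ p q r s → r * (- q) + (s * p + 0ℚ) ≡ (p * s - q * r) * 1ℚ
  ring-identity = solve-∀ ℚ-ring

inverse₂ : (a : Mat 2) → det₂ a ≢ 0ℚ → Mat 2
inverse₂ a det≢0 = inv (det₂ a) det≢0 ⋆ adj₂ a

inverse₂-isRightInverse : (a : Mat 2) (det≢0 : det₂ a ≢ 0ℚ) → IsIdentity (a ⊗ inverse₂ a det≢0)
inverse₂-isRightInverse a det≢0 = ⊗-adjugateʳ a (adj₂ a) (det₂ a) det≢0 (⊗-adj₂ a)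

det₂-ᵀ : ∀ a → det₂ (a ᵀ) ≡ det₂ a
det₂-ᵀ a = cong (λ t → a 0F 0F * a 1F 1F - t) (*-comm (a 1F 0F) (a 0F 1F))

adj₂-⊗ : ∀ (a : Mat 2) i j → (adj₂ a ⊗ a) i j ≡ det₂ a * δ i j
adj₂-⊗ = adjugate-⊗ adj₂ det₂ ⊗-adj₂ adj₂-ᵀ det₂-ᵀ
  where
  adj₂-ᵀ : ∀ a i j → adj₂ (a ᵀ) i j ≡ adj₂ a j i
  adj₂-ᵀ a 0F 0F = refl
  adj₂-ᵀ a 0F 1F = refl
  adj₂-ᵀ a 1F 0F = refl
  adj₂-ᵀ a 1F 1F = refl

basisChange₂ : ∀ {n} (vs ws : Fin 2 → Vect n) (C : Mat 2) → (∀ i → ws i ≗ lincomb (C i) vs) →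
  det₂ C ≢ 0ℚ → BasisChange ws vs
basisChange₂ vs ws C ws≗Cvs det≢0 = basisChange vs ws C (inverse₂ C det≢0) ws≗Cvs
  (⊗-adjugateˡ C (adj₂ C) (det₂ C) det≢0 (adj₂-⊗ C)) (inverse₂-isRightInverse C det≢0)

adj₃ : Mat 3 → Mat 3
adj₃ M 0F 0F = M 1F 1F * M 2F 2F - M 1F 2F * M 2F 1F
adj₃ M 0F 1F = - (M 0F 1F * M 2F 2F - M 0F 2F * M 2F 1F)
adj₃ M 0F 2F = M 0F 1F * M 1F 2F - M 0F 2F * M 1F 1F
adj₃ M 1F 0F = - (M 1F 0F * M 2F 2F - M 1F 2F * M 2F 0F)
adj₃ M 1F 1F = M 0F 0F * M 2F 2F - M 0F 2F * M 2F 0F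
adj₃ M 1F 2F = - (M 0F 0F * M 1F 2F - M 0F 2F * M 1F 0F)
adj₃ M 2F 0F = M 1F 0F * M 2F 1F - M 1F 1F * M 2F 0F
adj₃ M 2F 1F = - (M 0F 0F * M 2F 1F - M 0F 1F * M 2F 0F)
adj₃ M 2F 2F = M 0F 0F * M 1F 1F - M 0F 1F * M 1F 0F

det₃ : Mat 3 → ℚ
det₃ M = M 0F 0F * (M 1F 1F * M 2F 2F - M 1F 2F * M 2F 1F)
        - M 0F 1F * (M 1F 0F * M 2F 2F - M 1F 2F * M 2F 0F)
        + M 0F 2F * (M 1F 0F * M 2F 1F - M 1F 1F * M 2F 0F)

⊗-adj₃ : ∀ (M : Mat 3) i j → (M ⊗ adj₃ M) i j ≡ det₃ M * δ i j
⊗-adj₃ M 0F 0F = ring-identity (M 0F 0F) (M 0F 1F) (M 0F 2F) (M 1F 0F) (M 1F 1F) (M 1F 2F) (M 2F 0F) (M 2F 1F) (M 2F 2F)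
  where
  ring-identity : ∀ a b c d e f g h i →
    a * (e * i - f * h) + (b * (- (d * i - f * g)) + (c * (d * h - e * g) + 0ℚ))
    ≡ (a * (e * i - f * h) - b * (d * i - f * g) + c * (d * h - e * g)) * 1ℚ
  ring-identity = solve-∀ ℚ-ring
⊗-adj₃ M 0F 1F = ring-identity (M 0F 0F) (M 0F 1F) (M 0F 2F) (M 1F 0F) (M 1F 1F) (M 1F 2F) (M 2F 0F) (M 2F 1F) (M 2F 2F)
  where
  ring-identity : ∀ a b c d e f g h i →
    a * (- (b * i - c * h)) + (b * (a * i - c * g) + (c * (- (a * h - b * g)) + 0ℚ))
    ≡ (a * (e * i - f * h) - b * (d * i - f * g) + c * (d * h - e * g)) * 0ℚ
  ring-identity = solve-∀ ℚ-ring
⊗-adj₃ M 0F 2F = ring-identity (M 0F 0F) (M 0F 1F) (M 0F 2F) (M 1F 0F) (M 1F 1F) (M 1F 2F) (M 2F 0F) (M 2F 1F) (M 2F 2F)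
  where
  ring-identity : ∀ a b c d e f g h i →
    a * (b * f - c * e) + (b * (- (a * f - c * d)) + (c * (a * e - b * d) + 0ℚ))
    ≡ (a * (e * i - f * h) - b * (d * i - f * g) + c * (d * h - e * g)) * 0ℚ
  ring-identity = solve-∀ ℚ-ring
⊗-adj₃ M 1F 0F = ring-identity (M 0F 0F) (M 0F 1F) (M 0F 2F) (M 1F 0F) (M 1F 1F) (M 1F 2F) (M 2F 0F) (M 2F 1F) (M 2F 2F)
  where
  ring-identity : ∀ a b c d e f g h i →
    d * (e * i - f * h) + (e * (- (d * i - f * g)) + (f * (d * h - e * g) + 0ℚ))
    ≡ (a * (e * i - f * h) - b * (d * i - f * g) + c * (d * h - e * g)) * 0ℚ
  ring-identity = solve-∀ ℚ-ring
⊗-adj₃ M 1F 1F = ring-identity (M 0F 0F) (M 0F 1F) (M 0F 2F) (M 1F 0F) (M 1F 1F) (M 1F 2F) (M 2F 0F) (M 2F 1F) (M 2F 2F)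
  where
  ring-identity : ∀ a b c d e f g h i →
    d * (- (b * i - c * h)) + (e * (a * i - c * g) + (f * (- (a * h - b * g)) + 0ℚ))
    ≡ (a * (e * i - f * h) - b * (d * i - f * g) + c * (d * h - e * g)) * 1ℚ
  ring-identity = solve-∀ ℚ-ring
⊗-adj₃ M 1F 2F = ring-identity (M 0F 0F) (M 0F 1F) (M 0F 2F) (M 1F 0F) (M 1F 1F) (M 1F 2F) (M 2F 0F) (M 2F 1F) (M 2F 2F)
  where
  ring-identity : ∀ a b c d e f g h i →
    d * (b * f - c * e) + (e * (- (a * f - c * d)) + (f * (a * e - b * d) + 0ℚ))
    ≡ (a * (e * i - f * h) - b * (d * i - f * g) + c * (d * h - e * g)) * 0ℚ
  ring-identity = solve-∀ ℚ-ring
⊗-adj₃ M 2F 0F = ring-identity (M 0F 0F) (M 0F 1F) (M 0F 2F) (M 1F 0F) (M 1F 1F) (M 1F 2F) (M 2F 0F) (M 2F 1F) (M 2F 2F)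
  where
  ring-identity : ∀ a b c d e f g h i →
    g * (e * i - f * h) + (h * (- (d * i - f * g)) + (i * (d * h - e * g) + 0ℚ))
    ≡ (a * (e * i - f * h) - b * (d * i - f * g) + c * (d * h - e * g)) * 0ℚ
  ring-identity = solve-∀ ℚ-ring
⊗-adj₃ M 2F 1F = ring-identity (M 0F 0F) (M 0F 1F) (M 0F 2F) (M 1F 0F) (M 1F 1F) (M 1F 2F) (M 2F 0F) (M 2F 1F) (M 2F 2F)
  where
  ring-identity : ∀ a b c d e f g h i →
    g * (- (b * i - c * h)) + (h * (a * i - c * g) + (i * (- (a * h - b * g)) + 0ℚ))
    ≡ (a * (e * i - f * h) - b * (d * i - f * g) + c * (d * h - e * g)) * 0ℚ
  ring-identity = solve-∀ ℚ-ring
⊗-adj₃ M 2F 2F = ring-identity (M 0F 0F) (M 0F 1F) (M 0F 2F) (M 1F 0F) (M 1F 1F) (M 1F 2F) (M 2F 0F) (M 2F 1F) (M 2F 2F)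
  where
  ring-identity : ∀ a b c d e f g h i →
    g * (b * f - c * e) + (h * (- (a * f - c * d)) + (i * (a * e - b * d) + 0ℚ))
    ≡ (a * (e * i - f * h) - b * (d * i - f * g) + c * (d * h - e * g)) * 1ℚ
  ring-identity = solve-∀ ℚ-ring

adj₃-⊗ : ∀ (M : Mat 3) i j → (adj₃ M ⊗ M) i j ≡ det₃ M * δ i j
adj₃-⊗ = adjugate-⊗ adj₃ det₃ ⊗-adj₃ adj₃-ᵀ det₃-ᵀ
  where
  adj₃-ᵀ : ∀ M i j → adj₃ (M ᵀ) i j ≡ adj₃ M j i
  adj₃-ᵀ M 0F 0F = cong (λ t → M 1F 1F * M 2F 2F - t) (*-comm (M 2F 1F) (M 1F 2F))
  adj₃-ᵀ M 0F 1F = cong (λ t → - (M 1F 0F * M 2F 2F - t)) (*-comm (M 2F 0F) (M 1F 2F))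
  adj₃-ᵀ M 0F 2F = cong (λ t → M 1F 0F * M 2F 1F - t) (*-comm (M 2F 0F) (M 1F 1F))
  adj₃-ᵀ M 1F 0F = cong (λ t → - (M 0F 1F * M 2F 2F - t)) (*-comm (M 2F 1F) (M 0F 2F))
  adj₃-ᵀ M 1F 1F = cong (λ t → M 0F 0F * M 2F 2F - t) (*-comm (M 2F 0F) (M 0F 2F))
  adj₃-ᵀ M 1F 2F = cong (λ t → - (M 0F 0F * M 2F 1F - t)) (*-comm (M 2F 0F) (M 0F 1F))
  adj₃-ᵀ M 2F 0F = cong (λ t → M 0F 1F * M 1F 2F - t) (*-comm (M 1F 1F) (M 0F 2F))
  adj₃-ᵀ M 2F 1F = cong (λ t → - (M 0F 0F * M 1F 2F - t)) (*-comm (M 1F 0F) (M 0F 2F))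
  adj₃-ᵀ M 2F 2F = cong (λ t → M 0F 0F * M 1F 1F - t) (*-comm (M 1F 0F) (M 0F 1F))
  det₃-ᵀ : ∀ M → det₃ (M ᵀ) ≡ det₃ M
  det₃-ᵀ M = ring-identity (M 0F 0F) (M 0F 1F) (M 0F 2F) (M 1F 0F) (M 1F 1F) (M 1F 2F) (M 2F 0F) (M 2F 1F) (M 2F 2F)
    where
    ring-identity : ∀ a b c d e f g h i →
      a * (e * i - h * f) - d * (b * i - h * c) + g * (b * f - e * c)
      ≡ a * (e * i - f * h) - b * (d * i - f * g) + c * (d * h - e * g)
    ring-identity = solve-∀ ℚ-ring

basisChange₃ : ∀ {n} (vs ws : Fin 3 → Vect n) (C : Mat 3) → (∀ i → ws i ≗ lincomb (C i) vs) →
  det₃ C ≢ 0ℚ → BasisChange ws vs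
basisChange₃ vs ws C ws≗Cvs det≢0 = basisChange vs ws C (inv (det₃ C) det≢0 ⋆ adj₃ C) ws≗Cvs
  (⊗-adjugateˡ C (adj₃ C) (det₃ C) det≢0 (adj₃-⊗ C)) (⊗-adjugateʳ C (adj₃ C) (det₃ C) det≢0 (⊗-adj₃ C))

minors≡0⇒relation : ∀ {n} (u w : Vect n) → (∀ i j → u i * w j ≡ u j * w i) →
  ∃[ a ] ∃[ b ] ((a ≢ 0ℚ ⊎ b ≢ 0ℚ) × lincomb (a ∷ b ∷ []) (u ∷ w ∷ []) ≗ 0ᵥ)
minors≡0⇒relation {n} u w minors≡ with all? (λ k → u k ≟ 0ℚ)
... | yes u≗0 = 1ℚ , 0ℚ , inj₁ 1≢0 , λ k → trans (ring-identity (u k) (w k)) (u≗0 k)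
  where
  ring-identity : ∀ x y → 1ℚ * x + (0ℚ * y + 0ℚ) ≡ x
  ring-identity = solve-∀ ℚ-ring
... | no u≢0 with ¬∀⟶∃¬ n (λ k → u k ≡ 0ℚ) (λ k → u k ≟ 0ℚ) u≢0
...   | j , uⱼ≢0 = w j , - u j , inj₂ (neg-≢0 uⱼ≢0) , λ k →
  trans (ring-identity (w j) (u k) (u j) (w k)) (trans (cong (λ t → u k * w j - t) (minors≡ j k)) (+-inverseʳ (u k * w j)))
  where
  ring-identity : ∀ wⱼ uₖ uⱼ wₖ → wⱼ * uₖ + ((- uⱼ) * wₖ + 0ℚ) ≡ uₖ * wⱼ - uⱼ * wₖ
  ring-identity = solve-∀ ℚ-ring

relation⇒¬independent : ∀ {n} {u w : Vect n} {a b} → (a ≢ 0ℚ ⊎ b ≢ 0ℚ) →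
  lincomb (a ∷ b ∷ []) (u ∷ w ∷ []) ≗ 0ᵥ → ¬ LinIndep (u ∷ w ∷ [])
relation⇒¬independent {a = a} {b} (inj₁ a≢0) relation indep = a≢0 (indep (a ∷ b ∷ []) relation 0F)
relation⇒¬independent {a = a} {b} (inj₂ b≢0) relation indep = b≢0 (indep (a ∷ b ∷ []) relation 1F)

independent⇒minor≢0 : ∀ {n} {u w : Vect n} → LinIndep (u ∷ w ∷ []) →
  ∃[ i ] ∃[ j ] (u i * w j - u j * w i ≢ 0ℚ)
independent⇒minor≢0 {n} {u} {w} indep
  with all? (λ i → all? (λ j → (u i * w j - u j * w i) ≟ 0ℚ))
... | yes minors≡0 with minors≡0⇒relation u w (λ i j → x∙y⁻¹≈ε⇒x≈y _ _ (minors≡0 i j))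
...   | _ , _ , nontrivial , relation = ⊥-elim (relation⇒¬independent nontrivial relation indep)
independent⇒minor≢0 {n} {u} {w} indep
    | no ¬minors≡0 with ¬∀⟶∃¬ n _ (λ i → all? (λ j → (u i * w j - u j * w i) ≟ 0ℚ)) ¬minors≡0
...   | i , ¬row≡0 with ¬∀⟶∃¬ n _ (λ j → (u i * w j - u j * w i) ≟ 0ℚ) ¬row≡0
...     | j , minor≢0 = i , j , minor≢0

LinIndep-coefficients : ∀ {n k l} {vs : Fin k → Vect n} {ws : Fin l → Vect n} (C : Fin k → Vect l) →
  (∀ i → vs i ≗ lincomb (C i) ws) → LinIndep vs → LinIndep C
LinIndep-coefficients {vs = vs} {ws} C vs≗Cws indep c c·C≗0 = indep c λ j →
  trans (lincomb-cong c vs≗Cws j) (trans (lincomb-lincomb c C ws j) (lincomb-zero ws c·C≗0 j))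

lincomb-pad : ∀ {n} a b (x y z : Vect n) → lincomb (a ∷ b ∷ []) (x ∷ y ∷ []) ≗ lincomb (a ∷ b ∷ 0ℚ ∷ []) (x ∷ y ∷ z ∷ [])
lincomb-pad a b x y z j = ring-identity a b (x j) (y j) (z j)
  where
  ring-identity : ∀ a b p q r → a * p + (b * q + 0ℚ) ≡ a * p + (b * q + (0ℚ * r + 0ℚ))
  ring-identity = solve-∀ ℚ-ring

LinIndep-₀₁ : ∀ {n} (x y z : Vect n) → LinIndep (x ∷ y ∷ z ∷ []) → LinIndep (x ∷ y ∷ [])
LinIndep-₀₁ x y z indep c c·xy≗0 0F =
  indep (c 0F ∷ c 1F ∷ 0ℚ ∷ []) (λ j → trans (sym (lincomb-pad (c 0F) (c 1F) x y z j)) (c·xy≗0 j)) 0F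
LinIndep-₀₁ x y z indep c c·xy≗0 1F =
  indep (c 0F ∷ c 1F ∷ 0ℚ ∷ []) (λ j → trans (sym (lincomb-pad (c 0F) (c 1F) x y z j)) (c·xy≗0 j)) 1F

LinIndep-₁₂ : ∀ {n} (x y z : Vect n) → LinIndep (x ∷ y ∷ z ∷ []) → LinIndep (y ∷ z ∷ [])
LinIndep-₁₂ x y z indep c c·yz≗0 0F =
  indep (0ℚ ∷ c 0F ∷ c 1F ∷ []) (λ j → trans (ring-identity (c 0F) (c 1F) (x j) (y j) (z j)) (c·yz≗0 j)) 1F
  where
  ring-identity : ∀ a b p q r → 0ℚ * p + (a * q + (b * r + 0ℚ)) ≡ a * q + (b * r + 0ℚ)
  ring-identity = solve-∀ ℚ-ring
LinIndep-₁₂ x y z indep c c·yz≗0 1F =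
  indep (0ℚ ∷ c 0F ∷ c 1F ∷ []) (λ j → trans (ring-identity (c 0F) (c 1F) (x j) (y j) (z j)) (c·yz≗0 j)) 2F
  where
  ring-identity : ∀ a b p q r → 0ℚ * p + (a * q + (b * r + 0ℚ)) ≡ a * q + (b * r + 0ℚ)
  ring-identity = solve-∀ ℚ-ring

SameSpan-swap₁₂ : ∀ {n} (x y z : Vect n) → SameSpan (x ∷ y ∷ z ∷ []) (x ∷ z ∷ y ∷ [])
SameSpan-swap₁₂ x y z = SameSpan-intro {vs = x ∷ y ∷ z ∷ []} {ws = x ∷ z ∷ y ∷ []}
  (λ { 0F → InSpan-member (x ∷ z ∷ y ∷ []) 0F ; 1F → InSpan-member (x ∷ z ∷ y ∷ []) 2F
      ; 2F → InSpan-member (x ∷ z ∷ y ∷ []) 1F })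
  (λ { 0F → InSpan-member (x ∷ y ∷ z ∷ []) 0F ; 1F → InSpan-member (x ∷ y ∷ z ∷ []) 2F
      ; 2F → InSpan-member (x ∷ y ∷ z ∷ []) 1F })

-- V = W₁ ⊕ W₂ with W₁ = ⟨e₁, f₁⟩ (coordinates 0, 5) and W₂ = ⟨e₂, e₃, f₃, f₂⟩ (coordinates 1 to 4)

π₁ : V → Vect 2
π₁ v 0F = v 0F
π₁ v 1F = v 5F

π₂ : V → Vect 4
π₂ v 0F = v 1F
π₂ v 1F = v 2F
π₂ v 2F = v 3F
π₂ v 3F = v 4F

join : Vect 2 → Vect 4 → V
join x y 0F = x 0F
join x y 1F = y 0F
join x y 2F = y 1F
join x y 3F = y 2F
join x y 4F = y 3F
join x y 5F = x 1F

join-π : ∀ v → join (π₁ v) (π₂ v) ≗ v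
join-π v 0F = refl
join-π v 1F = refl
join-π v 2F = refl
join-π v 3F = refl
join-π v 4F = refl
join-π v 5F = refl

π₁-join : ∀ x y → π₁ (join x y) ≗ x
π₁-join x y 0F = refl
π₁-join x y 1F = refl

π₂-join : ∀ x y → π₂ (join x y) ≗ y
π₂-join x y 0F = refl
π₂-join x y 1F = refl
π₂-join x y 2F = refl
π₂-join x y 3F = refl

join-cong : ∀ {x x' y y'} → x ≗ x' → y ≗ y' → join x y ≗ join x' y'
join-cong x≗x' y≗y' 0F = x≗x' 0F
join-cong x≗x' y≗y' 1F = y≗y' 0F
join-cong x≗x' y≗y' 2F = y≗y' 1F
join-cong x≗x' y≗y' 3F = y≗y' 2F
join-cong x≗x' y≗y' 4F = y≗y' 3F
join-cong x≗x' y≗y' 5F = x≗x' 1F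

π₁-cong : ∀ {v w} → v ≗ w → π₁ v ≗ π₁ w
π₁-cong v≗w 0F = v≗w 0F
π₁-cong v≗w 1F = v≗w 5F

π₂-cong : ∀ {v w} → v ≗ w → π₂ v ≗ π₂ w
π₂-cong v≗w 0F = v≗w 1F
π₂-cong v≗w 1F = v≗w 2F
π₂-cong v≗w 2F = v≗w 3F
π₂-cong v≗w 3F = v≗w 4F

π₁-≗0 : ∀ {v} → v ≗ 0ᵥ → π₁ v ≗ 0ᵥ
π₁-≗0 v≗0 0F = v≗0 0F
π₁-≗0 v≗0 1F = v≗0 5F

π₂-≗0 : ∀ {v} → v ≗ 0ᵥ → π₂ v ≗ 0ᵥ
π₂-≗0 v≗0 0F = v≗0 1F
π₂-≗0 v≗0 1F = v≗0 2F
π₂-≗0 v≗0 2F = v≗0 3F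
π₂-≗0 v≗0 3F = v≗0 4F

≗-join : ∀ {v x y} → π₁ v ≗ x → π₂ v ≗ y → v ≗ join x y
≗-join {v} π₁v≗x π₂v≗y j = trans (sym (join-π v j)) (join-cong π₁v≗x π₂v≗y j)

π-≗0 : ∀ {v} → π₁ v ≗ 0ᵥ → π₂ v ≗ 0ᵥ → v ≗ 0ᵥ
π-≗0 {v} π₁v≗0 π₂v≗0 j = trans (≗-join π₁v≗0 π₂v≗0 j) (join-0 j)
  where
  join-0 : join 0ᵥ 0ᵥ ≗ 0ᵥ
  join-0 0F = refl
  join-0 1F = refl
  join-0 2F = refl
  join-0 3F = refl
  join-0 4F = refl
  join-0 5F = refl

π₁-lincomb : ∀ {k} c (vs : Fin k → V) → π₁ (lincomb c vs) ≗ lincomb c (λ i → π₁ (vs i))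
π₁-lincomb c vs 0F = refl
π₁-lincomb c vs 1F = refl

π₂-lincomb : ∀ {k} c (vs : Fin k → V) → π₂ (lincomb c vs) ≗ lincomb c (λ i → π₂ (vs i))
π₂-lincomb c vs 0F = refl
π₂-lincomb c vs 1F = refl
π₂-lincomb c vs 2F = refl
π₂-lincomb c vs 3F = refl

join-W₁ : ∀ {x} → π₂ x ≗ 0ᵥ → join (π₁ x) 0ᵥ ≗ x
join-W₁ π₂x≗0 j = sym (≗-join (λ _ → refl) π₂x≗0 j)

join-W₂ : ∀ {x} → π₁ x ≗ 0ᵥ → join 0ᵥ (π₂ x) ≗ x
join-W₂ π₁x≗0 j = sym (≗-join π₁x≗0 (λ _ → refl) j)

LinIndep-W₂ : ∀ {k} (vs : Fin k → V) → (∀ i → π₁ (vs i) ≗ 0ᵥ) → LinIndep vs → LinIndep (λ i → π₂ (vs i))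
LinIndep-W₂ vs inW₂ indep c c·π₂vs≗0 = indep c (π-≗0
  (λ j → trans (π₁-lincomb c vs j) (lincomb-zeroColumn c (λ i → π₁ (vs i)) j (λ m → inW₂ m j)))
  (λ j → trans (π₂-lincomb c vs j) (c·π₂vs≗0 j)))

private
  W₁-coordinate : ∀ x₀ x₁ x₂ x₃ x₄ x₅ p q →
    x₀ * p + (x₁ * 0ℚ + (x₂ * 0ℚ + (x₃ * 0ℚ + (x₄ * 0ℚ + (x₅ * q + 0ℚ))))) ≡ x₀ * p + (x₅ * q + 0ℚ)
  W₁-coordinate = solve-∀ ℚ-ring

  W₂-coordinate : ∀ x₀ x₁ x₂ x₃ x₄ x₅ p q r s →
    x₀ * 0ℚ + (x₁ * p + (x₂ * q + (x₃ * r + (x₄ * s + (x₅ * 0ℚ + 0ℚ)))))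
    ≡ x₁ * p + (x₂ * q + (x₃ * r + (x₄ * s + 0ℚ)))
  W₂-coordinate = solve-∀ ℚ-ring

·-embed : ∀ v a b → v · embed a b ≗ join (π₁ v · a) (π₂ v · b)
·-embed v a b 0F = W₁-coordinate (v 0F) (v 1F) (v 2F) (v 3F) (v 4F) (v 5F) _ _
·-embed v a b 1F = W₂-coordinate (v 0F) (v 1F) (v 2F) (v 3F) (v 4F) (v 5F) _ _ _ _
·-embed v a b 2F = W₂-coordinate (v 0F) (v 1F) (v 2F) (v 3F) (v 4F) (v 5F) _ _ _ _
·-embed v a b 3F = W₂-coordinate (v 0F) (v 1F) (v 2F) (v 3F) (v 4F) (v 5F) _ _ _ _
·-embed v a b 4F = W₂-coordinate (v 0F) (v 1F) (v 2F) (v 3F) (v 4F) (v 5F) _ _ _ _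
·-embed v a b 5F = W₁-coordinate (v 0F) (v 1F) (v 2F) (v 3F) (v 4F) (v 5F) _ _

π₁-·-embed : ∀ v a b → π₁ (v · embed a b) ≗ π₁ v · a
π₁-·-embed v a b j = trans (π₁-cong (·-embed v a b) j) (π₁-join _ _ j)

π₂-·-embed : ∀ v a b → π₂ (v · embed a b) ≗ π₂ v · b
π₂-·-embed v a b j = trans (π₂-cong (·-embed v a b) j) (π₂-join _ _ j)

ω₁ : Vect 2 → Vect 2 → ℚ
ω₁ x y = x 0F * y 1F - x 1F * y 0F

ω-split : ∀ v w → ω v w ≡ ω₁ (π₁ v) (π₁ w) + ω₄ (π₂ v) (π₂ w)
ω-split v w = ring-identity (v 0F) (v 1F) (v 2F) (v 3F) (v 4F) (v 5F) (w 0F) (w 1F) (w 2F) (w 3F) (w 4F) (w 5F)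
  where
  ring-identity : ∀ a₀ a₁ a₂ a₃ a₄ a₅ b₀ b₁ b₂ b₃ b₄ b₅ →
    ((a₀ * b₅ + a₁ * b₄) + a₂ * b₃) - ((a₅ * b₀ + a₄ * b₁) + a₃ * b₂)
    ≡ (a₀ * b₅ - a₅ * b₀) + ((a₁ * b₄ + a₂ * b₃) - (a₄ * b₁ + a₃ * b₂))
  ring-identity = solve-∀ ℚ-ring

ω₁-cong : ∀ {x x' y y'} → x ≗ x' → y ≗ y' → ω₁ x y ≡ ω₁ x' y'
ω₁-cong x≗x' y≗y' = cong₂ _-_ (cong₂ _*_ (x≗x' 0F) (y≗y' 1F)) (cong₂ _*_ (x≗x' 1F) (y≗y' 0F))

ω₄-cong : ∀ {x x' y y'} → x ≗ x' → y ≗ y' → ω₄ x y ≡ ω₄ x' y'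
ω₄-cong x≗x' y≗y' =
  cong₂ _-_ (cong₂ _+_ (cong₂ _*_ (x≗x' 0F) (y≗y' 3F)) (cong₂ _*_ (x≗x' 1F) (y≗y' 2F)))
            (cong₂ _+_ (cong₂ _*_ (x≗x' 3F) (y≗y' 0F)) (cong₂ _*_ (x≗x' 2F) (y≗y' 1F)))

ω-cong : ∀ {x x' y y'} → x ≗ x' → y ≗ y' → ω x y ≡ ω x' y'
ω-cong {x} {x'} {y} {y'} x≗x' y≗y' = begin
  ω x y                                   ≡⟨ ω-split x y ⟩
  ω₁ (π₁ x) (π₁ y) + ω₄ (π₂ x) (π₂ y)     ≡⟨ cong₂ _+_ (ω₁-cong (π₁-cong x≗x') (π₁-cong y≗y'))
                                                       (ω₄-cong (π₂-cong x≗x') (π₂-cong y≗y')) ⟩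
  ω₁ (π₁ x') (π₁ y') + ω₄ (π₂ x') (π₂ y') ≡⟨ sym (ω-split x' y') ⟩
  ω x' y'                                 ∎

ω₁-antisym : ∀ x y → ω₁ x y ≡ - ω₁ y x
ω₁-antisym x y = ring-identity (x 0F) (x 1F) (y 0F) (y 1F)
  where
  ring-identity : ∀ a₀ a₁ b₀ b₁ → a₀ * b₁ - a₁ * b₀ ≡ - (b₀ * a₁ - b₁ * a₀)
  ring-identity = solve-∀ ℚ-ring

ω₄-antisym : ∀ x y → ω₄ x y ≡ - ω₄ y x
ω₄-antisym x y = ring-identity (x 0F) (x 1F) (x 2F) (x 3F) (y 0F) (y 1F) (y 2F) (y 3F)
  where
  ring-identity : ∀ a₀ a₁ a₂ a₃ b₀ b₁ b₂ b₃ →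
    (a₀ * b₃ + a₁ * b₂) - (a₃ * b₀ + a₂ * b₁) ≡ - ((b₀ * a₃ + b₁ * a₂) - (b₃ * a₀ + b₂ * a₁))
  ring-identity = solve-∀ ℚ-ring

ω₁-antisym₀ : ∀ x y → ω₁ x y ≡ 0ℚ → ω₁ y x ≡ 0ℚ
ω₁-antisym₀ x y ωxy≡0 = trans (ω₁-antisym y x) (cong -_ ωxy≡0)

ω₄-antisym₀ : ∀ x y → ω₄ x y ≡ 0ℚ → ω₄ y x ≡ 0ℚ
ω₄-antisym₀ x y ωxy≡0 = trans (ω₄-antisym y x) (cong -_ ωxy≡0)

ω₄-self : ∀ x → ω₄ x x ≡ 0ℚ
ω₄-self x = ring-identity (x 0F) (x 1F) (x 2F) (x 3F)
  where
  ring-identity : ∀ a₀ a₁ a₂ a₃ → (a₀ * a₃ + a₁ * a₂) - (a₃ * a₀ + a₂ * a₁) ≡ 0ℚ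
  ring-identity = solve-∀ ℚ-ring

ω₁-zeroʳ : ∀ x {y} → y ≗ 0ᵥ → ω₁ x y ≡ 0ℚ
ω₁-zeroʳ x y≗0 = trans (ω₁-cong {x = x} (λ _ → refl) y≗0) (ring-identity (x 0F) (x 1F))
  where
  ring-identity : ∀ a₀ a₁ → a₀ * 0ℚ - a₁ * 0ℚ ≡ 0ℚ
  ring-identity = solve-∀ ℚ-ring

ω₄-π₂ : ∀ v w → ω v w ≡ 0ℚ → π₁ w ≗ 0ᵥ → ω₄ (π₂ v) (π₂ w) ≡ 0ℚ
ω₄-π₂ v w ωvw≡0 π₁w≗0 = begin
  ω₄ (π₂ v) (π₂ w)                            ≡⟨ sym (+-identityˡ _) ⟩
  0ℚ + ω₄ (π₂ v) (π₂ w)                       ≡⟨ cong (_+ ω₄ (π₂ v) (π₂ w)) (sym (ω₁-zeroʳ (π₁ v) π₁w≗0)) ⟩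
  ω₁ (π₁ v) (π₁ w) + ω₄ (π₂ v) (π₂ w)         ≡⟨ sym (ω-split v w) ⟩
  ω v w                                       ≡⟨ ωvw≡0 ⟩
  0ℚ                                          ∎

ω₁-relation : ∀ u w → ω₁ u w ≡ 0ℚ → ∃[ a ] ∃[ b ] ((a ≢ 0ℚ ⊎ b ≢ 0ℚ) × lincomb (a ∷ b ∷ []) (u ∷ w ∷ []) ≗ 0ᵥ)
ω₁-relation u w ω₁≡0 = minors≡0⇒relation u w minors
  where
  minors : ∀ i j → u i * w j ≡ u j * w i
  minors 0F 0F = refl
  minors 0F 1F = x∙y⁻¹≈ε⇒x≈y _ _ ω₁≡0
  minors 1F 0F = sym (x∙y⁻¹≈ε⇒x≈y _ _ ω₁≡0)
  minors 1F 1F = refl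

W₁-dual : ∀ F₁ → ¬ (F₁ ≗ 0ᵥ) → ∃[ E₁ ] (ω₁ E₁ F₁ ≢ 0ℚ)
W₁-dual F₁ F₁≢0 with F₁ 1F ≟ 0ℚ
... | no F₁₁≢0 = (1ℚ ∷ 0ℚ ∷ []) , λ ω≡0 → F₁₁≢0 (trans (sym (ring-identity (F₁ 0F) (F₁ 1F))) ω≡0)
  where
  ring-identity : ∀ p q → 1ℚ * q - 0ℚ * p ≡ q
  ring-identity = solve-∀ ℚ-ring
... | yes F₁₁≡0 with F₁ 0F ≟ 0ℚ
...   | yes F₁₀≡0 = ⊥-elim (F₁≢0 λ { 0F → F₁₀≡0 ; 1F → F₁₁≡0 })
...   | no F₁₀≢0 = (0ℚ ∷ 1ℚ ∷ []) , λ ω≡0 → neg-≢0 F₁₀≢0 (trans (sym (ring-identity (F₁ 0F) (F₁ 1F))) ω≡0)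
  where
  ring-identity : ∀ p q → 0ℚ * q - 1ℚ * p ≡ - p
  ring-identity = solve-∀ ℚ-ring

ω₄-negˡ : ∀ x y → ω₄ (λ k → - x k) y ≡ - ω₄ x y
ω₄-negˡ x y = ring-identity (x 0F) (x 1F) (x 2F) (x 3F) (y 0F) (y 1F) (y 2F) (y 3F)
  where
  ring-identity : ∀ a₀ a₁ a₂ a₃ b₀ b₁ b₂ b₃ →
    ((- a₀) * b₃ + (- a₁) * b₂) - ((- a₃) * b₀ + (- a₂) * b₁) ≡ - ((a₀ * b₃ + a₁ * b₂) - (a₃ * b₀ + a₂ * b₁))
  ring-identity = solve-∀ ℚ-ring

_∙_ : ∀ {n} → Vect n → Vect n → ℚ
_∙_ {n} u v = sumFin n (λ a → u a * v a)

∙-lincomb : ∀ {n k} (u : Vect n) (c : Fin k → ℚ) (vs : Fin k → Vect n) →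
  u ∙ lincomb c vs ≡ sumFin k (λ i → c i * (u ∙ vs i))
∙-lincomb {n} {k} u c vs = begin
  sumFin n (λ a → u a * sumFin k (λ i → c i * vs i a))
    ≡⟨ sumFin-cong n (λ a → sym (*-distribˡ-sumFin k (u a) _)) ⟩
  sumFin n (λ a → sumFin k (λ i → u a * (c i * vs i a)))
    ≡⟨ sumFin-comm n k _ ⟩
  sumFin k (λ i → sumFin n (λ a → u a * (c i * vs i a)))
    ≡⟨ sumFin-cong k (λ i → trans (sumFin-cong n (λ a → swap (u a) (c i) (vs i a))) (*-distribˡ-sumFin n (c i) _)) ⟩
  sumFin k (λ i → c i * sumFin n (λ a → u a * vs i a)) ∎
  where
  swap : ∀ x y z → x * (y * z) ≡ y * (x * z)
  swap = solve-∀ ℚ-ring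

-- ω₄ x y = J x ∙ y = K y ∙ x
J K : Vect 4 → Vect 4
J x = - x 3F ∷ - x 2F ∷ x 1F ∷ x 0F ∷ []
K y = y 3F ∷ y 2F ∷ - y 1F ∷ - y 0F ∷ []

ω₄-lincombʳ : ∀ {k} x (c : Fin k → ℚ) vs → ω₄ x (lincomb c vs) ≡ sumFin k (λ i → c i * ω₄ x (vs i))
ω₄-lincombʳ {k} x c vs = trans (ω₄≡J∙ x (lincomb c vs))
  (trans (∙-lincomb (J x) c vs) (sumFin-cong k (λ i → cong (c i *_) (sym (ω₄≡J∙ x (vs i))))))
  where
  ω₄≡J∙ : ∀ x y → ω₄ x y ≡ J x ∙ y
  ω₄≡J∙ x y = ring-identity (x 0F) (x 1F) (x 2F) (x 3F) (y 0F) (y 1F) (y 2F) (y 3F)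
    where
    ring-identity : ∀ a₀ a₁ a₂ a₃ b₀ b₁ b₂ b₃ →
      (a₀ * b₃ + a₁ * b₂) - (a₃ * b₀ + a₂ * b₁) ≡ (- a₃) * b₀ + ((- a₂) * b₁ + (a₁ * b₂ + (a₀ * b₃ + 0ℚ)))
    ring-identity = solve-∀ ℚ-ring

ω₄-lincombˡ : ∀ {k} (c : Fin k → ℚ) vs y → ω₄ (lincomb c vs) y ≡ sumFin k (λ i → c i * ω₄ (vs i) y)
ω₄-lincombˡ {k} c vs y = trans (ω₄≡K∙ (lincomb c vs) y)
  (trans (∙-lincomb (K y) c vs) (sumFin-cong k (λ i → cong (c i *_) (sym (ω₄≡K∙ (vs i) y)))))
  where
  ω₄≡K∙ : ∀ x y → ω₄ x y ≡ K y ∙ x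
  ω₄≡K∙ x y = ring-identity (x 0F) (x 1F) (x 2F) (x 3F) (y 0F) (y 1F) (y 2F) (y 3F)
    where
    ring-identity : ∀ a₀ a₁ a₂ a₃ b₀ b₁ b₂ b₃ →
      (a₀ * b₃ + a₁ * b₂) - (a₃ * b₀ + a₂ * b₁) ≡ b₃ * a₀ + (b₂ * a₁ + ((- b₁) * a₂ + ((- b₀) * a₃ + 0ℚ)))
    ring-identity = solve-∀ ℚ-ring

ω₄-lincomb : ∀ {k} (M : Fin k → Vect 4) v w →
  ω₄ (lincomb v M) (lincomb w M) ≡ sumFin k (λ a → v a * sumFin k (λ b → w b * ω₄ (M a) (M b)))
ω₄-lincomb {k} M v w = trans (ω₄-lincombˡ v M (lincomb w M))
  (sumFin-cong k (λ a → cong (v a *_) (ω₄-lincombʳ (M a) w M)))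

-- Symplectic bases of W₂

record IsSymplecticBasis (M : Mat 4) (μ : ℚ) : Set where
  constructor pairs
  field pairing : ∀ a b → ω₄ (M a) (M b) ≡ μ * ω₄ (δ a) (δ b)

symplecticBasis : ∀ {M μ} → ω₄ (M 0F) (M 3F) ≡ μ → ω₄ (M 1F) (M 2F) ≡ μ →
  ω₄ (M 0F) (M 1F) ≡ 0ℚ → ω₄ (M 0F) (M 2F) ≡ 0ℚ → ω₄ (M 1F) (M 3F) ≡ 0ℚ → ω₄ (M 2F) (M 3F) ≡ 0ℚ →
  IsSymplecticBasis M μ
symplecticBasis {M} {μ} ω₀₃ ω₁₂ ω₀₁ ω₀₂ ω₁₃ ω₂₃ = pairs gram
  where
  μ*0 : ∀ {x} → x ≡ 0ℚ → x ≡ μ * 0ℚ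
  μ*0 x≡0 = trans x≡0 (sym (*-zeroʳ μ))
  μ*1 : ∀ {x} → x ≡ μ → x ≡ μ * 1ℚ
  μ*1 x≡μ = trans x≡μ (sym (*-identityʳ μ))
  μ*-1 : ∀ x y → ω₄ x y ≡ μ → ω₄ y x ≡ μ * - 1ℚ
  μ*-1 x y ωxy≡μ = trans (ω₄-antisym y x) (trans (cong -_ (μ*1 ωxy≡μ)) (neg-distribʳ-* μ 1ℚ))
  gram : ∀ a b → ω₄ (M a) (M b) ≡ μ * ω₄ (δ a) (δ b)
  gram 0F 0F = μ*0 (ω₄-self (M 0F))
  gram 0F 1F = μ*0 ω₀₁
  gram 0F 2F = μ*0 ω₀₂
  gram 0F 3F = μ*1 ω₀₃
  gram 1F 0F = μ*0 (ω₄-antisym₀ (M 0F) (M 1F) ω₀₁)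
  gram 1F 1F = μ*0 (ω₄-self (M 1F))
  gram 1F 2F = μ*1 ω₁₂
  gram 1F 3F = μ*0 ω₁₃
  gram 2F 0F = μ*0 (ω₄-antisym₀ (M 0F) (M 2F) ω₀₂)
  gram 2F 1F = μ*-1 (M 1F) (M 2F) ω₁₂
  gram 2F 2F = μ*0 (ω₄-self (M 2F))
  gram 2F 3F = μ*0 ω₂₃
  gram 3F 0F = μ*-1 (M 0F) (M 3F) ω₀₃
  gram 3F 1F = μ*0 (ω₄-antisym₀ (M 1F) (M 3F) ω₁₃)
  gram 3F 2F = μ*0 (ω₄-antisym₀ (M 2F) (M 3F) ω₂₃)
  gram 3F 3F = μ*0 (ω₄-self (M 3F))

private
  x[yz]≡y[xz] : ∀ x y z → x * (y * z) ≡ y * (x * z)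
  x[yz]≡y[xz] = solve-∀ ℚ-ring

symplecticBasis-preserves : ∀ {M μ} → IsSymplecticBasis M μ → ∀ v w → ω₄ (v · M) (w · M) ≡ μ * ω₄ v w
symplecticBasis-preserves {M} {μ} (pairs gram) v w = begin
  ω₄ (v · M) (w · M)
    ≡⟨ ω₄-lincomb M v w ⟩
  sumFin 4 (λ a → v a * sumFin 4 (λ b → w b * ω₄ (M a) (M b)))
    ≡⟨ sumFin-cong 4 (λ a → trans (cong (v a *_) (pull-μ a)) (x[yz]≡y[xz] (v a) μ (sumFin 4 (λ b → w b * ω₄ (δ a) (δ b))))) ⟩
  sumFin 4 (λ a → μ * (v a * sumFin 4 (λ b → w b * ω₄ (δ a) (δ b))))
    ≡⟨ *-distribˡ-sumFin 4 μ (λ a → v a * sumFin 4 (λ b → w b * ω₄ (δ a) (δ b))) ⟩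
  μ * sumFin 4 (λ a → v a * sumFin 4 (λ b → w b * ω₄ (δ a) (δ b)))
    ≡⟨ cong (μ *_) (sym (ω₄-lincomb δ v w)) ⟩
  μ * ω₄ (v · δ) (w · δ)
    ≡⟨ cong (μ *_) (ω₄-cong (·-identity v) (·-identity w)) ⟩
  μ * ω₄ v w ∎
  where
  pull-μ : ∀ a → sumFin 4 (λ b → w b * ω₄ (M a) (M b)) ≡ μ * sumFin 4 (λ b → w b * ω₄ (δ a) (δ b))
  pull-μ a = trans (sumFin-cong 4 (λ b → trans (cong (w b *_) (gram a b)) (x[yz]≡y[xz] (w b) μ (ω₄ (δ a) (δ b)))))
                   (*-distribˡ-sumFin 4 μ (λ b → w b * ω₄ (δ a) (δ b)))

-- Index of the basis vector dual to the k-th one, and the sign of the pairing.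
dual : Fin 4 → Fin 4
dual 0F = 3F
dual 1F = 2F
dual 2F = 1F
dual 3F = 0F

sign : Fin 4 → ℚ
sign 0F = 1ℚ
sign 1F = 1ℚ
sign 2F = - 1ℚ
sign 3F = - 1ℚ

adjω : Mat 4 → Mat 4
adjω M j k = sign k * ω₄ (δ j) (M (dual k))

⊗-adjω : ∀ {M μ} → IsSymplecticBasis M μ → ∀ i k → (M ⊗ adjω M) i k ≡ μ * δ i k
⊗-adjω {M} {μ} (pairs gram) i k = begin
  sumFin 4 (λ j → M i j * (sign k * ω₄ (δ j) (M (dual k))))
    ≡⟨ sumFin-cong 4 (λ j → x[yz]≡y[xz] (M i j) (sign k) (ω₄ (δ j) (M (dual k)))) ⟩
  sumFin 4 (λ j → sign k * (M i j * ω₄ (δ j) (M (dual k))))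
    ≡⟨ *-distribˡ-sumFin 4 (sign k) (λ j → M i j * ω₄ (δ j) (M (dual k))) ⟩
  sign k * sumFin 4 (λ j → M i j * ω₄ (δ j) (M (dual k)))
    ≡⟨ cong (sign k *_) (sym (ω₄-lincombˡ (M i) δ (M (dual k)))) ⟩
  sign k * ω₄ (M i · δ) (M (dual k))
    ≡⟨ cong (sign k *_) (trans (ω₄-cong {y = M (dual k)} (·-identity (M i)) (λ _ → refl)) (gram i (dual k))) ⟩
  sign k * (μ * ω₄ (δ i) (δ (dual k)))
    ≡⟨ x[yz]≡y[xz] (sign k) μ (ω₄ (δ i) (δ (dual k))) ⟩
  μ * (sign k * ω₄ (δ i) (δ (dual k)))
    ≡⟨ cong (μ *_) (standard i k) ⟩
  μ * δ i k ∎
  where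
  standard : ∀ i k → sign k * ω₄ (δ i) (δ (dual k)) ≡ δ i k
  standard = toWitness {a? = all? (λ i → all? (λ k → sign k * ω₄ (δ i) (δ (dual k)) ≟ δ i k))} tt

-- The columns of a symplectic basis are independent: the Pfaffian of their Gram matrix is μ².

gram : Mat 4 → Mat 4
gram M a b = ω₄ (M a) (M b)

pf : Mat 4 → ℚ
pf A = A 0F 1F * A 2F 3F - A 0F 2F * A 1F 3F + A 0F 3F * A 1F 2F

-- Both sides equal det M.
pf-gram-ᵀ : ∀ M → pf (gram (M ᵀ)) ≡ pf (gram M)
pf-gram-ᵀ M = ring-identity (M 0F 0F) (M 0F 1F) (M 0F 2F) (M 0F 3F) (M 1F 0F) (M 1F 1F) (M 1F 2F) (M 1F 3F)
                    (M 2F 0F) (M 2F 1F) (M 2F 2F) (M 2F 3F) (M 3F 0F) (M 3F 1F) (M 3F 2F) (M 3F 3F)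
  where
  ring-identity : ∀ (m00 m01 m02 m03 m10 m11 m12 m13 m20 m21 m22 m23 m30 m31 m32 m33 : ℚ) →
    ((m00 * m31 + m10 * m21) - (m30 * m01 + m20 * m11)) * ((m02 * m33 + m12 * m23) - (m32 * m03 + m22 * m13))
    - ((m00 * m32 + m10 * m22) - (m30 * m02 + m20 * m12)) * ((m01 * m33 + m11 * m23) - (m31 * m03 + m21 * m13))
    + ((m00 * m33 + m10 * m23) - (m30 * m03 + m20 * m13)) * ((m01 * m32 + m11 * m22) - (m31 * m02 + m21 * m12))
    ≡ ((m00 * m13 + m01 * m12) - (m03 * m10 + m02 * m11)) * ((m20 * m33 + m21 * m32) - (m23 * m30 + m22 * m31))
    - ((m00 * m23 + m01 * m22) - (m03 * m20 + m02 * m21)) * ((m10 * m33 + m11 * m32) - (m13 * m30 + m12 * m31))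
    + ((m00 * m33 + m01 * m32) - (m03 * m30 + m02 * m31)) * ((m10 * m23 + m11 * m22) - (m13 * m20 + m12 * m21))
  ring-identity = solve-∀ ℚ-ring

pf-gram : ∀ {M μ} → IsSymplecticBasis M μ → pf (gram M) ≡ μ * μ
pf-gram {M} {μ} (pairs gram≡) =
  trans (cong₂ _+_ (cong₂ _-_ (cong₂ _*_ (gram≡ 0F 1F) (gram≡ 2F 3F)) (cong₂ _*_ (gram≡ 0F 2F) (gram≡ 1F 3F)))
                   (cong₂ _*_ (gram≡ 0F 3F) (gram≡ 1F 2F)))
        (ring-identity μ)
  where
  ring-identity : ∀ μ → μ * 0ℚ * (μ * 0ℚ) - μ * 0ℚ * (μ * 0ℚ) + μ * 1ℚ * (μ * 1ℚ) ≡ μ * μ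
  ring-identity = solve-∀ ℚ-ring

-- For an alternating A, pf A · u is a combination of the entries of A u.
pf-kernel : ∀ (A : Mat 4) (u : Vect 4) → (∀ a → A a a ≡ 0ℚ) → (∀ a b → A b a ≡ - A a b) →
  (∀ a → sumFin 4 (λ b → u b * A a b) ≡ 0ℚ) → ∀ c → pf A * u c ≡ 0ℚ
pf-kernel A u diag anti ker = entries
  (A 0F 0F) (A 0F 1F) (A 0F 2F) (A 0F 3F) (A 1F 0F) (A 1F 1F) (A 1F 2F) (A 1F 3F)
  (A 2F 0F) (A 2F 1F) (A 2F 2F) (A 2F 3F) (A 3F 0F) (A 3F 1F) (A 3F 2F) (A 3F 3F)
  (diag 0F) (diag 1F) (diag 2F) (diag 3F)
  (anti 0F 1F) (anti 0F 2F) (anti 0F 3F) (anti 1F 2F) (anti 1F 3F) (anti 2F 3F)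
  (ker 0F) (ker 1F) (ker 2F) (ker 3F)
  where
  P : ℚ → ℚ → ℚ → ℚ → ℚ → ℚ → ℚ
  P a b c d e f = a * f - b * e + c * d
  entries : ∀ g00 g01 g02 g03 g10 g11 g12 g13 g20 g21 g22 g23 g30 g31 g32 g33 →
    g00 ≡ 0ℚ → g11 ≡ 0ℚ → g22 ≡ 0ℚ → g33 ≡ 0ℚ →
    g10 ≡ - g01 → g20 ≡ - g02 → g30 ≡ - g03 → g21 ≡ - g12 → g31 ≡ - g13 → g32 ≡ - g23 →
    u 0F * g00 + (u 1F * g01 + (u 2F * g02 + (u 3F * g03 + 0ℚ))) ≡ 0ℚ →
    u 0F * g10 + (u 1F * g11 + (u 2F * g12 + (u 3F * g13 + 0ℚ))) ≡ 0ℚ →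
    u 0F * g20 + (u 1F * g21 + (u 2F * g22 + (u 3F * g23 + 0ℚ))) ≡ 0ℚ →
    u 0F * g30 + (u 1F * g31 + (u 2F * g32 + (u 3F * g33 + 0ℚ))) ≡ 0ℚ →
    ∀ c → P g01 g02 g03 g12 g13 g23 * u c ≡ 0ℚ
  entries .0ℚ a b c .(- a) .0ℚ d e .(- b) .(- d) .0ℚ f .(- c) .(- e) .(- f) .0ℚ
    refl refl refl refl refl refl refl refl refl refl r₀ r₁ r₂ r₃ = λ where
      0F → trans (sh₀ a b c d e f (u 0F) (u 1F) (u 2F) (u 3F)) (combine (- f) e (- d) r₁ r₂ r₃)
      1F → trans (sh₁ a b c d e f (u 0F) (u 1F) (u 2F) (u 3F)) (combine f (- c) b r₀ r₂ r₃)
      2F → trans (sh₂ a b c d e f (u 0F) (u 1F) (u 2F) (u 3F)) (combine (- e) c (- a) r₀ r₁ r₃)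
      3F → trans (sh₃ a b c d e f (u 0F) (u 1F) (u 2F) (u 3F)) (combine d (- b) a r₀ r₁ r₂)
    where
    combine : ∀ p q r {x y z} → x ≡ 0ℚ → y ≡ 0ℚ → z ≡ 0ℚ → p * x + q * y + r * z ≡ 0ℚ
    combine p q r refl refl refl = ring-identity p q r
      where
      ring-identity : ∀ p q r → p * 0ℚ + q * 0ℚ + r * 0ℚ ≡ 0ℚ
      ring-identity = solve-∀ ℚ-ring
    sh₀ : ∀ a b c d e f u₀ u₁ u₂ u₃ → (a * f - b * e + c * d) * u₀ ≡
      (- f) * (u₀ * (- a) + (u₁ * 0ℚ + (u₂ * d + (u₃ * e + 0ℚ))))
      + e * (u₀ * (- b) + (u₁ * (- d) + (u₂ * 0ℚ + (u₃ * f + 0ℚ))))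
      + (- d) * (u₀ * (- c) + (u₁ * (- e) + (u₂ * (- f) + (u₃ * 0ℚ + 0ℚ))))
    sh₀ = solve-∀ ℚ-ring
    sh₁ : ∀ a b c d e f u₀ u₁ u₂ u₃ → (a * f - b * e + c * d) * u₁ ≡
      f * (u₀ * 0ℚ + (u₁ * a + (u₂ * b + (u₃ * c + 0ℚ))))
      + (- c) * (u₀ * (- b) + (u₁ * (- d) + (u₂ * 0ℚ + (u₃ * f + 0ℚ))))
      + b * (u₀ * (- c) + (u₁ * (- e) + (u₂ * (- f) + (u₃ * 0ℚ + 0ℚ))))
    sh₁ = solve-∀ ℚ-ring
    sh₂ : ∀ a b c d e f u₀ u₁ u₂ u₃ → (a * f - b * e + c * d) * u₂ ≡
      (- e) * (u₀ * 0ℚ + (u₁ * a + (u₂ * b + (u₃ * c + 0ℚ))))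
      + c * (u₀ * (- a) + (u₁ * 0ℚ + (u₂ * d + (u₃ * e + 0ℚ))))
      + (- a) * (u₀ * (- c) + (u₁ * (- e) + (u₂ * (- f) + (u₃ * 0ℚ + 0ℚ))))
    sh₂ = solve-∀ ℚ-ring
    sh₃ : ∀ a b c d e f u₀ u₁ u₂ u₃ → (a * f - b * e + c * d) * u₃ ≡
      d * (u₀ * 0ℚ + (u₁ * a + (u₂ * b + (u₃ * c + 0ℚ))))
      + (- b) * (u₀ * (- a) + (u₁ * 0ℚ + (u₂ * d + (u₃ * e + 0ℚ))))
      + a * (u₀ * (- b) + (u₁ * (- d) + (u₂ * 0ℚ + (u₃ * f + 0ℚ))))
    sh₃ = solve-∀ ℚ-ring

ω₄-zeroʳ : ∀ x {y} → y ≗ 0ᵥ → ω₄ x y ≡ 0ℚ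
ω₄-zeroʳ x y≗0 = trans (ω₄-cong {x = x} (λ _ → refl) y≗0) (ring-identity (x 0F) (x 1F) (x 2F) (x 3F))
  where
  ring-identity : ∀ a₀ a₁ a₂ a₃ → (a₀ * 0ℚ + a₁ * 0ℚ) - (a₃ * 0ℚ + a₂ * 0ℚ) ≡ 0ℚ
  ring-identity = solve-∀ ℚ-ring

symplecticBasis-columns : ∀ {M μ} → IsSymplecticBasis M μ → μ ≢ 0ℚ → LinIndep (M ᵀ)
symplecticBasis-columns {M} {μ} gram≡ μ≢0 u u·Mᵀ≗0 c = x*y≡0⇒y≡0 pf≢0
  (pf-kernel (gram (M ᵀ)) u (λ a → ω₄-self ((M ᵀ) a)) (λ a b → ω₄-antisym ((M ᵀ) b) ((M ᵀ) a)) kernel c)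
  where
  kernel : ∀ a → sumFin 4 (λ b → u b * gram (M ᵀ) a b) ≡ 0ℚ
  kernel a = trans (sym (ω₄-lincombʳ ((M ᵀ) a) u (M ᵀ))) (ω₄-zeroʳ ((M ᵀ) a) u·Mᵀ≗0)
  pf≢0 : pf (gram (M ᵀ)) ≢ 0ℚ
  pf≢0 pf≡0 = *-≢0 μ≢0 μ≢0 (trans (sym (trans (pf-gram-ᵀ M) (pf-gram gram≡))) pf≡0)

adjω-⊗ : ∀ {M μ} → IsSymplecticBasis M μ → μ ≢ 0ℚ → ∀ i j → (adjω M ⊗ M) i j ≡ μ * δ i j
adjω-⊗ {M} {μ} gram≡ μ≢0 i j = x∙y⁻¹≈ε⇒x≈y _ _ (symplecticBasis-columns gram≡ μ≢0 u Mᵀ·u≗0 i)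
  where
  u : Vect 4
  u k = (adjω M ⊗ M) k j - μ * δ k j
  Mᵀ·u≗0 : lincomb u (M ᵀ) ≗ 0ᵥ
  Mᵀ·u≗0 r = begin
    sumFin 4 (λ k → ((adjω M ⊗ M) k j - μ * δ k j) * M r k)
      ≡⟨ sumFin-cong 4 (λ k → distrib (M r k) ((adjω M ⊗ M) k j) μ (δ k j)) ⟩
    sumFin 4 (λ k → M r k * (adjω M ⊗ M) k j + - 1ℚ * (μ * (M r k * δ k j)))
      ≡⟨ sumFin-+ 4 (λ k → M r k * (adjω M ⊗ M) k j) (λ k → - 1ℚ * (μ * (M r k * δ k j))) ⟩
    sumFin 4 (λ k → M r k * (adjω M ⊗ M) k j) + sumFin 4 (λ k → - 1ℚ * (μ * (M r k * δ k j)))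
      ≡⟨ cong₂ _+_ (sym (·-⊗ (M r) (adjω M) M j))
                   (trans (*-distribˡ-sumFin 4 (- 1ℚ) (λ k → μ * (M r k * δ k j)))
                          (cong (- 1ℚ *_) (*-distribˡ-sumFin 4 μ (λ k → M r k * δ k j)))) ⟩
    ((M r · adjω M) · M) j + - 1ℚ * (μ * (M r · δ) j)
      ≡⟨ cong₂ (λ s t → s + - 1ℚ * (μ * t))
               (sumFin-cong 4 (λ k → cong (_* M k j) (⊗-adjω gram≡ r k))) (·-identity (M r) j) ⟩
    sumFin 4 (λ k → μ * δ r k * M k j) + - 1ℚ * (μ * M r j)
      ≡⟨ cong (λ s → s + - 1ℚ * (μ * M r j))
              (trans (sumFin-cong 4 (λ k → *-assoc μ (δ r k) (M k j)))
                     (trans (*-distribˡ-sumFin 4 μ (λ k → δ r k * M k j)) (cong (μ *_) (sumFin-δˡ 4 (λ k → M k j) r)))) ⟩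
    μ * M r j + - 1ℚ * (μ * M r j)
      ≡⟨ cancel (μ * M r j) ⟩
    0ℚ ∎
    where
    distrib : ∀ m x μ d → (x - μ * d) * m ≡ m * x + - 1ℚ * (μ * (m * d))
    distrib = solve-∀ ℚ-ring
    cancel : ∀ x → x + - 1ℚ * x ≡ 0ℚ
    cancel = solve-∀ ℚ-ring

symplecticBasis⇒GSp4 : ∀ {M μ} → IsSymplecticBasis M μ → μ ≢ 0ℚ → IsGSp4 M μ
symplecticBasis⇒GSp4 {M} {μ} basis μ≢0 =
  μ≢0 ,
  (inv μ μ≢0 ⋆ adjω M , ⊗-adjugateʳ M (adjω M) μ μ≢0 (⊗-adjω basis) ,
                        ⊗-adjugateˡ M (adjω M) μ μ≢0 (adjω-⊗ basis μ≢0)) ,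
  symplecticBasis-preserves basis

symplecticBasis-spans : ∀ {M μ} → IsSymplecticBasis M μ → μ ≢ 0ℚ → ∀ v → InSpan M v
symplecticBasis-spans {M} {μ} basis μ≢0 v =
  v · (inv μ μ≢0 ⋆ adjω M) , λ j → sym (·-inverse v (inv μ μ≢0 ⋆ adjω M) M (⊗-adjugateˡ M (adjω M) μ μ≢0 (adjω-⊗ basis μ≢0)) j)

ω₄-δ : ∀ k y → ω₄ (δ k) y ≡ K y k
ω₄-δ 0F y = ring-identity (y 0F) (y 1F) (y 2F) (y 3F)
  where
  ring-identity : ∀ a₀ a₁ a₂ a₃ → (1ℚ * a₃ + 0ℚ * a₂) - (0ℚ * a₀ + 0ℚ * a₁) ≡ a₃
  ring-identity = solve-∀ ℚ-ring
ω₄-δ 1F y = ring-identity (y 0F) (y 1F) (y 2F) (y 3F)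
  where
  ring-identity : ∀ a₀ a₁ a₂ a₃ → (0ℚ * a₃ + 1ℚ * a₂) - (0ℚ * a₀ + 0ℚ * a₁) ≡ a₂
  ring-identity = solve-∀ ℚ-ring
ω₄-δ 2F y = ring-identity (y 0F) (y 1F) (y 2F) (y 3F)
  where
  ring-identity : ∀ a₀ a₁ a₂ a₃ → (0ℚ * a₃ + 0ℚ * a₂) - (0ℚ * a₀ + 1ℚ * a₁) ≡ - a₁
  ring-identity = solve-∀ ℚ-ring
ω₄-δ 3F y = ring-identity (y 0F) (y 1F) (y 2F) (y 3F)
  where
  ring-identity : ∀ a₀ a₁ a₂ a₃ → (0ℚ * a₃ + 0ℚ * a₂) - (1ℚ * a₀ + 0ℚ * a₁) ≡ - a₀
  ring-identity = solve-∀ ℚ-ring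

K-independent : ∀ {u w} → LinIndep (u ∷ w ∷ []) → LinIndep (K u ∷ K w ∷ [])
K-independent {u} {w} indep c Kc≗0 = indep c c≗0
  where
  negated : ∀ a b x y → a * (- x) + (b * (- y) + 0ℚ) ≡ - (a * x + (b * y + 0ℚ))
  negated = solve-∀ ℚ-ring
  c≗0 : lincomb c (u ∷ w ∷ []) ≗ 0ᵥ
  c≗0 0F = neg-injective (trans (sym (negated (c 0F) (c 1F) (u 0F) (w 0F))) (Kc≗0 3F))
  c≗0 1F = neg-injective (trans (sym (negated (c 0F) (c 1F) (u 1F) (w 1F))) (Kc≗0 2F))
  c≗0 2F = Kc≗0 1F
  c≗0 3F = Kc≗0 0F

K-≗0 : ∀ y → K y ≗ 0ᵥ → y ≗ 0ᵥ
K-≗0 y Ky≗0 0F = neg-injective (Ky≗0 3F)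
K-≗0 y Ky≗0 1F = neg-injective (Ky≗0 2F)
K-≗0 y Ky≗0 2F = Ky≗0 1F
K-≗0 y Ky≗0 3F = Ky≗0 0F

-- e is supported on two coordinates where the pairing functionals of u and w are independent.
dualVector : ∀ {u w} μ → LinIndep (u ∷ w ∷ []) → ∃[ e ] (ω₄ e u ≡ μ × ω₄ e w ≡ 0ℚ)
dualVector {u} {w} μ indep with independent⇒minor≢0 (K-independent indep)
... | i , j , Δ≢0 = e , eu≡μ , ew≡0
  where
  Δ Δ⁻¹ : ℚ
  Δ = K u i * K w j - K u j * K w i
  Δ⁻¹ = inv Δ Δ≢0
  coefficients : Fin 2 → ℚ
  coefficients = μ * K w j * Δ⁻¹ ∷ - (μ * K w i * Δ⁻¹) ∷ []
  e : Vect 4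
  e = lincomb coefficients (δ i ∷ δ j ∷ [])
  pairing : ∀ y → ω₄ e y ≡ μ * K w j * Δ⁻¹ * K y i + (- (μ * K w i * Δ⁻¹) * K y j + 0ℚ)
  pairing y = trans (ω₄-lincombˡ coefficients (δ i ∷ δ j ∷ []) y)
    (cong₂ (λ s t → μ * K w j * Δ⁻¹ * s + (- (μ * K w i * Δ⁻¹) * t + 0ℚ)) (ω₄-δ i y) (ω₄-δ j y))
  eu≡μ : ω₄ e u ≡ μ
  eu≡μ = trans (pairing u) (trans (ring-identity μ (K u i) (K u j) (K w i) (K w j) Δ⁻¹)
           (trans (cong (μ *_) (x*inv≡1 Δ Δ≢0)) (*-identityʳ μ)))
    where
    ring-identity : ∀ μ p q r s d → μ * s * d * p + (- (μ * r * d) * q + 0ℚ) ≡ μ * ((p * s - q * r) * d)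
    ring-identity = solve-∀ ℚ-ring
  ew≡0 : ω₄ e w ≡ 0ℚ
  ew≡0 = trans (pairing w) (ring-identity μ (K w i) (K w j) Δ⁻¹)
    where
    ring-identity : ∀ μ r s d → μ * s * d * r + (- (μ * r * d) * s + 0ℚ) ≡ 0ℚ
    ring-identity = solve-∀ ℚ-ring

completeSymplectic : ∀ {E F Z} μ → ω₄ E F ≡ μ → ω₄ E Z ≡ 0ℚ → ω₄ F Z ≡ 0ℚ → ¬ (Z ≗ 0ᵥ) →
  ∃[ X ] (ω₄ X Z ≡ μ × ω₄ X E ≡ 0ℚ × ω₄ X F ≡ 0ℚ)
completeSymplectic {E} {F} {Z} μ ωEF≡μ ωEZ≡0 ωFZ≡0 Z≢0
  with ¬∀⟶∃¬ 4 (λ k → K Z k ≡ 0ℚ) (λ k → K Z k ≟ 0ℚ) (λ KZ≗0 → Z≢0 (K-≗0 Z KZ≗0))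
... | k , κ≢0 = X , XZ≡μ , XE≡0 , XF≡0
  where
  κ κ⁻¹ A B : ℚ
  κ = K Z k
  κ⁻¹ = inv κ κ≢0
  A = ω₄ (δ k) E
  B = ω₄ (δ k) F
  coefficients : Fin 3 → ℚ
  coefficients = μ * κ⁻¹ ∷ - (B * κ⁻¹) ∷ A * κ⁻¹ ∷ []
  X : Vect 4
  X = lincomb coefficients (δ k ∷ E ∷ F ∷ [])
  pairing : ∀ y → ω₄ X y ≡ μ * κ⁻¹ * ω₄ (δ k) y + (- (B * κ⁻¹) * ω₄ E y + (A * κ⁻¹ * ω₄ F y + 0ℚ))
  pairing y = ω₄-lincombˡ coefficients (δ k ∷ E ∷ F ∷ []) y
  XZ≡μ : ω₄ X Z ≡ μ
  XZ≡μ = begin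
    ω₄ X Z ≡⟨ pairing Z ⟩
    μ * κ⁻¹ * ω₄ (δ k) Z + (- (B * κ⁻¹) * ω₄ E Z + (A * κ⁻¹ * ω₄ F Z + 0ℚ))
      ≡⟨ cong₂ (λ s t → μ * κ⁻¹ * ω₄ (δ k) Z + (- (B * κ⁻¹) * s + (A * κ⁻¹ * t + 0ℚ))) ωEZ≡0 ωFZ≡0 ⟩
    μ * κ⁻¹ * ω₄ (δ k) Z + (- (B * κ⁻¹) * 0ℚ + (A * κ⁻¹ * 0ℚ + 0ℚ))
      ≡⟨ ring-identity μ κ⁻¹ (ω₄ (δ k) Z) (B * κ⁻¹) (A * κ⁻¹) ⟩
    μ * (ω₄ (δ k) Z * κ⁻¹)
      ≡⟨ cong (λ t → μ * (t * κ⁻¹)) (ω₄-δ k Z) ⟩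
    μ * (κ * κ⁻¹)
      ≡⟨ trans (cong (μ *_) (x*inv≡1 κ κ≢0)) (*-identityʳ μ) ⟩
    μ ∎
    where
    ring-identity : ∀ μ d z s t → μ * d * z + (- s * 0ℚ + (t * 0ℚ + 0ℚ)) ≡ μ * (z * d)
    ring-identity = solve-∀ ℚ-ring
  XE≡0 : ω₄ X E ≡ 0ℚ
  XE≡0 = trans (pairing E)
    (trans (cong₂ (λ s t → μ * κ⁻¹ * A + (- (B * κ⁻¹) * s + (A * κ⁻¹ * t + 0ℚ)))
                  (ω₄-self E) (trans (ω₄-antisym F E) (cong -_ ωEF≡μ)))
           (ring-identity μ κ⁻¹ A B))
    where
    ring-identity : ∀ μ d a b → μ * d * a + (- (b * d) * 0ℚ + (a * d * (- μ) + 0ℚ)) ≡ 0ℚ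
    ring-identity = solve-∀ ℚ-ring
  XF≡0 : ω₄ X F ≡ 0ℚ
  XF≡0 = trans (pairing F)
    (trans (cong₂ (λ s t → μ * κ⁻¹ * B + (- (B * κ⁻¹) * s + (A * κ⁻¹ * t + 0ℚ))) ωEF≡μ (ω₄-self F))
           (ring-identity μ κ⁻¹ A B))
    where
    ring-identity : ∀ μ d a b → μ * d * b + (- (b * d) * μ + (a * d * 0ℚ + 0ℚ)) ≡ 0ℚ
    ring-identity = solve-∀ ℚ-ring

extendToSymplecticBasis : ∀ {u w} μ → μ ≢ 0ℚ → LinIndep (u ∷ w ∷ []) → ω₄ w u ≡ 0ℚ →
  ∃[ E₂ ] ∃[ E₃ ] IsSymplecticBasis (E₂ ∷ E₃ ∷ w ∷ u ∷ []) μ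
extendToSymplecticBasis {u} {w} μ μ≢0 indep ωwu≡0 = withDual (dualVector μ indep)
  where
  withDual : ∃[ E₂ ] (ω₄ E₂ u ≡ μ × ω₄ E₂ w ≡ 0ℚ) → ∃[ E₂ ] ∃[ E₃ ] IsSymplecticBasis (E₂ ∷ E₃ ∷ w ∷ u ∷ []) μ
  withDual (E₂ , E₂u≡μ , E₂w≡0) =
    withPartner (completeSymplectic {E₂} {u} {w} μ E₂u≡μ E₂w≡0 (ω₄-antisym₀ w u ωwu≡0) (LinIndep⇒≢0 (u ∷ w ∷ []) indep 1F))
    where
    withPartner : ∃[ E₃ ] (ω₄ E₃ w ≡ μ × ω₄ E₃ E₂ ≡ 0ℚ × ω₄ E₃ u ≡ 0ℚ) →
      ∃[ E₂ ] ∃[ E₃ ] IsSymplecticBasis (E₂ ∷ E₃ ∷ w ∷ u ∷ []) μ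
    withPartner (E₃ , E₃w≡μ , E₃E₂≡0 , E₃u≡0) =
      E₂ , E₃ , symplecticBasis E₂u≡μ E₃w≡μ (ω₄-antisym₀ E₃ E₂ E₃E₂≡0) E₂w≡0 E₃u≡0 ωwu≡0

lagrangian-span : ∀ {u w v} → LinIndep (u ∷ w ∷ []) → ω₄ w u ≡ 0ℚ → ω₄ v u ≡ 0ℚ → ω₄ v w ≡ 0ℚ →
  ∃[ ρ ] ∃[ σ ] (v ≗ λ j → ρ * u j + σ * w j)
lagrangian-span {u} {w} {v} indep ωwu≡0 ωvu≡0 ωvw≡0 =
  κ 3F , κ 2F , λ j → trans (v≗κM j) (ring-identity (κ 0F) (κ 1F) (κ 2F) (κ 3F) (E₂ j) (E₃ j) (w j) (u j) κ₀≡0 κ₁≡0)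
  where
  extension : ∃[ E₂ ] ∃[ E₃ ] IsSymplecticBasis (E₂ ∷ E₃ ∷ w ∷ u ∷ []) 1ℚ
  extension = extendToSymplecticBasis {u} {w} 1ℚ 1≢0 indep ωwu≡0
  E₂ : Vect 4
  E₂ = proj₁ extension
  E₃ : Vect 4
  E₃ = proj₁ (proj₂ extension)
  M : Mat 4
  M = E₂ ∷ E₃ ∷ w ∷ u ∷ []
  basis : IsSymplecticBasis M 1ℚ
  basis = proj₂ (proj₂ extension)
  κ : Vect 4
  κ = proj₁ (symplecticBasis-spans basis 1≢0 v)
  v≗κM : v ≗ lincomb κ M
  v≗κM = proj₂ (symplecticBasis-spans basis 1≢0 v)
  coordinate : ∀ b → ω₄ v (M b) ≡ 1ℚ * ω₄ κ (δ b)
  coordinate b = trans (ω₄-cong v≗κM (λ j → sym (lincomb-δ M b j))) (symplecticBasis-preserves basis κ (δ b))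
  κ₀≡0 : κ 0F ≡ 0ℚ
  κ₀≡0 = trans (sym (trans (coordinate 3F) (E₂-coordinate (κ 0F) (κ 1F) (κ 2F) (κ 3F)))) ωvu≡0
    where
    E₂-coordinate : ∀ a₀ a₁ a₂ a₃ → 1ℚ * ((a₀ * 1ℚ + a₁ * 0ℚ) - (a₃ * 0ℚ + a₂ * 0ℚ)) ≡ a₀
    E₂-coordinate = solve-∀ ℚ-ring
  κ₁≡0 : κ 1F ≡ 0ℚ
  κ₁≡0 = trans (sym (trans (coordinate 2F) (E₃-coordinate (κ 0F) (κ 1F) (κ 2F) (κ 3F)))) ωvw≡0
    where
    E₃-coordinate : ∀ a₀ a₁ a₂ a₃ → 1ℚ * ((a₀ * 0ℚ + a₁ * 1ℚ) - (a₃ * 0ℚ + a₂ * 0ℚ)) ≡ a₁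
    E₃-coordinate = solve-∀ ℚ-ring
  ring-identity : ∀ k₀ k₁ k₂ k₃ a b c d → k₀ ≡ 0ℚ → k₁ ≡ 0ℚ →
    k₀ * a + (k₁ * b + (k₂ * c + (k₃ * d + 0ℚ))) ≡ k₃ * d + k₂ * c
  ring-identity .0ℚ .0ℚ k₂ k₃ a b c d refl refl = polynomial-identity k₂ k₃ a b c d
    where
    polynomial-identity : ∀ k₂ k₃ a b c d → 0ℚ * a + (0ℚ * b + (k₂ * c + (k₃ * d + 0ℚ))) ≡ k₃ * d + k₂ * c
    polynomial-identity = solve-∀ ℚ-ring

-- The representatives

-- ω x y = J₆ x ∙ y = K₆ y ∙ x
J₆ K₆ : V → V
J₆ x = - x 5F ∷ - x 4F ∷ - x 3F ∷ x 2F ∷ x 1F ∷ x 0F ∷ []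
K₆ y = y 5F ∷ y 4F ∷ y 3F ∷ - y 2F ∷ - y 1F ∷ - y 0F ∷ []

ω-lincomb : ∀ {k l} (c : Fin k → ℚ) vs (d : Fin l → ℚ) ws →
  ω (lincomb c vs) (lincomb d ws) ≡ sumFin k (λ i → c i * sumFin l (λ j → d j * ω (vs i) (ws j)))
ω-lincomb {k} {l} c vs d ws = begin
  ω (lincomb c vs) (lincomb d ws)
    ≡⟨ ω≡K₆∙ (lincomb c vs) (lincomb d ws) ⟩
  K₆ (lincomb d ws) ∙ lincomb c vs
    ≡⟨ ∙-lincomb (K₆ (lincomb d ws)) c vs ⟩
  sumFin k (λ i → c i * (K₆ (lincomb d ws) ∙ vs i))
    ≡⟨ sumFin-cong k (λ i → cong (c i *_) (begin
         K₆ (lincomb d ws) ∙ vs i               ≡⟨ sym (ω≡K₆∙ (vs i) (lincomb d ws)) ⟩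
         ω (vs i) (lincomb d ws)                ≡⟨ ω≡J₆∙ (vs i) (lincomb d ws) ⟩
         J₆ (vs i) ∙ lincomb d ws               ≡⟨ ∙-lincomb (J₆ (vs i)) d ws ⟩
         sumFin l (λ j → d j * (J₆ (vs i) ∙ ws j)) ≡⟨ sumFin-cong l (λ j → cong (d j *_) (sym (ω≡J₆∙ (vs i) (ws j)))) ⟩
         sumFin l (λ j → d j * ω (vs i) (ws j)) ∎)) ⟩
  sumFin k (λ i → c i * sumFin l (λ j → d j * ω (vs i) (ws j))) ∎
  where
  ω≡J₆∙ : ∀ x y → ω x y ≡ J₆ x ∙ y
  ω≡J₆∙ x y = ring-identity (x 0F) (x 1F) (x 2F) (x 3F) (x 4F) (x 5F) (y 0F) (y 1F) (y 2F) (y 3F) (y 4F) (y 5F)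
    where
    ring-identity : ∀ a₀ a₁ a₂ a₃ a₄ a₅ b₀ b₁ b₂ b₃ b₄ b₅ →
      ((a₀ * b₅ + a₁ * b₄) + a₂ * b₃) - ((a₅ * b₀ + a₄ * b₁) + a₃ * b₂)
      ≡ (- a₅) * b₀ + ((- a₄) * b₁ + ((- a₃) * b₂ + (a₂ * b₃ + (a₁ * b₄ + (a₀ * b₅ + 0ℚ)))))
    ring-identity = solve-∀ ℚ-ring
  ω≡K₆∙ : ∀ x y → ω x y ≡ K₆ y ∙ x
  ω≡K₆∙ x y = ring-identity (x 0F) (x 1F) (x 2F) (x 3F) (x 4F) (x 5F) (y 0F) (y 1F) (y 2F) (y 3F) (y 4F) (y 5F)
    where
    ring-identity : ∀ a₀ a₁ a₂ a₃ a₄ a₅ b₀ b₁ b₂ b₃ b₄ b₅ →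
      ((a₀ * b₅ + a₁ * b₄) + a₂ * b₃) - ((a₅ * b₀ + a₄ * b₁) + a₃ * b₂)
      ≡ b₅ * a₀ + (b₄ * a₁ + (b₃ * a₂ + ((- b₂) * a₃ + ((- b₁) * a₄ + ((- b₀) * a₅ + 0ℚ)))))
    ring-identity = solve-∀ ℚ-ring

Isotropic-intro : ∀ {k} {vs : Fin k → V} → (∀ i j → ω (vs i) (vs j) ≡ 0ℚ) → Isotropic vs
Isotropic-intro {k} {vs} ω≡0 x y (c , x≗) (d , y≗) = begin
  ω x y                                 ≡⟨ ω-cong x≗ y≗ ⟩
  ω (lincomb c vs) (lincomb d vs)       ≡⟨ ω-lincomb c vs d vs ⟩
  sumFin k (λ i → c i * sumFin k (λ j → d j * ω (vs i) (vs j)))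
    ≡⟨ sumFin-≡0 k (λ i → trans (cong (c i *_) (sumFin-≡0 k (λ j → trans (cong (d j *_) (ω≡0 i j)) (*-zeroʳ (d j)))))
                                 (*-zeroʳ (c i))) ⟩
  0ℚ                                    ∎

LinIndep-byUnitColumns : ∀ {k} (vs : Fin k → V) (col : Fin k → Fin 6) →
  {True (all? (λ i → all? (λ m → vs m (col i) ≟ δ m i)))} → LinIndep vs
LinIndep-byUnitColumns vs col {unit} c c·vs≗0 i =
  trans (sym (lincomb-unitColumn c vs (col i) i (toWitness unit i))) (c·vs≗0 (col i))

Isotropic-byComputation : ∀ {k} (vs : Fin k → V) →
  {True (all? (λ i → all? (λ j → ω (vs i) (vs j) ≟ 0ℚ)))} → Isotropic vs
Isotropic-byComputation vs {iso} = Isotropic-intro (toWitness iso)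

InSpan-byComputation : ∀ {k l} (vs : Fin k → V) (ws : Fin l → V) (C : Fin l → Fin k → ℚ) →
  {True (all? (λ i → all? (λ j → ws i j ≟ lincomb (C i) vs j)))} → ∀ i → InSpan vs (ws i)
InSpan-byComputation vs ws C {ws≡Cvs} i = C i , toWitness ws≡Cvs i

rep-isIsotropicFlag : ∀ i → IsIsotropicFlag (rep i)
rep-isIsotropicFlag 0F =
  LinIndep-byUnitColumns (F2 (rep 0F)) (4F ∷ 3F ∷ []) ,
  LinIndep-byUnitColumns (F3 (rep 0F)) (5F ∷ 4F ∷ 3F ∷ []) ,
  InSpan-byComputation (F3 (rep 0F)) (F2 (rep 0F)) ((0ℚ ∷ 1ℚ ∷ 0ℚ ∷ []) ∷ (0ℚ ∷ 0ℚ ∷ 1ℚ ∷ []) ∷ []) ,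
  Isotropic-byComputation (F3 (rep 0F))
rep-isIsotropicFlag 1F =
  LinIndep-byUnitColumns (F2 (rep 1F)) (5F ∷ 4F ∷ []) ,
  LinIndep-byUnitColumns (F3 (rep 1F)) (5F ∷ 4F ∷ 3F ∷ []) ,
  InSpan-byComputation (F3 (rep 1F)) (F2 (rep 1F)) ((1ℚ ∷ 0ℚ ∷ 0ℚ ∷ []) ∷ (0ℚ ∷ 1ℚ ∷ 0ℚ ∷ []) ∷ []) ,
  Isotropic-byComputation (F3 (rep 1F))
rep-isIsotropicFlag 2F =
  LinIndep-byUnitColumns (F2 (rep 2F)) (4F ∷ 3F ∷ []) ,
  LinIndep-byUnitColumns (F3 (rep 2F)) (5F ∷ 4F ∷ 3F ∷ []) ,
  InSpan-byComputation (F3 (rep 2F)) (F2 (rep 2F)) ((1ℚ ∷ 1ℚ ∷ 0ℚ ∷ []) ∷ (0ℚ ∷ 0ℚ ∷ 1ℚ ∷ []) ∷ []) ,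
  Isotropic-byComputation (F3 (rep 2F))
rep-isIsotropicFlag 3F =
  LinIndep-byUnitColumns (F2 (rep 3F)) (4F ∷ 3F ∷ []) ,
  LinIndep-byUnitColumns (F3 (rep 3F)) (4F ∷ 0F ∷ 3F ∷ []) ,
  InSpan-byComputation (F3 (rep 3F)) (F2 (rep 3F)) ((1ℚ ∷ 0ℚ ∷ 0ℚ ∷ []) ∷ (0ℚ ∷ 0ℚ ∷ 1ℚ ∷ []) ∷ []) ,
  Isotropic-byComputation (F3 (rep 3F))
rep-isIsotropicFlag 4F =
  LinIndep-byUnitColumns (F2 (rep 4F)) (4F ∷ 0F ∷ []) ,
  LinIndep-byUnitColumns (F3 (rep 4F)) (4F ∷ 0F ∷ 3F ∷ []) ,
  InSpan-byComputation (F3 (rep 4F)) (F2 (rep 4F)) ((1ℚ ∷ 0ℚ ∷ 0ℚ ∷ []) ∷ (0ℚ ∷ 1ℚ ∷ 0ℚ ∷ []) ∷ []) ,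
  Isotropic-byComputation (F3 (rep 4F))

-- The group H and its orbits

embed-inverse : ∀ v a a' b b' → IsIdentity (a ⊗ a') → IsIdentity (b ⊗ b') →
  (v · embed a b) · embed a' b' ≗ v
embed-inverse v a a' b b' aa'≡1 bb'≡1 j = begin
  ((v · embed a b) · embed a' b') j                             ≡⟨ ·-embed (v · embed a b) a' b' j ⟩
  join (π₁ (v · embed a b) · a') (π₂ (v · embed a b) · b') j    ≡⟨ join-cong W₁-part W₂-part j ⟩
  join (π₁ v) (π₂ v) j                                          ≡⟨ join-π v j ⟩
  v j                                                           ∎
  where
  W₁-part : π₁ (v · embed a b) · a' ≗ π₁ v
  W₁-part k = trans (·-congˡ a' (π₁-·-embed v a b) k) (·-inverse (π₁ v) a a' aa'≡1 k)
  W₂-part : π₂ (v · embed a b) · b' ≗ π₂ v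
  W₂-part k = trans (·-congˡ b' (π₂-·-embed v a b) k) (·-inverse (π₂ v) b b' bb'≡1 k)

InH-inverse : ∀ g₁ g₂ → InH g₁ g₂ →
  ∃[ g₁' ] ∃[ g₂' ] (InH g₁' g₂' × ∀ v → (v · embed g₁ g₂) · embed g₁' g₂' ≗ v)
InH-inverse g₁ g₂ (det≢0 , μ , (μ≢0 , (g₂' , g₂g₂'≡1 , g₂'g₂≡1) , preserves) , det≡μ) =
  g₁' , g₂' , (det'≢0 , μ⁻¹ , (inv-≢0 μ μ≢0 , (g₂ , g₂'g₂≡1 , g₂g₂'≡1) , preserves') , det'≡μ⁻¹) ,
  λ v → embed-inverse v g₁ g₁' g₂ g₂' g₁g₁'≡1 g₂g₂'≡1
  where
  μ⁻¹ : ℚ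
  μ⁻¹ = inv μ μ≢0
  g₁' : Mat 2
  g₁' = μ⁻¹ ⋆ adj₂ g₁
  g₁g₁'≡1 : IsIdentity (g₁ ⊗ g₁')
  g₁g₁'≡1 = ⊗-adjugateʳ g₁ (adj₂ g₁) μ μ≢0 (λ i j → trans (⊗-adj₂ g₁ i j) (cong (_* δ i j) det≡μ))
  det'≡μ⁻¹ : det₂ g₁' ≡ μ⁻¹
  det'≡μ⁻¹ = begin
    det₂ g₁'             ≡⟨ ring-identity (g₁ 0F 0F) (g₁ 0F 1F) (g₁ 1F 0F) (g₁ 1F 1F) μ⁻¹ ⟩
    μ⁻¹ * (μ⁻¹ * det₂ g₁) ≡⟨ cong (μ⁻¹ *_) (trans (cong (μ⁻¹ *_) det≡μ) (*-comm μ⁻¹ μ)) ⟩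
    μ⁻¹ * (μ * μ⁻¹)       ≡⟨ cong (μ⁻¹ *_) (x*inv≡1 μ μ≢0) ⟩
    μ⁻¹ * 1ℚ              ≡⟨ *-identityʳ μ⁻¹ ⟩
    μ⁻¹                   ∎
    where
    ring-identity : ∀ p q r s c → (c * s) * (c * p) - (c * (- q)) * (c * (- r)) ≡ c * (c * (p * s - q * r))
    ring-identity = solve-∀ ℚ-ring
  det'≢0 : det₂ g₁' ≢ 0ℚ
  det'≢0 det'≡0 = inv-≢0 μ μ≢0 (trans (sym det'≡μ⁻¹) det'≡0)
  preserves' : ∀ v w → ω₄ (v · g₂') (w · g₂') ≡ μ⁻¹ * ω₄ v w
  preserves' v w = begin
    ω₄ (v · g₂') (w · g₂')                     ≡⟨ sym (inv*[x*y]≡y μ μ≢0 (ω₄ (v · g₂') (w · g₂'))) ⟩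
    μ⁻¹ * (μ * ω₄ (v · g₂') (w · g₂'))         ≡⟨ cong (μ⁻¹ *_) (sym (preserves (v · g₂') (w · g₂'))) ⟩
    μ⁻¹ * ω₄ ((v · g₂') · g₂) ((w · g₂') · g₂)
      ≡⟨ cong (μ⁻¹ *_) (ω₄-cong (·-inverse v g₂' g₂ g₂'g₂≡1) (·-inverse w g₂' g₂ g₂'g₂≡1)) ⟩
    μ⁻¹ * ω₄ v w                               ∎

SameHOrbit-sym : ∀ F G → SameHOrbit F G → SameHOrbit G F
SameHOrbit-sym F G (g₁ , g₂ , g∈H , F₂≈ , F₃≈) = invert (InH-inverse g₁ g₂ g∈H)
  where
  invert : ∃[ g₁' ] ∃[ g₂' ] (InH g₁' g₂' × ∀ v → (v · embed g₁ g₂) · embed g₁' g₂' ≗ v) → SameHOrbit G F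
  invert (g₁' , g₂' , g'∈H , undo) = g₁' , g₂' , g'∈H , back (F2 F) (F2 G) F₂≈ , back (F3 F) (F3 G) F₃≈
    where
    back : ∀ {k} (vs ws : Fin k → V) → SameSpan (λ i → vs i · embed g₁ g₂) ws →
      SameSpan (λ i → ws i · embed g₁' g₂') vs
    back vs ws vsg≈ws = SameSpan-trans (SameSpan-· (embed g₁' g₂') (SameSpan-sym vsg≈ws))
                                       (SameSpan-≗ (λ i → undo (vs i)))

InH-g₂-invertible : ∀ g₁ g₂ → InH g₁ g₂ → Invertible g₂
InH-g₂-invertible g₁ g₂ (_ , _ , (_ , g₂-invertible , _) , _) = g₂-invertible

MeetsW₁ MeetsW₂ InsideW₂ : ∀ {k} → (Fin k → V) → Set
MeetsW₁ vs = ∃[ x ] (InSpan vs x × π₂ x ≗ 0ᵥ × ¬ (x ≗ 0ᵥ))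
MeetsW₂ vs = ∃[ x ] (InSpan vs x × π₁ x ≗ 0ᵥ × ¬ (x ≗ 0ᵥ))
InsideW₂ vs = ∀ x → InSpan vs x → π₁ x ≗ 0ᵥ

H-Invariant : (∀ {k} → (Fin k → V) → Set) → Set
H-Invariant P = ∀ g₁ g₂ → InH g₁ g₂ → ∀ {k} (vs ws : Fin k → V) →
  SameSpan (λ i → vs i · embed g₁ g₂) ws → P vs → P ws

module _ (g₁ : Mat 2) (g₂ : Mat 4) (g∈H : InH g₁ g₂) {k} (vs ws : Fin k → V)
         (vsg≈ws : SameSpan (λ i → vs i · embed g₁ g₂) ws) where

  private
    g₁' : Mat 2
    g₁' = inverse₂ g₁ (proj₁ g∈H)

    g₂' : Mat 4
    g₂' = proj₁ (InH-g₂-invertible g₁ g₂ g∈H)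

    image : ∀ {x} → InSpan vs x → InSpan ws (x · embed g₁ g₂)
    image x∈vs = proj₁ (vsg≈ws _) (InSpan-· (embed g₁ g₂) x∈vs)

    image≢0 : ∀ {x} → ¬ (x ≗ 0ᵥ) → ¬ (x · embed g₁ g₂ ≗ 0ᵥ)
    image≢0 {x} x≢0 xg≗0 = x≢0 (π-≗0
      (·-injective g₁ g₁' (inverse₂-isRightInverse g₁ (proj₁ g∈H))
        (λ j → trans (sym (π₁-·-embed x g₁ g₂ j)) (π₁-≗0 xg≗0 j)))
      (·-injective g₂ g₂' (proj₁ (proj₂ (InH-g₂-invertible g₁ g₂ g∈H)))
        (λ j → trans (sym (π₂-·-embed x g₁ g₂ j)) (π₂-≗0 xg≗0 j))))

  MeetsW₁-transport : MeetsW₁ vs → MeetsW₁ ws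
  MeetsW₁-transport (x , x∈vs , π₂x≗0 , x≢0) =
    x · embed g₁ g₂ , image x∈vs , (λ j → trans (π₂-·-embed x g₁ g₂ j) (·-zero g₂ π₂x≗0 j)) , image≢0 x≢0

  MeetsW₂-transport : MeetsW₂ vs → MeetsW₂ ws
  MeetsW₂-transport (x , x∈vs , π₁x≗0 , x≢0) =
    x · embed g₁ g₂ , image x∈vs , (λ j → trans (π₁-·-embed x g₁ g₂ j) (·-zero g₁ π₁x≗0 j)) , image≢0 x≢0

  InsideW₂-transport : InsideW₂ vs → InsideW₂ ws
  InsideW₂-transport inside y y∈ws with proj₂ (vsg≈ws y) y∈ws
  ... | c , y≗cvsg = λ j → begin
    π₁ y j
      ≡⟨ π₁-cong (λ m → trans (y≗cvsg m) (sym (lincomb-· c vs (embed g₁ g₂) m))) j ⟩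
    π₁ (lincomb c vs · embed g₁ g₂) j              ≡⟨ π₁-·-embed (lincomb c vs) g₁ g₂ j ⟩
    (π₁ (lincomb c vs) · g₁) j                     ≡⟨ ·-zero g₁ (inside (lincomb c vs) (c , λ _ → refl)) j ⟩
    0ℚ                                             ∎

separated₂ : ∀ {P : ∀ {k} → (Fin k → V) → Set} → H-Invariant P →
  ∀ F G → P (F2 F) → ¬ P (F2 G) → ¬ SameHOrbit F G
separated₂ invariant F G PF ¬PG (g₁ , g₂ , g∈H , F₂≈ , _) = ¬PG (invariant g₁ g₂ g∈H (F2 F) (F2 G) F₂≈ PF)

separated₃ : ∀ {P : ∀ {k} → (Fin k → V) → Set} → H-Invariant P →
  ∀ F G → P (F3 F) → ¬ P (F3 G) → ¬ SameHOrbit F G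
separated₃ invariant F G PF ¬PG (g₁ , g₂ , g∈H , _ , F₃≈) = ¬PG (invariant g₁ g₂ g∈H (F3 F) (F3 G) F₃≈ PF)

private
  coefficient≡0 : ∀ {k} (vs : Fin k → V) {x} c → x ≗ lincomb c vs →
    ∀ j i → (∀ m → vs m j ≡ δ m i) → x j ≡ 0ℚ → c i ≡ 0ℚ
  coefficient≡0 vs c x≗cvs j i unit xⱼ≡0 =
    trans (sym (lincomb-unitColumn c vs j i unit)) (trans (sym (x≗cvs j)) xⱼ≡0)

  lincomb≗0 : ∀ {k} (vs : Fin k → V) {x c} → x ≗ lincomb c vs → c ≗ 0ᵥ → x ≗ 0ᵥ
  lincomb≗0 vs x≗cvs c≗0 j = trans (x≗cvs j) (lincomb-zero vs c≗0 j)

f₁f₂f₃-meetsW₁ : MeetsW₁ (v3 f₁ f₂ f₃)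
f₁f₂f₃-meetsW₁ = f₁ , InSpan-member (v3 f₁ f₂ f₃) 0F , (λ { 0F → refl ; 1F → refl ; 2F → refl ; 3F → refl }) ,
                 (λ f₁≗0 → 1≢0 (f₁≗0 5F))

f₁f₂-meetsW₁ : MeetsW₁ (v2 f₁ f₂)
f₁f₂-meetsW₁ = f₁ , InSpan-member (v2 f₁ f₂) 0F , (λ { 0F → refl ; 1F → refl ; 2F → refl ; 3F → refl }) ,
               (λ f₁≗0 → 1≢0 (f₁≗0 5F))

f₁₂e₁₂f₃-avoidsW₁ : ¬ MeetsW₁ (v3 (f₁ ⊕ f₂) (e₁ ⊖ e₂) f₃)
f₁₂e₁₂f₃-avoidsW₁ (x , (c , x≗cvs) , π₂x≗0 , x≢0) = x≢0 (lincomb≗0 (v3 (f₁ ⊕ f₂) (e₁ ⊖ e₂) f₃) x≗cvs c≗0)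
  where
  e₂-coordinate : ∀ a b c → a * 0ℚ + (b * - 1ℚ + (c * 0ℚ + 0ℚ)) ≡ - b
  e₂-coordinate = solve-∀ ℚ-ring
  c≗0 : c ≗ 0ᵥ
  c≗0 0F = coefficient≡0 (v3 (f₁ ⊕ f₂) (e₁ ⊖ e₂) f₃) c x≗cvs 4F 0F (λ { 0F → refl ; 1F → refl ; 2F → refl }) (π₂x≗0 3F)
  c≗0 1F = neg-injective (trans (sym (e₂-coordinate (c 0F) (c 1F) (c 2F))) (trans (sym (x≗cvs 1F)) (π₂x≗0 0F)))
  c≗0 2F = coefficient≡0 (v3 (f₁ ⊕ f₂) (e₁ ⊖ e₂) f₃) c x≗cvs 3F 2F (λ { 0F → refl ; 1F → refl ; 2F → refl }) (π₂x≗0 2F)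

f₁₂f₃-avoidsW₁ : ¬ MeetsW₁ (v2 (f₁ ⊕ f₂) f₃)
f₁₂f₃-avoidsW₁ (x , (c , x≗cvs) , π₂x≗0 , x≢0) = x≢0 (lincomb≗0 (v2 (f₁ ⊕ f₂) f₃) x≗cvs c≗0)
  where
  c≗0 : c ≗ 0ᵥ
  c≗0 0F = coefficient≡0 (v2 (f₁ ⊕ f₂) f₃) c x≗cvs 4F 0F (λ { 0F → refl ; 1F → refl }) (π₂x≗0 3F)
  c≗0 1F = coefficient≡0 (v2 (f₁ ⊕ f₂) f₃) c x≗cvs 3F 1F (λ { 0F → refl ; 1F → refl }) (π₂x≗0 2F)

f₁₂f₃-meetsW₂ : MeetsW₂ (v2 (f₁ ⊕ f₂) f₃)
f₁₂f₃-meetsW₂ = f₃ , InSpan-member (v2 (f₁ ⊕ f₂) f₃) 1F , (λ { 0F → refl ; 1F → refl }) , (λ f₃≗0 → 1≢0 (f₃≗0 3F))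

f₁₂e₁₂-avoidsW₂ : ¬ MeetsW₂ (v2 (f₁ ⊕ f₂) (e₁ ⊖ e₂))
f₁₂e₁₂-avoidsW₂ (x , (c , x≗cvs) , π₁x≗0 , x≢0) = x≢0 (lincomb≗0 (v2 (f₁ ⊕ f₂) (e₁ ⊖ e₂)) x≗cvs c≗0)
  where
  c≗0 : c ≗ 0ᵥ
  c≗0 0F = coefficient≡0 (v2 (f₁ ⊕ f₂) (e₁ ⊖ e₂)) c x≗cvs 5F 0F (λ { 0F → refl ; 1F → refl }) (π₁x≗0 1F)
  c≗0 1F = coefficient≡0 (v2 (f₁ ⊕ f₂) (e₁ ⊖ e₂)) c x≗cvs 0F 1F (λ { 0F → refl ; 1F → refl }) (π₁x≗0 0F)

f₂f₃-insideW₂ : InsideW₂ (v2 f₂ f₃)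
f₂f₃-insideW₂ x (c , x≗cvs) 0F = trans (x≗cvs 0F) (lincomb-zeroColumn c (v2 f₂ f₃) 0F (λ { 0F → refl ; 1F → refl }))
f₂f₃-insideW₂ x (c , x≗cvs) 1F = trans (x≗cvs 5F) (lincomb-zeroColumn c (v2 f₂ f₃) 5F (λ { 0F → refl ; 1F → refl }))

notInsideW₂ : ∀ {k} (vs : Fin k → V) i → ¬ (π₁ (vs i) ≗ 0ᵥ) → ¬ InsideW₂ vs
notInsideW₂ vs i π₁vsᵢ≢0 inside = π₁vsᵢ≢0 (inside (vs i) (InSpan-member vs i))

rep-orbits-distinct : (i j : Fin 5) → i ≢ j → ¬ SameHOrbit (rep i) (rep j)
rep-orbits-distinct 0F 1F _ = separated₂ {P = InsideW₂} InsideW₂-transport (rep 0F) (rep 1F) f₂f₃-insideW₂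
  (notInsideW₂ (v2 f₁ f₂) 0F (λ π₁f₁≗0 → 1≢0 (π₁f₁≗0 1F)))
rep-orbits-distinct 0F 2F _ = separated₂ {P = InsideW₂} InsideW₂-transport (rep 0F) (rep 2F) f₂f₃-insideW₂
  (notInsideW₂ (v2 (f₁ ⊕ f₂) f₃) 0F (λ π₁f₁₂≗0 → 1≢0 (π₁f₁₂≗0 1F)))
rep-orbits-distinct 0F 3F _ =
  separated₃ {P = MeetsW₁} MeetsW₁-transport (rep 0F) (rep 3F) f₁f₂f₃-meetsW₁ f₁₂e₁₂f₃-avoidsW₁
rep-orbits-distinct 0F 4F _ =
  separated₃ {P = MeetsW₁} MeetsW₁-transport (rep 0F) (rep 4F) f₁f₂f₃-meetsW₁ f₁₂e₁₂f₃-avoidsW₁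
rep-orbits-distinct 1F 2F _ =
  separated₂ {P = MeetsW₁} MeetsW₁-transport (rep 1F) (rep 2F) f₁f₂-meetsW₁ f₁₂f₃-avoidsW₁
rep-orbits-distinct 1F 3F _ =
  separated₃ {P = MeetsW₁} MeetsW₁-transport (rep 1F) (rep 3F) f₁f₂f₃-meetsW₁ f₁₂e₁₂f₃-avoidsW₁
rep-orbits-distinct 1F 4F _ =
  separated₃ {P = MeetsW₁} MeetsW₁-transport (rep 1F) (rep 4F) f₁f₂f₃-meetsW₁ f₁₂e₁₂f₃-avoidsW₁
rep-orbits-distinct 2F 3F _ =
  separated₃ {P = MeetsW₁} MeetsW₁-transport (rep 2F) (rep 3F) f₁f₂f₃-meetsW₁ f₁₂e₁₂f₃-avoidsW₁
rep-orbits-distinct 2F 4F _ =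
  separated₃ {P = MeetsW₁} MeetsW₁-transport (rep 2F) (rep 4F) f₁f₂f₃-meetsW₁ f₁₂e₁₂f₃-avoidsW₁
rep-orbits-distinct 3F 4F _ =
  separated₂ {P = MeetsW₂} MeetsW₂-transport (rep 3F) (rep 4F) f₁₂f₃-meetsW₂ f₁₂e₁₂-avoidsW₂
rep-orbits-distinct 1F 0F i≢j = rep-orbits-distinct 0F 1F (i≢j ∘ sym) ∘ SameHOrbit-sym (rep 1F) (rep 0F)
rep-orbits-distinct 2F 0F i≢j = rep-orbits-distinct 0F 2F (i≢j ∘ sym) ∘ SameHOrbit-sym (rep 2F) (rep 0F)
rep-orbits-distinct 3F 0F i≢j = rep-orbits-distinct 0F 3F (i≢j ∘ sym) ∘ SameHOrbit-sym (rep 3F) (rep 0F)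
rep-orbits-distinct 4F 0F i≢j = rep-orbits-distinct 0F 4F (i≢j ∘ sym) ∘ SameHOrbit-sym (rep 4F) (rep 0F)
rep-orbits-distinct 2F 1F i≢j = rep-orbits-distinct 1F 2F (i≢j ∘ sym) ∘ SameHOrbit-sym (rep 2F) (rep 1F)
rep-orbits-distinct 3F 1F i≢j = rep-orbits-distinct 1F 3F (i≢j ∘ sym) ∘ SameHOrbit-sym (rep 3F) (rep 1F)
rep-orbits-distinct 4F 1F i≢j = rep-orbits-distinct 1F 4F (i≢j ∘ sym) ∘ SameHOrbit-sym (rep 4F) (rep 1F)
rep-orbits-distinct 3F 2F i≢j = rep-orbits-distinct 2F 3F (i≢j ∘ sym) ∘ SameHOrbit-sym (rep 3F) (rep 2F)
rep-orbits-distinct 4F 2F i≢j = rep-orbits-distinct 2F 4F (i≢j ∘ sym) ∘ SameHOrbit-sym (rep 4F) (rep 2F)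
rep-orbits-distinct 4F 3F i≢j = rep-orbits-distinct 3F 4F (i≢j ∘ sym) ∘ SameHOrbit-sym (rep 4F) (rep 3F)
rep-orbits-distinct 0F 0F i≢i = λ _ → i≢i refl
rep-orbits-distinct 1F 1F i≢i = λ _ → i≢i refl
rep-orbits-distinct 2F 2F i≢i = λ _ → i≢i refl
rep-orbits-distinct 3F 3F i≢i = λ _ → i≢i refl
rep-orbits-distinct 4F 4F i≢i = λ _ → i≢i refl

-- Normal forms of isotropic flags

record HFrame : Set where
  field
    E₁ F₁ : Vect 2
    E₂ E₃ F₃ F₂ : Vect 4
    μ : ℚ
    μ≢0 : μ ≢ 0ℚ
    ω₁E₁F₁≡μ : ω₁ E₁ F₁ ≡ μ
    symplectic : IsSymplecticBasis (E₂ ∷ E₃ ∷ F₃ ∷ F₂ ∷ []) μ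

  g₁ : Mat 2
  g₁ = E₁ ∷ F₁ ∷ []

  g₂ : Mat 4
  g₂ = E₂ ∷ E₃ ∷ F₃ ∷ F₂ ∷ []

  inH : InH g₁ g₂
  inH = (λ det≡0 → μ≢0 (trans (sym ω₁E₁F₁≡μ) det≡0)) , μ , symplecticBasis⇒GSp4 symplectic μ≢0 , ω₁E₁F₁≡μ

  f̂₁ f̂₂ f̂₃ f̂₁₂ ê₁₂ : V
  f̂₁ = join F₁ 0ᵥ
  f̂₂ = join 0ᵥ F₂
  f̂₃ = join 0ᵥ F₃
  f̂₁₂ = join F₁ F₂
  ê₁₂ = join E₁ (λ k → - E₂ k)

  image₂ : Fin 5 → Fin 2 → V
  image₂ 0F = f̂₂ ∷ f̂₃ ∷ []
  image₂ 1F = f̂₁ ∷ f̂₂ ∷ []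
  image₂ 2F = f̂₁₂ ∷ f̂₃ ∷ []
  image₂ 3F = f̂₁₂ ∷ f̂₃ ∷ []
  image₂ 4F = f̂₁₂ ∷ ê₁₂ ∷ []

  image₃ : Fin 5 → Fin 3 → V
  image₃ 0F = f̂₁ ∷ f̂₂ ∷ f̂₃ ∷ []
  image₃ 1F = f̂₁ ∷ f̂₂ ∷ f̂₃ ∷ []
  image₃ 2F = f̂₁ ∷ f̂₂ ∷ f̂₃ ∷ []
  image₃ 3F = f̂₁₂ ∷ ê₁₂ ∷ f̂₃ ∷ []
  image₃ 4F = f̂₁₂ ∷ ê₁₂ ∷ f̂₃ ∷ []

open HFrame using (image₂; image₃)

unit-· : ∀ {n} (u : Vect n) k (g : Mat n) → (∀ i → u i ≡ δ k i) → u · g ≗ g k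
unit-· {n} u k g u≗δ j = trans (sumFin-cong n (λ i → cong (_* g i j) (u≗δ i))) (sumFin-δˡ n (λ i → g i j) k)

module _ (a : Mat 2) (b : Mat 4) where

  private
    image : ∀ v {x y} → π₁ v · a ≗ x → π₂ v · b ≗ y → v · embed a b ≗ join x y
    image v π₁≗ π₂≗ j = trans (·-embed v a b j) (join-cong π₁≗ π₂≗ j)

  f₁-·-embed : f₁ · embed a b ≗ join (a 1F) 0ᵥ
  f₁-·-embed = image f₁ (unit-· (π₁ f₁) 1F a λ { 0F → refl ; 1F → refl })
                        (·-zero {u = π₂ f₁} b λ { 0F → refl ; 1F → refl ; 2F → refl ; 3F → refl })

  f₂-·-embed : f₂ · embed a b ≗ join 0ᵥ (b 3F)
  f₂-·-embed = image f₂ (·-zero {u = π₁ f₂} a λ { 0F → refl ; 1F → refl })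
                        (unit-· (π₂ f₂) 3F b λ { 0F → refl ; 1F → refl ; 2F → refl ; 3F → refl })

  f₃-·-embed : f₃ · embed a b ≗ join 0ᵥ (b 2F)
  f₃-·-embed = image f₃ (·-zero {u = π₁ f₃} a λ { 0F → refl ; 1F → refl })
                        (unit-· (π₂ f₃) 2F b λ { 0F → refl ; 1F → refl ; 2F → refl ; 3F → refl })

  f₁₂-·-embed : (f₁ ⊕ f₂) · embed a b ≗ join (a 1F) (b 3F)
  f₁₂-·-embed = image (f₁ ⊕ f₂) (unit-· (π₁ (f₁ ⊕ f₂)) 1F a λ { 0F → refl ; 1F → refl })
                                (unit-· (π₂ (f₁ ⊕ f₂)) 3F b λ { 0F → refl ; 1F → refl ; 2F → refl ; 3F → refl })

  e₁₂-·-embed : (e₁ ⊖ e₂) · embed a b ≗ join (a 0F) (λ k → - b 0F k)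
  e₁₂-·-embed = image (e₁ ⊖ e₂) (unit-· (π₁ (e₁ ⊖ e₂)) 0F a λ { 0F → refl ; 1F → refl })
                                (λ j → ring-identity (b 0F j) (b 1F j) (b 2F j) (b 3F j))
    where
    ring-identity : ∀ p q r s → - 1ℚ * p + (0ℚ * q + (0ℚ * r + (0ℚ * s + 0ℚ))) ≡ - p
    ring-identity = solve-∀ ℚ-ring

module _ (h : HFrame) where
  open HFrame h using (g₁; g₂)

  rep-image₂ : ∀ i k → F2 (rep i) k · embed g₁ g₂ ≗ image₂ h i k
  rep-image₂ 0F 0F = f₂-·-embed g₁ g₂
  rep-image₂ 0F 1F = f₃-·-embed g₁ g₂
  rep-image₂ 1F 0F = f₁-·-embed g₁ g₂
  rep-image₂ 1F 1F = f₂-·-embed g₁ g₂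
  rep-image₂ 2F 0F = f₁₂-·-embed g₁ g₂
  rep-image₂ 2F 1F = f₃-·-embed g₁ g₂
  rep-image₂ 3F 0F = f₁₂-·-embed g₁ g₂
  rep-image₂ 3F 1F = f₃-·-embed g₁ g₂
  rep-image₂ 4F 0F = f₁₂-·-embed g₁ g₂
  rep-image₂ 4F 1F = e₁₂-·-embed g₁ g₂

  rep-image₃ : ∀ i k → F3 (rep i) k · embed g₁ g₂ ≗ image₃ h i k
  rep-image₃ 0F 0F = f₁-·-embed g₁ g₂
  rep-image₃ 0F 1F = f₂-·-embed g₁ g₂
  rep-image₃ 0F 2F = f₃-·-embed g₁ g₂
  rep-image₃ 1F 0F = f₁-·-embed g₁ g₂
  rep-image₃ 1F 1F = f₂-·-embed g₁ g₂
  rep-image₃ 1F 2F = f₃-·-embed g₁ g₂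
  rep-image₃ 2F 0F = f₁-·-embed g₁ g₂
  rep-image₃ 2F 1F = f₂-·-embed g₁ g₂
  rep-image₃ 2F 2F = f₃-·-embed g₁ g₂
  rep-image₃ 3F 0F = f₁₂-·-embed g₁ g₂
  rep-image₃ 3F 1F = e₁₂-·-embed g₁ g₂
  rep-image₃ 3F 2F = f₃-·-embed g₁ g₂
  rep-image₃ 4F 0F = f₁₂-·-embed g₁ g₂
  rep-image₃ 4F 1F = e₁₂-·-embed g₁ g₂
  rep-image₃ 4F 2F = f₃-·-embed g₁ g₂

  rep-image₂≈ : ∀ i → SameSpan (λ k → F2 (rep i) k · embed g₁ g₂) (image₂ h i)
  rep-image₂≈ i = SameSpan-≗ (rep-image₂ i)

  rep-image₃≈ : ∀ i → SameSpan (λ k → F3 (rep i) k · embed g₁ g₂) (image₃ h i)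
  rep-image₃≈ i = SameSpan-≗ (rep-image₃ i)

record RepImage (P : Fin 2 → V) (L : Fin 3 → V) : Set where
  constructor repImage
  field
    index : Fin 5
    frame : HFrame
    F₂≈ : SameSpan (image₂ frame index) P
    F₃≈ : SameSpan (image₃ frame index) L

RepImage-resp : ∀ {P P' L L'} → RepImage P L → SameSpan P P' → SameSpan L L' → RepImage P' L'
RepImage-resp {P} {P'} {L} {L'} (repImage i h P≈ L≈) P≈P' L≈L' = repImage i h
  (SameSpan-trans {us = image₂ h i} {vs = P} {ws = P'} P≈ P≈P')
  (SameSpan-trans {us = image₃ h i} {vs = L} {ws = L'} L≈ L≈L')

RepImage⇒SameHOrbit : ∀ F → RepImage (F2 F) (F3 F) → ∃[ i ] SameHOrbit F (rep i)
RepImage⇒SameHOrbit F (repImage i h F₂≈ F₃≈) = i , SameHOrbit-sym (rep i) F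
  (g₁ , g₂ , inH , SameSpan-trans {us = λ k → F2 (rep i) k · embed g₁ g₂} {vs = image₂ h i} {ws = F2 F} (rep-image₂≈ h i) F₂≈
                 , SameSpan-trans {us = λ k → F3 (rep i) k · embed g₁ g₂} {vs = image₃ h i} {ws = F3 F} (rep-image₃≈ h i) F₃≈)
  where open HFrame h using (g₁; g₂; inH)

repImage-≗ : ∀ i (h : HFrame) {P L} → (∀ k → image₂ h i k ≗ P k) → (∀ k → image₃ h i k ≗ L k) → RepImage P L
repImage-≗ i h {P} {L} P≗ L≗ = repImage i h (SameSpan-≗ {vs = image₂ h i} {ws = P} P≗) (SameSpan-≗ {vs = image₃ h i} {ws = L} L≗)

∷-≗₂ : ∀ {a b a' b' : V} → a ≗ a' → b ≗ b' → ∀ k → (a ∷ b ∷ []) k ≗ (a' ∷ b' ∷ []) k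
∷-≗₂ a≗ b≗ 0F = a≗
∷-≗₂ a≗ b≗ 1F = b≗

∷-≗₃ : ∀ {a b c a' b' c' : V} → a ≗ a' → b ≗ b' → c ≗ c' → ∀ k → (a ∷ b ∷ c ∷ []) k ≗ (a' ∷ b' ∷ c' ∷ []) k
∷-≗₃ a≗ b≗ c≗ 0F = a≗
∷-≗₃ a≗ b≗ c≗ 1F = b≗
∷-≗₃ a≗ b≗ c≗ 2F = c≗

frame : (F₁ : Vect 2) (F₂ F₃ : Vect 4) → ¬ (F₁ ≗ 0ᵥ) → LinIndep (F₂ ∷ F₃ ∷ []) → ω₄ F₃ F₂ ≡ 0ℚ → HFrame
frame F₁ F₂ F₃ F₁≢0 indep ω₄F₃F₂≡0 = record
  { E₁ = E₁ ; F₁ = F₁ ; E₂ = proj₁ extension ; E₃ = proj₁ (proj₂ extension) ; F₃ = F₃ ; F₂ = F₂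
  ; μ = ω₁ E₁ F₁ ; μ≢0 = proj₂ (W₁-dual F₁ F₁≢0) ; ω₁E₁F₁≡μ = refl ; symplectic = proj₂ (proj₂ extension) }
  where
  E₁ : Vect 2
  E₁ = proj₁ (W₁-dual F₁ F₁≢0)
  extension : ∃[ E₂ ] ∃[ E₃ ] IsSymplecticBasis (E₂ ∷ E₃ ∷ F₃ ∷ F₂ ∷ []) (ω₁ E₁ F₁)
  extension = extendToSymplecticBasis (ω₁ E₁ F₁) (proj₂ (W₁-dual F₁ F₁≢0)) indep ω₄F₃F₂≡0

MixedFrame : V → V → V → Set
MixedFrame x y z = Σ HFrame (λ h → HFrame.f̂₁₂ h ≗ x × HFrame.ê₁₂ h ≗ y × HFrame.f̂₃ h ≗ z)

mixedFrame : ∀ x y z → π₁ z ≗ 0ᵥ → ¬ (z ≗ 0ᵥ) → ω₁ (π₁ y) (π₁ x) ≢ 0ℚ →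
  ω y x ≡ 0ℚ → ω x z ≡ 0ℚ → ω y z ≡ 0ℚ → MixedFrame x y z
mixedFrame x y z π₁z≗0 z≢0 μ≢0 ωyx≡0 ωxz≡0 ωyz≡0 = h , join-π x , ê₁₂≗y , join-W₂ π₁z≗0
  where
  μ : ℚ
  μ = ω₁ (π₁ y) (π₁ x)
  E₂ : Vect 4
  E₂ k = - π₂ y k
  ω₄E₂F₂≡μ : ω₄ E₂ (π₂ x) ≡ μ
  ω₄E₂F₂≡μ = trans (ω₄-negˡ (π₂ y) (π₂ x))
    (trans (cong -_ (inverseʳ-unique μ _ (trans (sym (ω-split y x)) ωyx≡0))) (⁻¹-involutive μ))
  ω₄E₂F₃≡0 : ω₄ E₂ (π₂ z) ≡ 0ℚ
  ω₄E₂F₃≡0 = trans (ω₄-negˡ (π₂ y) (π₂ z)) (cong -_ (ω₄-π₂ y z ωyz≡0 π₁z≗0))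
  ω₄F₂F₃≡0 : ω₄ (π₂ x) (π₂ z) ≡ 0ℚ
  ω₄F₂F₃≡0 = ω₄-π₂ x z ωxz≡0 π₁z≗0
  completion : ∃[ X ] (ω₄ X (π₂ z) ≡ μ × ω₄ X E₂ ≡ 0ℚ × ω₄ X (π₂ x) ≡ 0ℚ)
  completion = completeSymplectic {E₂} {π₂ x} {π₂ z} μ ω₄E₂F₂≡μ ω₄E₂F₃≡0 ω₄F₂F₃≡0
                 (λ π₂z≗0 → z≢0 (π-≗0 π₁z≗0 π₂z≗0))
  E₃ : Vect 4
  E₃ = proj₁ completion
  h : HFrame
  h = record
    { E₁ = π₁ y ; F₁ = π₁ x ; E₂ = E₂ ; E₃ = E₃ ; F₃ = π₂ z ; F₂ = π₂ x ; μ = μ ; μ≢0 = μ≢0 ; ω₁E₁F₁≡μ = refl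
    ; symplectic = symplecticBasis ω₄E₂F₂≡μ (proj₁ (proj₂ completion))
        (ω₄-antisym₀ E₃ E₂ (proj₁ (proj₂ (proj₂ completion)))) ω₄E₂F₃≡0
        (proj₂ (proj₂ (proj₂ completion))) (ω₄-antisym₀ (π₂ x) (π₂ z) ω₄F₂F₃≡0) }
  ê₁₂≗y : join (π₁ y) (λ k → - E₂ k) ≗ y
  ê₁₂≗y j = sym (≗-join (λ _ → refl) (λ k → sym (⁻¹-involutive (π₂ y k))) j)

det₂-firstRow : ∀ p q → det₂ ((p ∷ q ∷ []) ∷ δ 1F ∷ []) ≡ p
det₂-firstRow p q = ring-identity p q
  where
  ring-identity : ∀ p q → p * 1ℚ - q * 0ℚ ≡ p
  ring-identity = solve-∀ ℚ-ring

det₂-lastRow : ∀ p q → det₂ (δ 0F ∷ (p ∷ q ∷ []) ∷ []) ≡ q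
det₂-lastRow p q = ring-identity p q
  where
  ring-identity : ∀ p q → 1ℚ * q - 0ℚ * p ≡ q
  ring-identity = solve-∀ ℚ-ring

det₃-firstRow : ∀ p q r → det₃ ((p ∷ q ∷ r ∷ []) ∷ δ 1F ∷ δ 2F ∷ []) ≡ p
det₃-firstRow p q r = ring-identity p q r
  where
  ring-identity : ∀ p q r → p * (1ℚ * 1ℚ - 0ℚ * 0ℚ) - q * (0ℚ * 1ℚ - 0ℚ * 0ℚ) + r * (0ℚ * 0ℚ - 1ℚ * 0ℚ) ≡ p
  ring-identity = solve-∀ ℚ-ring

det₃-middleRow : ∀ p q r → det₃ (δ 0F ∷ (p ∷ q ∷ r ∷ []) ∷ δ 2F ∷ []) ≡ q
det₃-middleRow p q r = ring-identity p q r
  where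
  ring-identity : ∀ p q r → 1ℚ * (q * 1ℚ - r * 0ℚ) - 0ℚ * (p * 1ℚ - r * 0ℚ) + 0ℚ * (p * 0ℚ - q * 0ℚ) ≡ q
  ring-identity = solve-∀ ℚ-ring

det₃-lastRow : ∀ p q r → det₃ (δ 0F ∷ δ 1F ∷ (p ∷ q ∷ r ∷ []) ∷ []) ≡ r
det₃-lastRow p q r = ring-identity p q r
  where
  ring-identity : ∀ p q r → 1ℚ * (1ℚ * r - 0ℚ * q) - 0ℚ * (0ℚ * r - 0ℚ * p) + 0ℚ * (0ℚ * q - 1ℚ * p) ≡ r
  ring-identity = solve-∀ ℚ-ring

det₃-rotated : ∀ p q r → det₃ ((p ∷ q ∷ r ∷ []) ∷ δ 0F ∷ δ 1F ∷ []) ≡ r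
det₃-rotated p q r = ring-identity p q r
  where
  ring-identity : ∀ p q r → p * (0ℚ * 0ℚ - 0ℚ * 1ℚ) - q * (1ℚ * 0ℚ - 0ℚ * 0ℚ) + r * (1ℚ * 1ℚ - 0ℚ * 0ℚ) ≡ r
  ring-identity = solve-∀ ℚ-ring

private
  ≢0-by : ∀ {d x} → d ≡ x → x ≢ 0ℚ → d ≢ 0ℚ
  ≢0-by d≡x x≢0 d≡0 = x≢0 (trans (sym d≡x) d≡0)

normalForm-F₂⊆W₂ : ∀ x z c → π₁ x ≗ 0ᵥ → π₁ z ≗ 0ᵥ → LinIndep (x ∷ z ∷ c ∷ []) → Isotropic (x ∷ z ∷ c ∷ []) →
  RepImage (x ∷ z ∷ []) (x ∷ z ∷ c ∷ [])
normalForm-F₂⊆W₂ x z c π₁x≗0 π₁z≗0 indep iso =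
  fromSpan (lagrangian-span {π₂ x} {π₂ z} {π₂ c} indep₂ ω₄zx≡0 (ω₄-π₂ c x (ω≡0 2F 0F) π₁x≗0) (ω₄-π₂ c z (ω≡0 2F 1F) π₁z≗0))
  where
  ω≡0 : ∀ i j → ω ((x ∷ z ∷ c ∷ []) i) ((x ∷ z ∷ c ∷ []) j) ≡ 0ℚ
  ω≡0 = Isotropic⇒ω≡0 (x ∷ z ∷ c ∷ []) iso
  indep₂ : LinIndep (π₂ x ∷ π₂ z ∷ [])
  indep₂ = LinIndep-W₂ (x ∷ z ∷ []) (λ { 0F → π₁x≗0 ; 1F → π₁z≗0 }) (LinIndep-₀₁ x z c indep)
  ω₄zx≡0 : ω₄ (π₂ z) (π₂ x) ≡ 0ℚ
  ω₄zx≡0 = ω₄-π₂ z x (ω≡0 1F 0F) π₁x≗0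
  fromSpan : ∃[ ρ ] ∃[ σ ] (π₂ c ≗ λ j → ρ * π₂ x j + σ * π₂ z j) → RepImage (x ∷ z ∷ []) (x ∷ z ∷ c ∷ [])
  fromSpan (ρ , σ , π₂c≗) = RepImage-resp
    (repImage-≗ 0F h (∷-≗₂ (join-W₂ π₁x≗0) (join-W₂ π₁z≗0)) (∷-≗₃ (join-W₁ π₂ℓ≗0) (join-W₂ π₁x≗0) (join-W₂ π₁z≗0)))
    (SameSpan-refl (x ∷ z ∷ [])) (proj₁ change)
    where
    ℓ-coefficients : Fin 3 → ℚ
    ℓ-coefficients = - ρ ∷ - σ ∷ 1ℚ ∷ []
    ℓ : V
    ℓ = lincomb ℓ-coefficients (x ∷ z ∷ c ∷ [])
    π₂ℓ≗0 : π₂ ℓ ≗ 0ᵥ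
    π₂ℓ≗0 j = trans (π₂-lincomb ℓ-coefficients (x ∷ z ∷ c ∷ []) j) (ring-identity ρ σ (π₂ x j) (π₂ z j) (π₂ c j) (π₂c≗ j))
      where
      ring-identity : ∀ ρ σ a b c → c ≡ ρ * a + σ * b → - ρ * a + (- σ * b + (1ℚ * c + 0ℚ)) ≡ 0ℚ
      ring-identity ρ σ a b .(ρ * a + σ * b) refl = polynomial-identity ρ σ a b
        where
        polynomial-identity : ∀ ρ σ a b → - ρ * a + (- σ * b + (1ℚ * (ρ * a + σ * b) + 0ℚ)) ≡ 0ℚ
        polynomial-identity = solve-∀ ℚ-ring
    π₁ℓ≢0 : ¬ (π₁ ℓ ≗ 0ᵥ)
    π₁ℓ≢0 π₁ℓ≗0 = 1≢0 (indep ℓ-coefficients (π-≗0 π₁ℓ≗0 π₂ℓ≗0) 2F)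
    h : HFrame
    h = frame (π₁ ℓ) (π₂ x) (π₂ z) π₁ℓ≢0 indep₂ ω₄zx≡0
    change : BasisChange (ℓ ∷ x ∷ z ∷ []) (x ∷ z ∷ c ∷ [])
    change = basisChange₃ (x ∷ z ∷ c ∷ []) (ℓ ∷ x ∷ z ∷ []) (ℓ-coefficients ∷ δ 0F ∷ δ 1F ∷ [])
      (λ { 0F _ → refl ; 1F j → sym (lincomb-δ (x ∷ z ∷ c ∷ []) 0F j) ; 2F j → sym (lincomb-δ (x ∷ z ∷ c ∷ []) 1F j) })
      (≢0-by (det₃-rotated (- ρ) (- σ) 1ℚ) 1≢0)

normalForm-F₃∩W₂ : ∀ x z m → π₁ z ≗ 0ᵥ → π₁ m ≗ 0ᵥ → LinIndep (x ∷ z ∷ m ∷ []) → Isotropic (x ∷ z ∷ m ∷ []) →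
  RepImage (x ∷ z ∷ []) (x ∷ z ∷ m ∷ [])
normalForm-F₃∩W₂ x z m π₁z≗0 π₁m≗0 indep iso = fromSpan (lagrangian-span {π₂ z} {π₂ m} {π₂ x} indep₂ ω₄mz≡0 ω₄xz≡0 ω₄xm≡0)
  where
  ω≡0 : ∀ i j → ω ((x ∷ z ∷ m ∷ []) i) ((x ∷ z ∷ m ∷ []) j) ≡ 0ℚ
  ω≡0 = Isotropic⇒ω≡0 (x ∷ z ∷ m ∷ []) iso
  indep₂ : LinIndep (π₂ z ∷ π₂ m ∷ [])
  indep₂ = LinIndep-W₂ (z ∷ m ∷ []) (λ { 0F → π₁z≗0 ; 1F → π₁m≗0 }) (LinIndep-₁₂ x z m indep)
  ω₄mz≡0 : ω₄ (π₂ m) (π₂ z) ≡ 0ℚ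
  ω₄mz≡0 = ω₄-π₂ m z (ω≡0 2F 1F) π₁z≗0
  ω₄xz≡0 : ω₄ (π₂ x) (π₂ z) ≡ 0ℚ
  ω₄xz≡0 = ω₄-π₂ x z (ω≡0 0F 1F) π₁z≗0
  ω₄xm≡0 : ω₄ (π₂ x) (π₂ m) ≡ 0ℚ
  ω₄xm≡0 = ω₄-π₂ x m (ω≡0 0F 2F) π₁m≗0
  fromSpan : ∃[ ρ ] ∃[ σ ] (π₂ x ≗ λ j → ρ * π₂ z j + σ * π₂ m j) → RepImage (x ∷ z ∷ []) (x ∷ z ∷ m ∷ [])
  fromSpan (ρ , σ , π₂x≗) = bySign (σ ≟ 0ℚ)
    where
    -- the W₁-component x − ρ z − σ m of x
    y₁-coefficients : Fin 3 → ℚ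
    y₁-coefficients = 1ℚ ∷ - ρ ∷ - σ ∷ []
    y₁ : V
    y₁ = lincomb y₁-coefficients (x ∷ z ∷ m ∷ [])
    π₂y₁≗0 : π₂ y₁ ≗ 0ᵥ
    π₂y₁≗0 j = trans (π₂-lincomb y₁-coefficients (x ∷ z ∷ m ∷ []) j) (ring-identity ρ σ (π₂ x j) (π₂ z j) (π₂ m j) (π₂x≗ j))
      where
      ring-identity : ∀ ρ σ a b c → a ≡ ρ * b + σ * c → 1ℚ * a + (- ρ * b + (- σ * c + 0ℚ)) ≡ 0ℚ
      ring-identity ρ σ .(ρ * b + σ * c) b c refl = polynomial-identity ρ σ b c
        where
        polynomial-identity : ∀ ρ σ b c → 1ℚ * (ρ * b + σ * c) + (- ρ * b + (- σ * c + 0ℚ)) ≡ 0ℚ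
        polynomial-identity = solve-∀ ℚ-ring
    π₁y₁≗π₁x : π₁ y₁ ≗ π₁ x
    π₁y₁≗π₁x j = trans (π₁-lincomb y₁-coefficients (x ∷ z ∷ m ∷ []) j)
                       (ring-identity ρ σ (π₁ x j) (π₁ z j) (π₁ m j) (π₁z≗0 j) (π₁m≗0 j))
      where
      ring-identity : ∀ ρ σ a b c → b ≡ 0ℚ → c ≡ 0ℚ → 1ℚ * a + (- ρ * b + (- σ * c + 0ℚ)) ≡ a
      ring-identity ρ σ a .0ℚ .0ℚ refl refl = polynomial-identity ρ σ a
        where
        polynomial-identity : ∀ ρ σ a → 1ℚ * a + (- ρ * 0ℚ + (- σ * 0ℚ + 0ℚ)) ≡ a
        polynomial-identity = solve-∀ ℚ-ring
    f̂₁≗y₁ : join (π₁ x) 0ᵥ ≗ y₁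
    f̂₁≗y₁ j = sym (≗-join π₁y₁≗π₁x π₂y₁≗0 j)
    π₁x≢0 : ¬ (π₁ x ≗ 0ᵥ)
    π₁x≢0 π₁x≗0 = 1≢0 (indep y₁-coefficients (π-≗0 (λ j → trans (π₁y₁≗π₁x j) (π₁x≗0 j)) π₂y₁≗0) 0F)
    bySign : Dec (σ ≡ 0ℚ) → RepImage (x ∷ z ∷ []) (x ∷ z ∷ m ∷ [])
    bySign (yes σ≡0) = RepImage-resp
      (repImage-≗ 1F h (∷-≗₂ f̂₁≗y₁ (join-W₂ π₁z≗0)) (∷-≗₃ f̂₁≗y₁ (join-W₂ π₁z≗0) (join-W₂ π₁m≗0)))
      (proj₁ change₂) (proj₁ change₃)
      where
      h : HFrame
      h = frame (π₁ x) (π₂ z) (π₂ m) π₁x≢0 indep₂ ω₄mz≡0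
      y₁≗ : y₁ ≗ lincomb (1ℚ ∷ - ρ ∷ []) (x ∷ z ∷ [])
      y₁≗ j = ring-identity ρ σ (x j) (z j) (m j) σ≡0
        where
        ring-identity : ∀ ρ σ a b c → σ ≡ 0ℚ → 1ℚ * a + (- ρ * b + (- σ * c + 0ℚ)) ≡ 1ℚ * a + (- ρ * b + 0ℚ)
        ring-identity ρ .0ℚ a b c refl = polynomial-identity ρ a b c
          where
          polynomial-identity : ∀ ρ a b c → 1ℚ * a + (- ρ * b + (- 0ℚ * c + 0ℚ)) ≡ 1ℚ * a + (- ρ * b + 0ℚ)
          polynomial-identity = solve-∀ ℚ-ring
      change₂ : BasisChange (y₁ ∷ z ∷ []) (x ∷ z ∷ [])
      change₂ = basisChange₂ (x ∷ z ∷ []) (y₁ ∷ z ∷ []) ((1ℚ ∷ - ρ ∷ []) ∷ δ 1F ∷ [])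
        (λ { 0F → y₁≗ ; 1F j → sym (lincomb-δ (x ∷ z ∷ []) 1F j) }) (≢0-by (det₂-firstRow 1ℚ (- ρ)) 1≢0)
      change₃ : BasisChange (y₁ ∷ z ∷ m ∷ []) (x ∷ z ∷ m ∷ [])
      change₃ = basisChange₃ (x ∷ z ∷ m ∷ []) (y₁ ∷ z ∷ m ∷ []) (y₁-coefficients ∷ δ 1F ∷ δ 2F ∷ [])
        (λ { 0F _ → refl ; 1F j → sym (lincomb-δ (x ∷ z ∷ m ∷ []) 1F j) ; 2F j → sym (lincomb-δ (x ∷ z ∷ m ∷ []) 2F j) })
        (≢0-by (det₃-firstRow 1ℚ (- ρ) (- σ)) 1≢0)
    bySign (no σ≢0) = RepImage-resp
      (repImage-≗ 2F h (∷-≗₂ (join-π x) (join-W₂ π₁z≗0)) (∷-≗₃ f̂₁≗y₁ f̂₂≗y₂ (join-W₂ π₁z≗0)))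
      (SameSpan-refl (x ∷ z ∷ [])) (proj₁ change₃)
      where
      -- the W₂-component ρ z + σ m of x
      y₂-coefficients : Fin 3 → ℚ
      y₂-coefficients = 0ℚ ∷ ρ ∷ σ ∷ []
      y₂ : V
      y₂ = lincomb y₂-coefficients (x ∷ z ∷ m ∷ [])
      f̂₂≗y₂ : join 0ᵥ (π₂ x) ≗ y₂
      f̂₂≗y₂ j = sym (≗-join
        (λ k → trans (π₁-lincomb y₂-coefficients (x ∷ z ∷ m ∷ []) k)
                     (W₁-part ρ σ (π₁ x k) (π₁ z k) (π₁ m k) (π₁z≗0 k) (π₁m≗0 k)))
        (λ k → trans (π₂-lincomb y₂-coefficients (x ∷ z ∷ m ∷ []) k) (W₂-part ρ σ (π₂ x k) (π₂ z k) (π₂ m k) (π₂x≗ k))) j)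
        where
        W₁-part : ∀ ρ σ a b c → b ≡ 0ℚ → c ≡ 0ℚ → 0ℚ * a + (ρ * b + (σ * c + 0ℚ)) ≡ 0ℚ
        W₁-part ρ σ a .0ℚ .0ℚ refl refl = polynomial-identity ρ σ a
          where
          polynomial-identity : ∀ ρ σ a → 0ℚ * a + (ρ * 0ℚ + (σ * 0ℚ + 0ℚ)) ≡ 0ℚ
          polynomial-identity = solve-∀ ℚ-ring
        W₂-part : ∀ ρ σ a b c → a ≡ ρ * b + σ * c → 0ℚ * a + (ρ * b + (σ * c + 0ℚ)) ≡ a
        W₂-part ρ σ .(ρ * b + σ * c) b c refl = polynomial-identity ρ σ b c
          where
          polynomial-identity : ∀ ρ σ b c → 0ℚ * (ρ * b + σ * c) + (ρ * b + (σ * c + 0ℚ)) ≡ ρ * b + σ * c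
          polynomial-identity = solve-∀ ℚ-ring
      indep₂′ : LinIndep (π₂ x ∷ π₂ z ∷ [])
      indep₂′ c c·≗0 = λ { 0F → c₀≡0 ; 1F → c₁≡0 }
        where
        relation : ∀ a b X Z M → X ≡ ρ * Z + σ * M → a * X + (b * Z + 0ℚ) ≡ 0ℚ →
          (a * ρ + b) * Z + (a * σ * M + 0ℚ) ≡ 0ℚ
        relation a b .(ρ * Z + σ * M) Z M refl e = trans (ring-identity a b ρ σ Z M) e
          where
          ring-identity : ∀ a b ρ σ Z M → (a * ρ + b) * Z + (a * σ * M + 0ℚ) ≡ a * (ρ * Z + σ * M) + (b * Z + 0ℚ)
          ring-identity = solve-∀ ℚ-ring
        d≡0 : ∀ i → (c 0F * ρ + c 1F ∷ c 0F * σ ∷ []) i ≡ 0ℚ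
        d≡0 = indep₂ (c 0F * ρ + c 1F ∷ c 0F * σ ∷ [])
          (λ j → relation (c 0F) (c 1F) (π₂ x j) (π₂ z j) (π₂ m j) (π₂x≗ j) (c·≗0 j))
        c₀≡0 : c 0F ≡ 0ℚ
        c₀≡0 = x*y≡0⇒y≡0 σ≢0 (trans (*-comm σ (c 0F)) (d≡0 1F))
        c₁≡0 : c 1F ≡ 0ℚ
        c₁≡0 = ring-identity (c 0F) (c 1F) c₀≡0 (d≡0 0F)
          where
          ring-identity : ∀ a b → a ≡ 0ℚ → a * ρ + b ≡ 0ℚ → b ≡ 0ℚ
          ring-identity .0ℚ b refl e = trans (sym (polynomial-identity ρ b)) e
            where
            polynomial-identity : ∀ ρ b → 0ℚ * ρ + b ≡ b
            polynomial-identity = solve-∀ ℚ-ring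
      h : HFrame
      h = frame (π₁ x) (π₂ x) (π₂ z) π₁x≢0 indep₂′ (ω₄-antisym₀ (π₂ x) (π₂ z) ω₄xz≡0)
      change₃ : BasisChange (y₁ ∷ y₂ ∷ z ∷ []) (x ∷ z ∷ m ∷ [])
      change₃ = basisChange₃ (x ∷ z ∷ m ∷ []) (y₁ ∷ y₂ ∷ z ∷ [])
        (y₁-coefficients ∷ y₂-coefficients ∷ δ 1F ∷ [])
        (λ { 0F _ → refl ; 1F _ → refl ; 2F j → sym (lincomb-δ (x ∷ z ∷ m ∷ []) 1F j) })
        (≢0-by det (neg-≢0 σ≢0))
        where
        det : det₃ (y₁-coefficients ∷ y₂-coefficients ∷ δ 1F ∷ []) ≡ - σ
        det = ring-identity ρ σ
          where
          ring-identity : ∀ ρ σ → 1ℚ * (ρ * 0ℚ - σ * 1ℚ) - (- ρ) * (0ℚ * 0ℚ - σ * 0ℚ) + (- σ) * (0ℚ * 1ℚ - ρ * 0ℚ) ≡ - σ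
          ring-identity = solve-∀ ℚ-ring

normalForm-F₃↠W₁ : ∀ x z c → π₁ z ≗ 0ᵥ → ω₁ (π₁ c) (π₁ x) ≢ 0ℚ → LinIndep (x ∷ z ∷ c ∷ []) →
  Isotropic (x ∷ z ∷ c ∷ []) → RepImage (x ∷ z ∷ []) (x ∷ z ∷ c ∷ [])
normalForm-F₃↠W₁ x z c π₁z≗0 μ≢0 indep iso = fromFrame
  (mixedFrame x c z π₁z≗0 (LinIndep⇒≢0 (x ∷ z ∷ c ∷ []) indep 1F) μ≢0 (ω≡0 2F 0F) (ω≡0 0F 1F) (ω≡0 2F 1F))
  where
  ω≡0 : ∀ i j → ω ((x ∷ z ∷ c ∷ []) i) ((x ∷ z ∷ c ∷ []) j) ≡ 0ℚ
  ω≡0 = Isotropic⇒ω≡0 (x ∷ z ∷ c ∷ []) iso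
  fromFrame : MixedFrame x c z → RepImage (x ∷ z ∷ []) (x ∷ z ∷ c ∷ [])
  fromFrame (h , f̂₁₂≗x , ê₁₂≗c , f̂₃≗z) =
    RepImage-resp (repImage-≗ 3F h (∷-≗₂ f̂₁₂≗x f̂₃≗z) (∷-≗₃ f̂₁₂≗x ê₁₂≗c f̂₃≗z))
      (SameSpan-refl (x ∷ z ∷ [])) (SameSpan-swap₁₂ x c z)

normalForm-F₂∩W₂ : ∀ x z c → π₁ z ≗ 0ᵥ → LinIndep (x ∷ z ∷ c ∷ []) → Isotropic (x ∷ z ∷ c ∷ []) →
  RepImage (x ∷ z ∷ []) (x ∷ z ∷ c ∷ [])
normalForm-F₂∩W₂ x z c π₁z≗0 indep iso = byPairing (ω₁ (π₁ c) (π₁ x) ≟ 0ℚ)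
  where
  byPairing : Dec (ω₁ (π₁ c) (π₁ x) ≡ 0ℚ) → RepImage (x ∷ z ∷ []) (x ∷ z ∷ c ∷ [])
  byPairing (no μ≢0) = normalForm-F₃↠W₁ x z c π₁z≗0 μ≢0 indep iso
  byPairing (yes ω₁≡0) = fromRelation (ω₁-relation (π₁ x) (π₁ c) (ω₁-antisym₀ (π₁ c) (π₁ x) ω₁≡0))
    where
    fromRelation : ∃[ a ] ∃[ b ] ((a ≢ 0ℚ ⊎ b ≢ 0ℚ) × lincomb (a ∷ b ∷ []) (π₁ x ∷ π₁ c ∷ []) ≗ 0ᵥ) →
      RepImage (x ∷ z ∷ []) (x ∷ z ∷ c ∷ [])
    fromRelation (a , b , nontrivial , relation) = byCoefficient (b ≟ 0ℚ)
      where
      byCoefficient : Dec (b ≡ 0ℚ) → RepImage (x ∷ z ∷ []) (x ∷ z ∷ c ∷ [])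
      byCoefficient (yes b≡0) = normalForm-F₂⊆W₂ x z c π₁x≗0 π₁z≗0 indep iso
        where
        a≢0 : a ≢ 0ℚ
        a≢0 = [ id , (λ b≢0 → ⊥-elim (b≢0 b≡0)) ]′ nontrivial
        π₁x≗0 : π₁ x ≗ 0ᵥ
        π₁x≗0 j = x*y≡0⇒y≡0 a≢0 (trans (sym (ring-identity a b (π₁ x j) (π₁ c j) b≡0)) (relation j))
          where
          ring-identity : ∀ a b p r → b ≡ 0ℚ → a * p + (b * r + 0ℚ) ≡ a * p
          ring-identity a .0ℚ p r refl = polynomial-identity a p r
            where
            polynomial-identity : ∀ a p r → a * p + (0ℚ * r + 0ℚ) ≡ a * p
            polynomial-identity = solve-∀ ℚ-ring
      byCoefficient (no b≢0) = RepImage-resp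
        (normalForm-F₃∩W₂ x z m π₁z≗0 π₁m≗0 (proj₂ change indep)
          (Isotropic-resp (x ∷ z ∷ m ∷ []) (x ∷ z ∷ c ∷ []) (proj₁ change) iso))
        (SameSpan-refl (x ∷ z ∷ [])) (proj₁ change)
        where
        m-coefficients : Fin 3 → ℚ
        m-coefficients = a ∷ 0ℚ ∷ b ∷ []
        m : V
        m = lincomb m-coefficients (x ∷ z ∷ c ∷ [])
        π₁m≗0 : π₁ m ≗ 0ᵥ
        π₁m≗0 j = trans (π₁-lincomb m-coefficients (x ∷ z ∷ c ∷ []) j)
                        (trans (ring-identity a b (π₁ x j) (π₁ z j) (π₁ c j)) (relation j))
          where
          ring-identity : ∀ a b p q r → a * p + (0ℚ * q + (b * r + 0ℚ)) ≡ a * p + (b * r + 0ℚ)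
          ring-identity = solve-∀ ℚ-ring
        change : BasisChange (x ∷ z ∷ m ∷ []) (x ∷ z ∷ c ∷ [])
        change = basisChange₃ (x ∷ z ∷ c ∷ []) (x ∷ z ∷ m ∷ []) (δ 0F ∷ δ 1F ∷ m-coefficients ∷ [])
          (λ { 0F j → sym (lincomb-δ (x ∷ z ∷ c ∷ []) 0F j) ; 1F j → sym (lincomb-δ (x ∷ z ∷ c ∷ []) 1F j)
             ; 2F _ → refl })
          (≢0-by (det₃-lastRow a 0ℚ b) b≢0)

normalForm-F₂↠W₁ : ∀ x₀ x₁ c → ω₁ (π₁ x₁) (π₁ x₀) ≢ 0ℚ → LinIndep (x₀ ∷ x₁ ∷ c ∷ []) →
  Isotropic (x₀ ∷ x₁ ∷ c ∷ []) → RepImage (x₀ ∷ x₁ ∷ []) (x₀ ∷ x₁ ∷ c ∷ [])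
normalForm-F₂↠W₁ x₀ x₁ c μ≢0 indep iso = fromFrame
  (mixedFrame x₀ x₁ z π₁z≗0 (LinIndep⇒≢0 (x₀ ∷ x₁ ∷ z ∷ []) (proj₂ change indep) 2F) μ≢0
    (ω≡0 1F 0F) (ω≡0 0F 2F) (ω≡0 1F 2F))
  where
  α β s : ℚ
  α = ω₁ (π₁ x₁) (π₁ c)
  β = ω₁ (π₁ c) (π₁ x₀)
  s = ω₁ (π₁ x₀) (π₁ x₁)
  z-coefficients : Fin 3 → ℚ
  z-coefficients = α ∷ β ∷ s ∷ []
  z : V
  z = lincomb z-coefficients (x₀ ∷ x₁ ∷ c ∷ [])
  -- three vectors of the plane W₁ satisfy Cramer's relation
  π₁z≗0 : π₁ z ≗ 0ᵥ
  π₁z≗0 0F = cramer (π₁ x₀ 0F) (π₁ x₀ 1F) (π₁ x₁ 0F) (π₁ x₁ 1F) (π₁ c 0F) (π₁ c 1F)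
    where
    cramer : ∀ a₀ a₁ b₀ b₁ c₀ c₁ →
      (b₀ * c₁ - b₁ * c₀) * a₀ + ((c₀ * a₁ - c₁ * a₀) * b₀ + ((a₀ * b₁ - a₁ * b₀) * c₀ + 0ℚ)) ≡ 0ℚ
    cramer = solve-∀ ℚ-ring
  π₁z≗0 1F = cramer (π₁ x₀ 0F) (π₁ x₀ 1F) (π₁ x₁ 0F) (π₁ x₁ 1F) (π₁ c 0F) (π₁ c 1F)
    where
    cramer : ∀ a₀ a₁ b₀ b₁ c₀ c₁ →
      (b₀ * c₁ - b₁ * c₀) * a₁ + ((c₀ * a₁ - c₁ * a₀) * b₁ + ((a₀ * b₁ - a₁ * b₀) * c₁ + 0ℚ)) ≡ 0ℚ
    cramer = solve-∀ ℚ-ring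
  s≢0 : s ≢ 0ℚ
  s≢0 s≡0 = μ≢0 (trans (ω₁-antisym (π₁ x₁) (π₁ x₀)) (cong -_ s≡0))
  change : BasisChange (x₀ ∷ x₁ ∷ z ∷ []) (x₀ ∷ x₁ ∷ c ∷ [])
  change = basisChange₃ (x₀ ∷ x₁ ∷ c ∷ []) (x₀ ∷ x₁ ∷ z ∷ []) (δ 0F ∷ δ 1F ∷ z-coefficients ∷ [])
    (λ { 0F j → sym (lincomb-δ (x₀ ∷ x₁ ∷ c ∷ []) 0F j) ; 1F j → sym (lincomb-δ (x₀ ∷ x₁ ∷ c ∷ []) 1F j)
       ; 2F _ → refl })
    (≢0-by (det₃-lastRow α β s) s≢0)
  ω≡0 : ∀ i j → ω ((x₀ ∷ x₁ ∷ z ∷ []) i) ((x₀ ∷ x₁ ∷ z ∷ []) j) ≡ 0ℚ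
  ω≡0 = Isotropic⇒ω≡0 (x₀ ∷ x₁ ∷ z ∷ []) (Isotropic-resp (x₀ ∷ x₁ ∷ z ∷ []) (x₀ ∷ x₁ ∷ c ∷ []) (proj₁ change) iso)
  fromFrame : MixedFrame x₀ x₁ z → RepImage (x₀ ∷ x₁ ∷ []) (x₀ ∷ x₁ ∷ c ∷ [])
  fromFrame (h , f̂₁₂≗x₀ , ê₁₂≗x₁ , f̂₃≗z) =
    RepImage-resp (repImage-≗ 4F h (∷-≗₂ f̂₁₂≗x₀ ê₁₂≗x₁) (∷-≗₃ f̂₁₂≗x₀ ê₁₂≗x₁ f̂₃≗z))
      (SameSpan-refl (x₀ ∷ x₁ ∷ [])) (proj₁ change)

normalForm : ∀ x₀ x₁ c → LinIndep (x₀ ∷ x₁ ∷ c ∷ []) → Isotropic (x₀ ∷ x₁ ∷ c ∷ []) →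
  RepImage (x₀ ∷ x₁ ∷ []) (x₀ ∷ x₁ ∷ c ∷ [])
normalForm x₀ x₁ c indep iso = byPairing (ω₁ (π₁ x₁) (π₁ x₀) ≟ 0ℚ)
  where
  byPairing : Dec (ω₁ (π₁ x₁) (π₁ x₀) ≡ 0ℚ) → RepImage (x₀ ∷ x₁ ∷ []) (x₀ ∷ x₁ ∷ c ∷ [])
  byPairing (no μ≢0) = normalForm-F₂↠W₁ x₀ x₁ c μ≢0 indep iso
  byPairing (yes ω₁≡0) = fromRelation (ω₁-relation (π₁ x₀) (π₁ x₁) (ω₁-antisym₀ (π₁ x₁) (π₁ x₀) ω₁≡0))
    where
    fromRelation : ∃[ g₀ ] ∃[ g₁ ] ((g₀ ≢ 0ℚ ⊎ g₁ ≢ 0ℚ) × lincomb (g₀ ∷ g₁ ∷ []) (π₁ x₀ ∷ π₁ x₁ ∷ []) ≗ 0ᵥ) →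
      RepImage (x₀ ∷ x₁ ∷ []) (x₀ ∷ x₁ ∷ c ∷ [])
    fromRelation (g₀ , g₁ , nontrivial , relation) = byCoefficient (g₁ ≟ 0ℚ)
      where
      byCoefficient : Dec (g₁ ≡ 0ℚ) → RepImage (x₀ ∷ x₁ ∷ []) (x₀ ∷ x₁ ∷ c ∷ [])
      byCoefficient (no g₁≢0) = RepImage-resp
        (normalForm-F₂∩W₂ x₀ z c π₁z≗0 (proj₂ change₃ indep)
          (Isotropic-resp (x₀ ∷ z ∷ c ∷ []) (x₀ ∷ x₁ ∷ c ∷ []) (proj₁ change₃) iso))
        (proj₁ change₂) (proj₁ change₃)
        where
        z : V
        z = lincomb (g₀ ∷ g₁ ∷ []) (x₀ ∷ x₁ ∷ [])
        π₁z≗0 : π₁ z ≗ 0ᵥ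
        π₁z≗0 j = trans (π₁-lincomb (g₀ ∷ g₁ ∷ []) (x₀ ∷ x₁ ∷ []) j) (relation j)
        change₂ : BasisChange (x₀ ∷ z ∷ []) (x₀ ∷ x₁ ∷ [])
        change₂ = basisChange₂ (x₀ ∷ x₁ ∷ []) (x₀ ∷ z ∷ []) (δ 0F ∷ (g₀ ∷ g₁ ∷ []) ∷ [])
          (λ { 0F j → sym (lincomb-δ (x₀ ∷ x₁ ∷ []) 0F j) ; 1F _ → refl }) (≢0-by (det₂-lastRow g₀ g₁) g₁≢0)
        change₃ : BasisChange (x₀ ∷ z ∷ c ∷ []) (x₀ ∷ x₁ ∷ c ∷ [])
        change₃ = basisChange₃ (x₀ ∷ x₁ ∷ c ∷ []) (x₀ ∷ z ∷ c ∷ []) (δ 0F ∷ (g₀ ∷ g₁ ∷ 0ℚ ∷ []) ∷ δ 2F ∷ [])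
          (λ { 0F j → sym (lincomb-δ (x₀ ∷ x₁ ∷ c ∷ []) 0F j) ; 1F → lincomb-pad g₀ g₁ x₀ x₁ c
             ; 2F j → sym (lincomb-δ (x₀ ∷ x₁ ∷ c ∷ []) 2F j) })
          (≢0-by (det₃-middleRow g₀ g₁ 0ℚ) g₁≢0)
      byCoefficient (yes g₁≡0) = RepImage-resp
        (normalForm-F₂∩W₂ x₁ x₀ c π₁x₀≗0 (proj₂ swap₃ indep)
          (Isotropic-resp (x₁ ∷ x₀ ∷ c ∷ []) (x₀ ∷ x₁ ∷ c ∷ []) (proj₁ swap₃) iso))
        (proj₁ swap₂) (proj₁ swap₃)
        where
        g₀≢0 : g₀ ≢ 0ℚ
        g₀≢0 = [ id , (λ g₁≢0 → ⊥-elim (g₁≢0 g₁≡0)) ]′ nontrivial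
        π₁x₀≗0 : π₁ x₀ ≗ 0ᵥ
        π₁x₀≗0 j = x*y≡0⇒y≡0 g₀≢0 (trans (sym (ring-identity g₀ g₁ (π₁ x₀ j) (π₁ x₁ j) g₁≡0)) (relation j))
          where
          ring-identity : ∀ a b p r → b ≡ 0ℚ → a * p + (b * r + 0ℚ) ≡ a * p
          ring-identity a .0ℚ p r refl = polynomial-identity a p r
            where
            polynomial-identity : ∀ a p r → a * p + (0ℚ * r + 0ℚ) ≡ a * p
            polynomial-identity = solve-∀ ℚ-ring
        swap₂ : BasisChange (x₁ ∷ x₀ ∷ []) (x₀ ∷ x₁ ∷ [])
        swap₂ = basisChange₂ (x₀ ∷ x₁ ∷ []) (x₁ ∷ x₀ ∷ []) (δ 1F ∷ δ 0F ∷ [])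
          (λ { 0F j → sym (lincomb-δ (x₀ ∷ x₁ ∷ []) 1F j) ; 1F j → sym (lincomb-δ (x₀ ∷ x₁ ∷ []) 0F j) }) (λ ())
        swap₃ : BasisChange (x₁ ∷ x₀ ∷ c ∷ []) (x₀ ∷ x₁ ∷ c ∷ [])
        swap₃ = basisChange₃ (x₀ ∷ x₁ ∷ c ∷ []) (x₁ ∷ x₀ ∷ c ∷ []) (δ 1F ∷ δ 0F ∷ δ 2F ∷ [])
          (λ { 0F j → sym (lincomb-δ (x₀ ∷ x₁ ∷ c ∷ []) 1F j) ; 1F j → sym (lincomb-δ (x₀ ∷ x₁ ∷ c ∷ []) 0F j)
             ; 2F j → sym (lincomb-δ (x₀ ∷ x₁ ∷ c ∷ []) 2F j) }) (λ ())

dets≡0⇒minors≡0 : ∀ (u w : Vect 3) → (∀ k → det₃ (u ∷ w ∷ δ k ∷ []) ≡ 0ℚ) → ∀ i j → u i * w j ≡ u j * w i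
dets≡0⇒minors≡0 u w dets≡0 = minors
  where
  m₁₂ : u 1F * w 2F ≡ u 2F * w 1F
  m₁₂ = x∙y⁻¹≈ε⇒x≈y _ _ (trans (sym (ring-identity (u 0F) (u 1F) (u 2F) (w 0F) (w 1F) (w 2F))) (dets≡0 0F))
    where
    ring-identity : ∀ u₀ u₁ u₂ w₀ w₁ w₂ →
      u₀ * (w₁ * 0ℚ - w₂ * 0ℚ) - u₁ * (w₀ * 0ℚ - w₂ * 1ℚ) + u₂ * (w₀ * 0ℚ - w₁ * 1ℚ) ≡ u₁ * w₂ - u₂ * w₁
    ring-identity = solve-∀ ℚ-ring
  m₂₀ : u 2F * w 0F ≡ u 0F * w 2F
  m₂₀ = x∙y⁻¹≈ε⇒x≈y _ _ (trans (sym (ring-identity (u 0F) (u 1F) (u 2F) (w 0F) (w 1F) (w 2F))) (dets≡0 1F))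
    where
    ring-identity : ∀ u₀ u₁ u₂ w₀ w₁ w₂ →
      u₀ * (w₁ * 0ℚ - w₂ * 1ℚ) - u₁ * (w₀ * 0ℚ - w₂ * 0ℚ) + u₂ * (w₀ * 1ℚ - w₁ * 0ℚ) ≡ u₂ * w₀ - u₀ * w₂
    ring-identity = solve-∀ ℚ-ring
  m₀₁ : u 0F * w 1F ≡ u 1F * w 0F
  m₀₁ = x∙y⁻¹≈ε⇒x≈y _ _ (trans (sym (ring-identity (u 0F) (u 1F) (u 2F) (w 0F) (w 1F) (w 2F))) (dets≡0 2F))
    where
    ring-identity : ∀ u₀ u₁ u₂ w₀ w₁ w₂ →
      u₀ * (w₁ * 1ℚ - w₂ * 0ℚ) - u₁ * (w₀ * 1ℚ - w₂ * 0ℚ) + u₂ * (w₀ * 0ℚ - w₁ * 0ℚ) ≡ u₀ * w₁ - u₁ * w₀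
    ring-identity = solve-∀ ℚ-ring
  minors : ∀ i j → u i * w j ≡ u j * w i
  minors 0F 0F = refl
  minors 0F 1F = m₀₁
  minors 0F 2F = sym m₂₀
  minors 1F 0F = sym m₀₁
  minors 1F 1F = refl
  minors 1F 2F = m₁₂
  minors 2F 0F = m₂₀
  minors 2F 1F = sym m₁₂
  minors 2F 2F = refl

completeByUnitVector : ∀ (u w : Vect 3) → LinIndep (u ∷ w ∷ []) → ∃[ k ] (det₃ (u ∷ w ∷ δ k ∷ []) ≢ 0ℚ)
completeByUnitVector u w indep = byDeterminants (all? (λ k → det₃ (u ∷ w ∷ δ k ∷ []) ≟ 0ℚ))
  where
  byDeterminants : Dec (∀ k → det₃ (u ∷ w ∷ δ k ∷ []) ≡ 0ℚ) → ∃[ k ] (det₃ (u ∷ w ∷ δ k ∷ []) ≢ 0ℚ)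
  byDeterminants (no ¬dets≡0) = ¬∀⟶∃¬ 3 (λ k → det₃ (u ∷ w ∷ δ k ∷ []) ≡ 0ℚ) (λ k → det₃ (u ∷ w ∷ δ k ∷ []) ≟ 0ℚ) ¬dets≡0
  byDeterminants (yes dets≡0) =
    ⊥-elim (relation⇒¬independent (proj₁ (proj₂ (proj₂ relation))) (proj₂ (proj₂ (proj₂ relation))) indep)
    where
    relation : ∃[ a ] ∃[ b ] ((a ≢ 0ℚ ⊎ b ≢ 0ℚ) × lincomb (a ∷ b ∷ []) (u ∷ w ∷ []) ≗ 0ᵥ)
    relation = minors≡0⇒relation u w (dets≡0⇒minors≡0 u w dets≡0)

isotropicFlag-repImage : ∀ F → IsIsotropicFlag F → RepImage (F2 F) (F3 F)
isotropicFlag-repImage F (F₂-indep , F₃-indep , F₂⊆F₃ , F₃-iso) = RepImage-resp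
  (normalForm (F2 F 0F) (F2 F 1F) (F3 F k) (proj₂ change F₃-indep)
     (Isotropic-resp (F2 F 0F ∷ F2 F 1F ∷ F3 F k ∷ []) (F3 F) (proj₁ change) F₃-iso))
  (SameSpan-≗ {vs = F2 F 0F ∷ F2 F 1F ∷ []} {ws = F2 F} λ { 0F _ → refl ; 1F _ → refl }) (proj₁ change)
  where
  A₀ A₁ : Vect 3
  A₀ = proj₁ (F₂⊆F₃ 0F)
  A₁ = proj₁ (F₂⊆F₃ 1F)
  completion : ∃[ k ] (det₃ (A₀ ∷ A₁ ∷ δ k ∷ []) ≢ 0ℚ)
  completion = completeByUnitVector A₀ A₁
    (LinIndep-coefficients {vs = F2 F} {ws = F3 F} (A₀ ∷ A₁ ∷ []) (λ { 0F → proj₂ (F₂⊆F₃ 0F) ; 1F → proj₂ (F₂⊆F₃ 1F) }) F₂-indep)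
  k : Fin 3
  k = proj₁ completion
  change : BasisChange (F2 F 0F ∷ F2 F 1F ∷ F3 F k ∷ []) (F3 F)
  change = basisChange₃ (F3 F) (F2 F 0F ∷ F2 F 1F ∷ F3 F k ∷ []) (A₀ ∷ A₁ ∷ δ k ∷ [])
    (λ { 0F → proj₂ (F₂⊆F₃ 0F) ; 1F → proj₂ (F₂⊆F₃ 1F) ; 2F j → sym (lincomb-δ (F3 F) k j) }) (proj₂ completion)

lemma2p3 : ((i : Fin 5) → IsIsotropicFlag (rep i))
    × ((F : Flag) → IsIsotropicFlag F → ∃[ i ] SameHOrbit F (rep i))
    × ((i j : Fin 5) → i ≢ j → ¬ SameHOrbit (rep i) (rep j))
lemma2p3 = rep-isIsotropicFlag , (λ F F-isotropic → RepImage⇒SameHOrbit F (isotropicFlag-repImage F F-isotropic)) ,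
           rep-orbits-distinct
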